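{- Let $p\ge2$ and $n,k\ge0$. The number of elements of $\mathbb{F}_n^p$ having exactly $k$ lower covers equals the number of elements of $\mathbb{F}_n^p$ having exactly $k$ upper covers; equivalently, it is the coefficient of $x^ny^k$ in $$\frac{(1-x)\bigl(1+(y-1)x^p\bigr)}{1-2x+x^{p+1}-(y-1)\bigl(x^2-x^p+x^{p+1}-x^{p+2}\bigr)}.$$
   Context: A Dyck path of semilength $n\ge 0$ is a lattice path from $(0,0)$ to $(2n,0)$ with steps $U=(1,1)$ and $D=(1,-1)$ that never goes below the $x$-axis; it is identified with its word over $\{U,D\}$. A path avoids a pattern $\alpha$ if $\alpha$ does not occur as a factor (block of consecutive steps). For an integer $p\ge 2$, $\mathcal{F}_n^p$ is the set of Dyck paths of semilength $n$ avoiding $DUU$ and $D^{p+1}$, ordered by the Stanley order: $P\le Q$ iff $P$ lies weakly below $Q$ when both are drawn in the plane; $\mathbb{F}_n^p=(\mathcal{F}_n^p,\le)$. An upper (resp. lower) cover of $P$ is an element $Q>P$ (resp. $Q<P$) with no element strictly between $P$ and $Q$. -}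

module Defs where

open import Data.Nat as ℕ using (ℕ; zero; suc; _∸_)
open import Data.Integer as ℤ using (ℤ; +_; -[1+_])
open import Data.List using (List; []; _∷_; _++_; map; filter; length; replicate; scanl; foldr; concatMap)
open import Data.List.Relation.Binary.Pointwise using (Pointwise)
open import Data.List.Relation.Binary.Infix.Heterogeneous using (Infix)
open import Data.List.Relation.Unary.Any using (Any)
open import Data.Product using (_×_; _,_)
open import Relation.Binary.PropositionalEquality using (_≡_; _≢_)
open import Relation.Nullary using (¬_)

data Step : Set where
  U D : Step

δ : Step → ℤ
δ U = + 1
δ D = -[1+ 0 ]

heights : List Step → List ℤ
heights = scanl (λ h s → h ℤ.+ δ s) (+ 0)

endHeight : List Step → ℤ
endHeight = foldr (λ s h → δ s ℤ.+ h) (+ 0)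

IsDyck : ℕ → List Step → Set
IsDyck n w = (length w ≡ 2 ℕ.* n)
           × Data.List.Relation.Unary.All.All (λ h → + 0 ℤ.≤ h) (heights w)
           × (endHeight w ≡ + 0)
  where import Data.List.Relation.Unary.All

Occurs : List Step → List Step → Set
Occurs α w = Infix _≡_ α w

InF : ℕ → ℕ → List Step → Set
InF n p w = IsDyck n w
          × ¬ Occurs (D ∷ U ∷ U ∷ []) w
          × ¬ Occurs (replicate (suc p) D) w

_≼_ : List Step → List Step → Set
P ≼ Q = Pointwise ℤ._≤_ (heights P) (heights Q)

_≺_ : List Step → List Step → Set
P ≺ Q = P ≼ Q × P ≢ Q

open import Relation.Nullary using (Dec; yes; no; ¬?)
open import Relation.Nullary.Decidable using (_×-dec_)
import Data.List.Relation.Unary.All as All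
import Data.List.Relation.Unary.Any as AnyM
import Data.List.Relation.Binary.Pointwise as PW
import Data.List.Relation.Binary.Infix.Heterogeneous.Properties as InfP
import Data.List.Properties as LP

_≟S_ : (a b : Step) → Dec (a ≡ b)
U ≟S U = yes _≡_.refl
U ≟S D = no (λ ())
D ≟S U = no (λ ())
D ≟S D = yes _≡_.refl

occurs? : (α w : List Step) → Dec (Occurs α w)
occurs? = InfP.infix? _≟S_

isDyck? : (n : ℕ) (w : List Step) → Dec (IsDyck n w)
isDyck? n w = (length w ℕ.≟ 2 ℕ.* n)
         ×-dec (All.all? (λ h → + 0 ℤ.≤? h) (heights w)
         ×-dec (endHeight w ℤ.≟ + 0))

inF? : (n p : ℕ) (w : List Step) → Dec (InF n p w)
inF? n p w = isDyck? n w
        ×-dec (¬? (occurs? (D ∷ U ∷ U ∷ []) w)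
        ×-dec ¬? (occurs? (replicate (suc p) D) w))

≼? : (P Q : List Step) → Dec (P ≼ Q)
≼? P Q = PW.decidable ℤ._≤?_ (heights P) (heights Q)

≺? : (P Q : List Step) → Dec (P ≺ Q)
≺? P Q = ≼? P Q ×-dec ¬? (LP.≡-dec _≟S_ P Q)

words : ℕ → List (List Step)
words zero    = [] ∷ []
words (suc m) = map (U ∷_) (words m) ++ map (D ∷_) (words m)

𝓕 : ℕ → ℕ → List (List Step)
𝓕 n p = filter (inF? n p) (words (2 ℕ.* n))

IsLowerCoverOf : ℕ → ℕ → List Step → List Step → Set
IsLowerCoverOf n p Q P = Q ≺ P × ¬ Any (λ R → Q ≺ R × R ≺ P) (𝓕 n p)

IsUpperCoverOf : ℕ → ℕ → List Step → List Step → Set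
IsUpperCoverOf n p Q P = P ≺ Q × ¬ Any (λ R → P ≺ R × R ≺ Q) (𝓕 n p)

lowerCover? : (n p : ℕ) (Q P : List Step) → Dec (IsLowerCoverOf n p Q P)
lowerCover? n p Q P = ≺? Q P ×-dec ¬? (AnyM.any? (λ R → ≺? Q R ×-dec ≺? R P) (𝓕 n p))

upperCover? : (n p : ℕ) (Q P : List Step) → Dec (IsUpperCoverOf n p Q P)
upperCover? n p Q P = ≺? P Q ×-dec ¬? (AnyM.any? (λ R → ≺? P R ×-dec ≺? R Q) (𝓕 n p))

#lowerCovers : ℕ → ℕ → List Step → ℕ
#lowerCovers n p P = length (filter (λ Q → lowerCover? n p Q P) (𝓕 n p))

#upperCovers : ℕ → ℕ → List Step → ℕ
#upperCovers n p P = length (filter (λ Q → upperCover? n p Q P) (𝓕 n p))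

#withLower : ℕ → ℕ → ℕ → ℕ
#withLower p n k = length (filter (λ P → #lowerCovers n p P ℕ.≟ k) (𝓕 n p))

#withUpper : ℕ → ℕ → ℕ → ℕ
#withUpper p n k = length (filter (λ P → #upperCovers n p P ℕ.≟ k) (𝓕 n p))

-- Bivariate polynomials over ℤ in x, y (as lists of monomials c·xⁱyʲ)
-- and formal power series ℕ → ℕ → ℤ (coefficient of xⁿyᵏ)

Poly : Set
Poly = List (ℤ × ℕ × ℕ)

cst : ℤ → Poly
cst c = (c , 0 , 0) ∷ []

X Y : Poly
X = (+ 1 , 1 , 0) ∷ []
Y = (+ 1 , 0 , 1) ∷ []

_⊕_ : Poly → Poly → Poly
f ⊕ g = f ++ g

⊖_ : Poly → Poly
⊖ f = map (λ { (c , i , j) → (ℤ.- c , i , j) }) f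

_⊝_ : Poly → Poly → Poly
f ⊝ g = f ⊕ (⊖ g)

_⊛_ : Poly → Poly → Poly
f ⊛ g = concatMap (λ { (c , i , j) → map (λ { (d , k , l) → (c ℤ.* d , i ℕ.+ k , j ℕ.+ l) }) g }) f

_^^_ : Poly → ℕ → Poly
f ^^ zero  = cst (+ 1)
f ^^ suc m = f ⊛ (f ^^ m)

infixl 6 _⊕_ _⊝_
infixl 7 _⊛_
infixr 8 _^^_

Series : Set
Series = ℕ → ℕ → ℤ

coeffP : Poly → ℕ → ℕ → ℤ
coeffP [] n k = + 0
coeffP ((c , i , j) ∷ f) n k with i ℕ.≟ n | j ℕ.≟ k
... | yes _ | yes _ = c ℤ.+ coeffP f n k
... | _     | _     = coeffP f n k

coeffMul : Poly → Series → ℕ → ℕ → ℤ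
coeffMul [] A n k = + 0
coeffMul ((c , i , j) ∷ f) A n k with i ℕ.≤? n | j ℕ.≤? k
... | yes _ | yes _ = c ℤ.* A (n ∸ i) (k ∸ j) ℤ.+ coeffMul f A n k
... | _     | _     = coeffMul f A n k

-- A is the power series expansion of the rational function num/den
-- (den has constant term 1, so this determines A uniquely): den · A = num
IsExpansionOf : Series → Poly → Poly → Set
IsExpansionOf A num den = ∀ n k → coeffMul den A n k ≡ coeffP num n k

numer : ℕ → Poly
numer p = (cst (+ 1) ⊝ X) ⊛ (cst (+ 1) ⊕ (Y ⊝ cst (+ 1)) ⊛ X ^^ p)

denom : ℕ → Poly
denom p = cst (+ 1) ⊝ cst (+ 2) ⊛ X ⊕ X ^^ suc p
        ⊝ (Y ⊝ cst (+ 1)) ⊛ (X ^^ 2 ⊝ X ^^ p ⊕ X ^^ suc p ⊝ X ^^ (2 ℕ.+ p))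

-- Every element of 𝓕ₙᵖ is U^(1 + Σ (fᵢ − 1)) D^f₁ U D^f₂ ⋯ U D^fₘ for a unique composition
-- (f₁, …, fₘ) of n with parts in [1, p]: avoiding DUU makes every ascent after the first a single
-- U, and avoiding D^(p+1) bounds the descents. A cover in the Stanley order turns one peak UD into a
-- valley DU (or back), and such a swap stays in 𝓕ₙᵖ iff a condition on two neighbouring parts holds;
-- moreover every element strictly below (above) a path lies below (above) one of these swaps. So
-- the numbers of lower and upper covers are statistics on compositions. Removing the first part
-- gives linear equations for their bivariate generating functions; multiplying by Δ, where the
-- denominator of the theorem is (1 − x) Δ, turns both series into the same polynomial, and since Δ
-- has constant term 1 the two series are equal.

module Submission where

open import Defs
open import Data.Nat as ℕ using (ℕ; zero; suc; _+_; _*_; _∸_; _≤_; _<_; s≤s; z≤n)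
import Data.Nat.Properties as NP
open import Data.Nat.Properties using (+-assoc; +-comm; +-suc; suc-injective)
open import Data.Nat.ListAction using (sum)
open import Data.Nat.Solver using (module +-*-Solver)
open import Data.Integer as ℤ using (ℤ; +_; -[1+_])
import Data.Integer.Properties as ZP
open import Data.Integer.Tactic.RingSolver using (solve-∀)
open import Data.Bool using (Bool; true; false; _∧_; not; T)
import Data.Bool.Properties as BP
open import Data.Bool.Properties using (T-≡)
open import Data.Empty using (⊥; ⊥-elim)
open import Data.Unit using (⊤; tt)
open import Data.Product using (Σ; _×_; _,_; proj₁; proj₂)
import Data.Product
open import Data.Sum using (_⊎_; inj₁; inj₂)
import Data.Sum
open import Data.List using (List; []; _∷_; _++_; map; filter; length; replicate; scanl)
import Data.List.Properties as LP
open import Data.List.Relation.Unary.All as All using (All; []; _∷_)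
import Data.List.Relation.Unary.All.Properties as AllP
open import Data.List.Relation.Unary.Any using (Any; here; there)
open import Data.List.Relation.Unary.AllPairs using ([]; _∷_)
open import Data.List.Relation.Unary.Unique.Propositional using (Unique)
import Data.List.Relation.Unary.Unique.Propositional.Properties as UP
open import Data.List.Relation.Binary.Pointwise using (Pointwise; []; _∷_)
open import Data.List.Relation.Binary.Infix.Heterogeneous using (here; there; _++ⁱ_)
open import Data.List.Relation.Binary.Prefix.Heterogeneous using (Prefix; []; _∷_)
open import Data.List.Membership.Propositional using (_∈_; find; lose)
import Data.List.Membership.Propositional.Properties as MP
import Data.List.Relation.Binary.Permutation.Propositional.Properties as PP
open import Data.List.Relation.Binary.Permutation.Propositional using (_↭_)
open import Data.List.Relation.Binary.BagAndSetEquality using (∼bag⇒↭)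
open import Data.List.Membership.Propositional.Properties.WithK using (unique∧set⇒bag)
open import Function.Bundles using (Equivalence; mk⇔)
open import Relation.Binary.PropositionalEquality
open import Relation.Nullary using (yes; no; does; ¬_)
open import Relation.Nullary.Decidable using (does-⇔)
open import Relation.Unary using (Pred; Decidable)
open import Data.Nat.Induction using (<-rec)
open import Function using (_∘_)
open import Level using (0ℓ)

-- Walks and the Stanley order

Ds Us : ℕ → List Step
Ds n = replicate n D
Us n = replicate n U

-- Walk h w : w leads from height h down to height 0 without going below 0.
data Walk : ℕ → List Step → Set where
  wnil : Walk 0 []
  wU   : ∀ {h w} → Walk (suc h) w → Walk h (U ∷ w)
  wD   : ∀ {h w} → Walk h w → Walk (suc h) (D ∷ w)

-- Below h g Q P : Q is a walk from height h, P a walk from height h + 2g,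
-- and Q stays weakly below P (two walks on the same steps differ by an even amount).
data Below : ℕ → ℕ → List Step → List Step → Set where
  bnil : Below 0 0 [] []
  bUU  : ∀ {h g Q P} → Below (suc h) g Q P → Below h g (U ∷ Q) (U ∷ P)
  bDD  : ∀ {h g Q P} → Below h g Q P → Below (suc h) g (D ∷ Q) (D ∷ P)
  bDU  : ∀ {h g Q P} → Below h (suc g) Q P → Below (suc h) g (D ∷ Q) (U ∷ P)
  bUD  : ∀ {h g Q P} → Below (suc h) g Q P → Below h (suc g) (U ∷ Q) (D ∷ P)

heightsFrom : ℤ → List Step → List ℤ
heightsFrom = scanl (λ h s → h ℤ.+ δ s)

NonNeg : List ℤ → Set
NonNeg = All (+ 0 ℤ.≤_)

+1≡suc : ∀ h → + h ℤ.+ δ U ≡ + suc h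
+1≡suc h = cong +_ (+-comm h 1)

endHeight-U : ∀ h w → + h ℤ.+ endHeight (U ∷ w) ≡ + suc h ℤ.+ endHeight w
endHeight-U h w = trans (sym (ZP.+-assoc (+ h) (+ 1) (endHeight w))) (cong (ℤ._+ endHeight w) (+1≡suc h))

endHeight-D : ∀ h w → + suc h ℤ.+ endHeight (D ∷ w) ≡ + h ℤ.+ endHeight w
endHeight-D h w = sym (ZP.+-assoc (+ suc h) -[1+ 0 ] (endHeight w))

Walk⇒heights : ∀ {h w} → Walk h w → NonNeg (heightsFrom (+ h) w) × (+ h ℤ.+ endHeight w ≡ + 0)
Walk⇒heights wnil = (ℤ.+≤+ z≤n ∷ []) , refl
Walk⇒heights {h} {U ∷ w} (wU k) =
  let nonNeg , end = Walk⇒heights k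
  in (ℤ.+≤+ z≤n ∷ subst (λ c → NonNeg (heightsFrom c w)) (sym (+1≡suc h)) nonNeg) , trans (endHeight-U h w) end
Walk⇒heights {suc h} {D ∷ w} (wD k) =
  let nonNeg , end = Walk⇒heights k
  in (ℤ.+≤+ z≤n ∷ nonNeg) , trans (endHeight-D h w) end

heights⇒Walk : ∀ h w → NonNeg (heightsFrom (+ h) w) → + h ℤ.+ endHeight w ≡ + 0 → Walk h w
heights⇒Walk zero    []      _              _   = wnil
heights⇒Walk (suc h) []      _              ()
heights⇒Walk h       (U ∷ w) (_ ∷ nonNeg)   end =
  wU (heights⇒Walk (suc h) w (subst (λ c → NonNeg (heightsFrom c w)) (+1≡suc h) nonNeg) (trans (sym (endHeight-U h w)) end))
heights⇒Walk zero    (D ∷ w) (_ ∷ () ∷ _)   _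
heights⇒Walk (suc h) (D ∷ w) (_ ∷ nonNeg)   end = wD (heights⇒Walk h w nonNeg (trans (sym (endHeight-D h w)) end))

IsDyck⇒Walk : ∀ {n w} → IsDyck n w → Walk 0 w
IsDyck⇒Walk {w = w} (_ , nonNeg , end) = heights⇒Walk 0 w nonNeg (trans (ZP.+-identityˡ (endHeight w)) end)

Walk⇒IsDyck : ∀ {n w} → length w ≡ 2 * n → Walk 0 w → IsDyck n w
Walk⇒IsDyck {w = w} len k =
  len , proj₁ (Walk⇒heights k) , trans (sym (ZP.+-identityˡ (endHeight w))) (proj₂ (Walk⇒heights k))

h+2[1+g] : ∀ h g → h + 2 * suc g ≡ suc (suc h + 2 * g)
h+2[1+g] h g = solve 2 (λ h g → h :+ con 2 :* (con 1 :+ g) := con 2 :+ h :+ con 2 :* g) refl h g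
  where open +-*-Solver

Below⇒≤heights : ∀ {h g Q P} → Below h g Q P → Pointwise ℤ._≤_ (heightsFrom (+ h) Q) (heightsFrom (+ (h + 2 * g)) P)
Below⇒≤heights bnil = ℤ.+≤+ z≤n ∷ []
Below⇒≤heights {h} {g} {U ∷ Q} {U ∷ P} (bUU b) =
  ℤ.+≤+ (NP.m≤m+n h (2 * g)) ∷
  subst₂ (λ c d → Pointwise ℤ._≤_ (heightsFrom c Q) (heightsFrom d P)) (sym (+1≡suc h)) (sym (+1≡suc (h + 2 * g)))
      (Below⇒≤heights b)
Below⇒≤heights {suc h} {g} (bDD b) = ℤ.+≤+ (NP.m≤m+n (suc h) (2 * g)) ∷ Below⇒≤heights b
Below⇒≤heights {suc h} {g} {D ∷ Q} {U ∷ P} (bDU b) =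
  ℤ.+≤+ (NP.m≤m+n (suc h) (2 * g)) ∷
  subst (λ d → Pointwise ℤ._≤_ (heightsFrom (+ h) Q) (heightsFrom d P))
        (trans (cong +_ (h+2[1+g] h g)) (sym (+1≡suc (suc h + 2 * g)))) (Below⇒≤heights b)
Below⇒≤heights {h} {suc g} {U ∷ Q} {D ∷ P} (bUD b) =
  ℤ.+≤+ (NP.m≤m+n h (2 * suc g)) ∷
  subst₂ (λ c d → Pointwise ℤ._≤_ (heightsFrom c Q) (heightsFrom d P))
         (sym (+1≡suc h)) (sym (cong (λ x → + x ℤ.+ δ D) (h+2[1+g] h g))) (Below⇒≤heights b)

≤heights⇒Below : ∀ {h h' g Q P} → Walk h Q → Walk h' P → h' ≡ h + 2 * g →
                 Pointwise ℤ._≤_ (heightsFrom (+ h) Q) (heightsFrom (+ h') P) → Below h g Q P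
≤heights⇒Below {g = zero}  wnil wnil _  _ = bnil
≤heights⇒Below {g = suc g} wnil wnil () _
≤heights⇒Below wnil (wU _) _ (_ ∷ ())
≤heights⇒Below wnil (wD _) _ (_ ∷ ())
≤heights⇒Below (wU _) wnil _ (_ ∷ ())
≤heights⇒Below (wD _) wnil _ (_ ∷ ())
≤heights⇒Below {h} {h'} {Q = U ∷ Q} {U ∷ P} (wU kq) (wU kp) e (_ ∷ le) =
  bUU (≤heights⇒Below kq kp (cong suc e) (subst₂ (λ c d → Pointwise ℤ._≤_ (heightsFrom c Q) (heightsFrom d P)) (+1≡suc h)
      (+1≡suc h') le))
≤heights⇒Below (wD kq) (wD kp) e (_ ∷ le) = bDD (≤heights⇒Below kq kp (suc-injective e) le)
≤heights⇒Below {suc h} {h'} {g} {D ∷ Q} {U ∷ P} (wD kq) (wU kp) e (_ ∷ le) =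
  bDU (≤heights⇒Below kq kp (trans (cong suc e) (sym (h+2[1+g] h g)))
                      (subst (λ d → Pointwise ℤ._≤_ (heightsFrom (+ h) Q) (heightsFrom d P)) (+1≡suc h') le))
≤heights⇒Below {h} {suc h'} {zero} {U ∷ Q} {D ∷ P} (wU _) (wD _) e (_ ∷ x ∷ _) =
  ⊥-elim (NP.1+n≰n (NP.≤-trans (NP.n≤1+n _) (subst (λ z → suc z ≤ h') h≡1+h' (ZP.drop‿+≤+ (subst (ℤ._≤ + h') (+1≡suc h) x)))))
  where
  h≡1+h' : h ≡ suc h'
  h≡1+h' = sym (trans e (NP.+-identityʳ h))
≤heights⇒Below {h} {suc h'} {suc g} {U ∷ Q} {D ∷ P} (wU kq) (wD kp) e (_ ∷ le) =
  bUD (≤heights⇒Below kq kp (suc-injective (trans e (h+2[1+g] h g)))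
                      (subst (λ c → Pointwise ℤ._≤_ (heightsFrom c Q) (heightsFrom (+ h') P)) (+1≡suc h) le))

Ds-snoc : ∀ k (X : List Step) → Ds k ++ D ∷ X ≡ D ∷ Ds k ++ X
Ds-snoc zero    X = refl
Ds-snoc (suc k) X = cong (D ∷_) (Ds-snoc k X)

Us-snoc : ∀ k (X : List Step) → Us k ++ U ∷ X ≡ U ∷ Us k ++ X
Us-snoc zero    X = refl
Us-snoc (suc k) X = cong (U ∷_) (Us-snoc k X)

Ds-++ : ∀ a b (X : List Step) → Ds a ++ Ds b ++ X ≡ Ds (a + b) ++ X
Ds-++ zero    b X = refl
Ds-++ (suc a) b X = cong (D ∷_) (Ds-++ a b X)

Walk-Ds : ∀ f {h X} → Walk h X → Walk (f + h) (Ds f ++ X)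
Walk-Ds zero    k = k
Walk-Ds (suc f) k = wD (Walk-Ds f k)

Walk-Us : ∀ a {h X} → Walk (a + h) X → Walk h (Us a ++ X)
Walk-Us zero    k = k
Walk-Us (suc a) {h} {X} k = wU (Walk-Us a (subst (λ x → Walk x X) (sym (+-suc a h)) k))

Walk-Us⁻ : ∀ a {h X} → Walk h (Us a ++ X) → Walk (a + h) X
Walk-Us⁻ zero    k = k
Walk-Us⁻ (suc a) {h} {X} (wU k) = subst (λ x → Walk x X) (+-suc a h) (Walk-Us⁻ a k)

Walk-suffix : ∀ (A : List Step) {h B} → Walk h (A ++ B) → Σ ℕ λ h' → Walk h' B
Walk-suffix []      {h} k = h , k
Walk-suffix (U ∷ A) (wU k) = Walk-suffix A k
Walk-suffix (D ∷ A) (wD k) = Walk-suffix A k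

Walk-height-unique : ∀ {h h' X} → Walk h X → Walk h' X → h ≡ h'
Walk-height-unique wnil   wnil   = refl
Walk-height-unique (wU a) (wU b) = suc-injective (Walk-height-unique a b)
Walk-height-unique (wD a) (wD b) = cong suc (Walk-height-unique a b)

¬Walk-++U : ∀ (A : List Step) {h} → ¬ Walk h (A ++ U ∷ [])
¬Walk-++U []      (wU ())
¬Walk-++U (U ∷ A) (wU k) = ¬Walk-++U A k
¬Walk-++U (D ∷ A) (wD k) = ¬Walk-++U A k

Below-refl : ∀ {h Y} → Walk h Y → Below h 0 Y Y
Below-refl wnil   = bnil
Below-refl (wU k) = bUU (Below-refl k)
Below-refl (wD k) = bDD (Below-refl k)

Below-antisym : ∀ {h A B} → Below h 0 A B → Below h 0 B A → A ≡ B
Below-antisym bnil    bnil    = refl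
Below-antisym (bUU a) (bUU b) = cong (U ∷_) (Below-antisym a b)
Below-antisym (bDD a) (bDD b) = cong (D ∷_) (Below-antisym a b)

Below-prefix : ∀ X {h A B} → Walk h (X ++ A) → (∀ {h'} → Walk h' A → Below h' 0 A B) → Below h 0 (X ++ A) (X ++ B)
Below-prefix []      k below = below k
Below-prefix (U ∷ X) (wU k) below = bUU (Below-prefix X k below)
Below-prefix (D ∷ X) (wD k) below = bDD (Below-prefix X k below)

Below-valley-peak : ∀ X Y {h} → Walk h (X ++ D ∷ U ∷ Y) → Below h 0 (X ++ D ∷ U ∷ Y) (X ++ U ∷ D ∷ Y)
Below-valley-peak X Y k = Below-prefix X k (λ { (wD (wU k')) → bDU (bUD (Below-refl k')) })

Below-squeeze : ∀ X Y {h R} → Below h 0 (X ++ D ∷ U ∷ Y) R → Below h 0 R (X ++ U ∷ D ∷ Y) →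
                R ≡ X ++ D ∷ U ∷ Y ⊎ R ≡ X ++ U ∷ D ∷ Y
Below-squeeze []      Y (bDD (bUU a)) (bDU (bUD b)) = inj₁ (cong (λ z → D ∷ U ∷ z) (Below-antisym b a))
Below-squeeze []      Y (bDU (bUD a)) (bUU (bDD b)) = inj₂ (cong (λ z → U ∷ D ∷ z) (Below-antisym b a))
Below-squeeze (U ∷ X) Y (bUU a) (bUU b) = Data.Sum.map (cong (U ∷_)) (cong (U ∷_)) (Below-squeeze X Y a b)
Below-squeeze (D ∷ X) Y (bDD a) (bDD b) = Data.Sum.map (cong (D ∷_)) (cong (D ∷_)) (Below-squeeze X Y a b)

++-D≢++-U : ∀ X {Y Z} → X ++ D ∷ Y ≢ X ++ U ∷ Z
++-D≢++-U []      ()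
++-D≢++-U (x ∷ X) e = ++-D≢++-U X (LP.∷-injectiveʳ e)

NoDUU NoUU : List Step → Set
NoDUU X = ¬ Occurs (D ∷ U ∷ U ∷ []) X
NoUU X = ¬ Occurs (U ∷ U ∷ []) X

NotD : List Step → Set
NotD [] = ⊤
NotD (U ∷ _) = ⊤
NotD (D ∷ _) = ⊥

NotU : List Step → Set
NotU [] = ⊤
NotU (D ∷ _) = ⊤
NotU (U ∷ _) = ⊥

Occurs-tail : ∀ {x α X} → Occurs (x ∷ α) X → Occurs α X
Occurs-tail (here (_ ∷ pr)) = there (here pr)
Occurs-tail (there o) = there (Occurs-tail o)

Prefix-Ds : ∀ m k X → m ≤ k → Prefix _≡_ (Ds m) (Ds k ++ X)
Prefix-Ds zero k X _ = []
Prefix-Ds (suc m) (suc k) X (s≤s le) = refl ∷ Prefix-Ds m k X le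

¬Prefix-Ds : ∀ m k X → k < m → NotD X → Prefix _≡_ (Ds m) (Ds k ++ X) → ⊥
¬Prefix-Ds (suc m) zero [] _ _ ()
¬Prefix-Ds (suc m) zero (U ∷ X) _ _ (() ∷ _)
¬Prefix-Ds (suc m) (suc k) X (s≤s lt) nd (_ ∷ pr) = ¬Prefix-Ds m k X lt nd pr

NoDUU-Us : ∀ a X → NoUU X → NoDUU (Us a ++ X)
NoDUU-Us zero X noUU o = noUU (Occurs-tail o)
NoDUU-Us (suc a) X noUU (here (() ∷ _))
NoDUU-Us (suc a) X noUU (there o) = NoDUU-Us a X noUU o

NoUU-tail : ∀ {x X} → NoUU (x ∷ X) → NoUU X
NoUU-tail noUU o = noUU (there o)

NoDUU⇒NoUU-tail : ∀ X → NoDUU (D ∷ X) → NoUU X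
NoDUU⇒NoUU-tail (U ∷ U ∷ X) nd o = nd (here (refl ∷ (refl ∷ (refl ∷ []))))
NoDUU⇒NoUU-tail (U ∷ D ∷ X) nd (here (_ ∷ (() ∷ _)))
NoDUU⇒NoUU-tail (U ∷ D ∷ X) nd (there (here (() ∷ _)))
NoDUU⇒NoUU-tail (U ∷ D ∷ X) nd (there (there o)) = NoDUU⇒NoUU-tail X (λ o' → nd (there (there o'))) o
NoDUU⇒NoUU-tail (D ∷ X) nd (here (() ∷ _))
NoDUU⇒NoUU-tail (D ∷ X) nd (there o) = NoDUU⇒NoUU-tail X (λ o' → nd (there o')) o
NoDUU⇒NoUU-tail [] nd (here ())
NoDUU⇒NoUU-tail (U ∷ []) nd (here (_ ∷ ()))
NoDUU⇒NoUU-tail (U ∷ []) nd (there (here ()))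

splitUs : ∀ P → Σ ℕ λ a → Σ (List Step) λ R → (P ≡ Us a ++ R) × NotU R
splitUs [] = 0 , [] , refl , tt
splitUs (D ∷ P) = 0 , D ∷ P , refl , tt
splitUs (U ∷ P) with splitUs P
... | a , R , e , noUU = suc a , R , cong (U ∷_) e , noUU

Swap : Step → Step → List Step → List Step → Set
Swap a b A B = Σ (List Step) λ X → Σ (List Step) λ Y → (A ≡ X ++ a ∷ b ∷ Y) × (B ≡ X ++ b ∷ a ∷ Y)

Swap-++ : ∀ {a b A B} Z → Swap a b A B → Swap a b (Z ++ A) (Z ++ B)
Swap-++ Z (X , Y , refl , refl) = Z ++ X , Y , sym (LP.++-assoc Z X _) , sym (LP.++-assoc Z X _)

Swap-∷ : ∀ {a b A B} c → Swap a b A B → Swap a b (c ∷ A) (c ∷ B)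
Swap-∷ c = Swap-++ (c ∷ [])

Swap-length : ∀ {a b A B} → Swap a b A B → length A ≡ length B
Swap-length {a} {b} (X , Y , refl , refl) = trans (LP.length-++ X) (sym (LP.length-++ X))

StartsD : List Step → Set
StartsD (D ∷ _) = ⊤
StartsD _ = ⊥

PeakLowerable : ℕ → List Step → Set
PeakLowerable g Q = 1 ≤ g ⊎ StartsD Q

lower-peak : ∀ {h g Q R} → Below h g Q (U ∷ D ∷ R) → PeakLowerable g Q → Below h g Q (D ∷ U ∷ R)
lower-peak (bUU (bUD b)) _ = bUD (bUU b)
lower-peak (bUU (bDD b)) (inj₁ (s≤s z≤n)) = bUD (bDU b)
lower-peak (bUU (bDD b)) (inj₂ ())
lower-peak (bDU (bUD b)) _ = bDD (bUU b)
lower-peak (bDU (bDD b)) _ = bDD (bDU b)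

NoUU-D∷ : ∀ {X} → NoUU X → NoUU (D ∷ X)
NoUU-D∷ noUU (here (() ∷ _))
NoUU-D∷ noUU (there o) = noUU o

NoDUU-tail : ∀ {x X} → NoDUU (x ∷ X) → NoDUU X
NoDUU-tail noUU o = noUU (there o)

¬lower-final-peak : ∀ {h g Q} → Below h g Q (U ∷ D ∷ []) → PeakLowerable g Q → ⊥
¬lower-final-peak (bUU (bDD bnil)) (inj₁ ())
¬lower-final-peak (bUU (bDD bnil)) (inj₂ ())
¬lower-final-peak (bUU (bUD ()))
¬lower-final-peak (bDU (bUD ()))
¬lower-final-peak (bDU (bDD ()))

skip-peak : ∀ {h g R Q} → Below h g Q (U ∷ D ∷ U ∷ R) → PeakLowerable g Q → NoUU Q →
  Σ ℕ λ h2 → Σ ℕ λ g2 → Σ (List Step) λ Q'' → Below h2 g2 Q'' (U ∷ R) × PeakLowerable g2 Q'' × NoUU Q'' ×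
  (∀ {X} → Below h2 g2 Q'' X → Below h g Q (U ∷ D ∷ X))
skip-peak (bUU (bDD b)) (inj₁ 1≤g) noUU = _ , _ , _ , b , inj₁ 1≤g , NoUU-tail (NoUU-tail noUU) , λ b' → bUU (bDD b')
skip-peak (bUU (bDD b)) (inj₂ ()) noUU
skip-peak (bUU (bUD b)) pk noUU = ⊥-elim (noUU (here (refl ∷ (refl ∷ []))))
skip-peak (bDU (bDD b)) pk noUU = _ , _ , _ , b , inj₁ (s≤s z≤n) , NoUU-tail (NoUU-tail noUU) , λ b' → bDU (bDD b')
skip-peak {Q = D ∷ U ∷ D ∷ Q₃} (bDU (bUD b)) pk noUU = _ , _ , _ , b , inj₂ tt , NoUU-tail (NoUU-tail noUU) , λ b' → bDU (bUD b')
skip-peak {Q = D ∷ U ∷ U ∷ Q₃} (bDU (bUD b)) pk noUU = ⊥-elim (noUU (there (here (refl ∷ (refl ∷ [])))))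
skip-peak {Q = D ∷ U ∷ []} (bDU (bUD ())) pk noUU

StartsU : List Step → Set
StartsU (U ∷ _) = ⊤
StartsU _ = ⊥

ValleyRaisable : ℕ → List Step → Set
ValleyRaisable g Q = 1 ≤ g ⊎ StartsU Q

-- P' is weakly below the suffix Q' of Q, with its first valley raisable there, and whatever
-- replaces P' below Q' gives, after the prefix k, a path below Q.
record Resumable (h g : ℕ) (P' Q : List Step) (k : List Step → List Step) : Set where
  constructor resumable
  field
    {h' g'}  : ℕ
    Q₁ Q'    : List Step
    split    : Q ≡ Q₁ ++ Q'
    below    : Below h' g' P' Q'
    raisable : ValleyRaisable g' Q'
    resume   : ∀ {X} → Below h' g' X Q' → Below h g (k X) Q

raise-valley : ∀ {h g R Q} → Below h g (D ∷ U ∷ R) Q → ValleyRaisable g Q → Below h g (U ∷ D ∷ R) Q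
raise-valley (bDU (bUU b)) _ = bUU (bDU b)
raise-valley (bDU (bUD b)) _ = bUU (bDD b)
raise-valley (bDD (bUU b)) (inj₁ (s≤s z≤n)) = bUD (bDU b)
raise-valley (bDD (bUU b)) (inj₂ ())
raise-valley (bDD (bUD b)) _ = bUD (bDD b)

¬raise-final-valley : ∀ {h g Q} → Below h g (D ∷ []) Q → ValleyRaisable g Q → ⊥
¬raise-final-valley (bDD bnil) (inj₁ ())
¬raise-final-valley (bDD bnil) (inj₂ ())
¬raise-final-valley (bDU ())

descend-Ds : ∀ k {h g P' Q} → Below h g (Ds k ++ P') Q →
  Σ ℕ λ h' → Σ ℕ λ g' → Σ (List Step) λ Q1 → Σ (List Step) λ Q' → (Q ≡ Q1 ++ Q') × Below h' g' P' Q' ×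
  (1 ≤ g' ⊎ (Q1 ≡ Ds k × g' ≡ g)) × (∀ {X} → Below h' g' X Q' → Below h g (Ds k ++ X) Q)
descend-Ds zero b = _ , _ , [] , _ , refl , b , inj₂ (refl , refl) , λ b' → b'
descend-Ds (suc k) (bDU b) with descend-Ds k b
... | h' , g' , Q1 , Q' , refl , b' , c , rb = h' , g' , U ∷ Q1 , Q' , refl , b' , inj₁ (c1 c) , λ x → bDU (rb x)
  where
  c1 : ∀ {g'' g0} → (1 ≤ g'' ⊎ (Q1 ≡ Ds k × g'' ≡ suc g0)) → 1 ≤ g''
  c1 (inj₁ x) = x
  c1 (inj₂ (_ , refl)) = s≤s z≤n
descend-Ds (suc k) (bDD b) with descend-Ds k b
... | h' , g' , Q1 , Q' , refl , b' , inj₁ x , rb = h' , g' , D ∷ Q1 , Q' , refl , b' , inj₁ x , λ y → bDD (rb y)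
... | h' , g' , Q1 , Q' , refl , b' , inj₂ (refl , refl) , rb = h' , g' , D ∷ Q1 , Q' , refl , b' , inj₂ (refl , refl) , λ y → bDD
    (rb y)

-- The elements of 𝓕 n p and the covers given by a single swap

∈-words : ∀ w → w ∈ words (length w)
∈-words []      = here refl
∈-words (U ∷ w) = MP.∈-++⁺ˡ (MP.∈-map⁺ (U ∷_) (∈-words w))
∈-words (D ∷ w) = MP.∈-++⁺ʳ (map (U ∷_) (words (length w))) (MP.∈-map⁺ (D ∷_) (∈-words w))

words-unique : ∀ m → Unique (words m)
words-unique zero    = [] ∷ []
words-unique (suc m) = UP.++⁺ (UP.map⁺ LP.∷-injectiveʳ (words-unique m)) (UP.map⁺ LP.∷-injectiveʳ (words-unique m)) disjoint
  where
  disjoint : ∀ {v} → ¬ (v ∈ map (U ∷_) (words m) × v ∈ map (D ∷_) (words m))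
  disjoint (a , b) with MP.∈-map⁻ (U ∷_) a | MP.∈-map⁻ (D ∷_) b
  ... | _ , _ , refl | _ , _ , ()

module _ {n p : ℕ} where

  𝓕-unique : Unique (𝓕 n p)
  𝓕-unique = UP.filter⁺ (inF? n p) (words-unique (2 * n))

  ∈𝓕⇒InF : ∀ {Q} → Q ∈ 𝓕 n p → InF n p Q
  ∈𝓕⇒InF mem = proj₂ (MP.∈-filter⁻ (inF? n p) {xs = words (2 * n)} mem)

  InF⇒∈𝓕 : ∀ {Q} → InF n p Q → Q ∈ 𝓕 n p
  InF⇒∈𝓕 {Q} inF = MP.∈-filter⁺ (inF? n p) (subst (λ m → Q ∈ words m) (proj₁ (proj₁ inF)) (∈-words Q)) inF

  ∈𝓕⇒Walk : ∀ {Q} → Q ∈ 𝓕 n p → Walk 0 Q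
  ∈𝓕⇒Walk mem = IsDyck⇒Walk {n} (proj₁ (∈𝓕⇒InF mem))

  ≼⇒Below : ∀ {Q P} → Q ∈ 𝓕 n p → P ∈ 𝓕 n p → Q ≼ P → Below 0 0 Q P
  ≼⇒Below Q∈ P∈ = ≤heights⇒Below (∈𝓕⇒Walk Q∈) (∈𝓕⇒Walk P∈) refl

  valley-isLowerCoverOf-peak : ∀ X Y → (X ++ D ∷ U ∷ Y) ∈ 𝓕 n p → (X ++ U ∷ D ∷ Y) ∈ 𝓕 n p →
                               IsLowerCoverOf n p (X ++ D ∷ U ∷ Y) (X ++ U ∷ D ∷ Y)
  valley-isLowerCoverOf-peak X Y valley∈ peak∈ = (Below⇒≤heights below , ++-D≢++-U X) , nothingBetween
    where
    below : Below 0 0 (X ++ D ∷ U ∷ Y) (X ++ U ∷ D ∷ Y)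
    below = Below-valley-peak X Y (∈𝓕⇒Walk valley∈)
    nothingBetween : ¬ Any (λ R → (X ++ D ∷ U ∷ Y) ≺ R × R ≺ (X ++ U ∷ D ∷ Y)) (𝓕 n p)
    nothingBetween between with find between
    ... | R , R∈ , (lo , lo≢) , (hi , hi≢) with Below-squeeze X Y (≼⇒Below valley∈ R∈ lo) (≼⇒Below R∈ peak∈ hi)
    ...   | inj₁ e = lo≢ (sym e)
    ...   | inj₂ e = hi≢ e

module _ {A : Set} where

  length-filter-unique : ∀ {P : Pred A 0ℓ} (P? : Decidable P) {L M : List A} → Unique L → Unique M →
                         (∀ {x} → x ∈ M → x ∈ L × P x) → (∀ {x} → x ∈ L → P x → x ∈ M) →
                         length (filter P? L) ≡ length M
  length-filter-unique P? {L} {M} uL uM M⊆ ⊆M = PP.↭-length (∼bag⇒↭ (unique∧set⇒bag (UP.filter⁺ P? uL) uM (mk⇔ to from)))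
    where
    to : ∀ {x} → x ∈ filter P? L → x ∈ M
    to mem = let x∈L , Px = MP.∈-filter⁻ P? {xs = L} mem in ⊆M x∈L Px
    from : ∀ {x} → x ∈ M → x ∈ filter P? L
    from mem = let x∈L , Px = M⊆ mem in MP.∈-filter⁺ P? x∈L Px

  length-filter-cong : ∀ {P Q : Pred A 0ℓ} (P? : Decidable P) (Q? : Decidable Q) xs →
                       (∀ {x} → x ∈ xs → does (P? x) ≡ does (Q? x)) → length (filter P? xs) ≡ length (filter Q? xs)
  length-filter-cong P? Q? []       _    = refl
  length-filter-cong P? Q? (x ∷ xs) same with does (P? x) | does (Q? x) | same (here refl)
  ... | true  | true  | _ = cong suc (length-filter-cong P? Q? xs (same ∘ there))
  ... | false | false | _ = length-filter-cong P? Q? xs (same ∘ there)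

  module _ {B : Set} where

    length-filter-map : ∀ {P : Pred B 0ℓ} (f : A → B) (P? : Decidable P) xs →
                        length (filter P? (map f xs)) ≡ length (filter (P? ∘ f) xs)
    length-filter-map f P? []       = refl
    length-filter-map f P? (x ∷ xs) with does (P? (f x))
    ... | true  = cong suc (length-filter-map f P? xs)
    ... | false = length-filter-map f P? xs

    Unique-map : ∀ (Inv : A → Set) (f : A → B) {xs} → All Inv xs →
                 (∀ {x y} → Inv x → Inv y → f x ≡ f y → x ≡ y) → Unique xs → Unique (map f xs)
    Unique-map Inv f []         inj []         = []
    Unique-map Inv f (ix ∷ ixs) inj (x∉ ∷ u) = distinct ix ixs x∉ ∷ Unique-map Inv f ixs inj u
      where
      distinct : ∀ {x ys} → Inv x → All Inv ys → All (x ≢_) ys → All (f x ≢_) (map f ys)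
      distinct ix []         []         = []
      distinct ix (iy ∷ iys) (x≢ ∷ x≢s) = (x≢ ∘ inj ix iy) ∷ distinct ix iys x≢s

count : ∀ {A : Set} → (A → ℕ) → ℕ → List A → ℕ
count s k L = length (filter (λ w → s w ℕ.≟ k) L)

module _ {A : Set} (s : A → ℕ) where

  count-++ : ∀ k L₁ L₂ → count s k (L₁ ++ L₂) ≡ count s k L₁ + count s k L₂
  count-++ k L₁ L₂ = trans (cong length (LP.filter-++ (λ w → s w ℕ.≟ k) L₁ L₂)) (LP.length-++ (filter (λ w → s w ℕ.≟ k) L₁))

  count-+-≤ : ∀ c k L → c ≤ k → count (λ w → c + s w) k L ≡ count s (k ∸ c) L
  count-+-≤ c k L c≤k = length-filter-cong _ _ L (λ {w} _ → does-⇔ (mk⇔ from to) (c + s w ℕ.≟ k) (s w ℕ.≟ k ∸ c))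
    where
    from : ∀ {m} → c + m ≡ k → m ≡ k ∸ c
    from {m} e = trans (sym (NP.m+n∸m≡n c m)) (cong (_∸ c) e)
    to : ∀ {m} → m ≡ k ∸ c → c + m ≡ k
    to e = trans (cong (_+_ c) e) (NP.m+[n∸m]≡n c≤k)

  count-+-≰ : ∀ c k L → ¬ c ≤ k → count (λ w → c + s w) k L ≡ 0
  count-+-≰ c k L c≰k =
    cong length (LP.filter-none (λ w → c + s w ℕ.≟ k) {L} (All.tabulate (λ {w} _ e → c≰k (subst (c ≤_) e (NP.m≤m+n c (s w))))))

count-cong : ∀ {A : Set} {s t : A → ℕ} k xs → (∀ {x} → x ∈ xs → s x ≡ t x) → count s k xs ≡ count t k xs
count-cong k xs s≡t = length-filter-cong _ _ xs (λ x∈ → cong (λ z → does (z ℕ.≟ k)) (s≡t x∈))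

-- Power series and the coefficients of polynomial multiples

-- shift i j A is the series xⁱ yʲ A
shift : ℕ → ℕ → Series → Series
shift i j A n k with i ℕ.≤? n | j ℕ.≤? k
... | yes _ | yes _ = A (n ∸ i) (k ∸ j)
... | _     | _     = + 0

𝟙 : Series
𝟙 = coeffP (cst (+ 1))

infix 4 _≈_
_≈_ : Series → Series → Set
A ≈ B = ∀ n k → A n k ≡ B n k

shift-cong : ∀ i j {A B} → A ≈ B → shift i j A ≈ shift i j B
shift-cong i j A≈B n k with i ℕ.≤? n | j ℕ.≤? k
... | yes _ | yes _ = A≈B _ _
... | yes _ | no _  = refl
... | no _  | _     = refl

shift-+ : ∀ i j A B n k → shift i j (λ n' k' → A n' k' ℤ.+ B n' k') n k ≡ shift i j A n k ℤ.+ shift i j B n k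
shift-+ i j A B n k with i ℕ.≤? n | j ℕ.≤? k
... | yes _ | yes _ = refl
... | yes _ | no _  = refl
... | no _  | _     = refl

shift-- : ∀ i j A B n k → shift i j (λ n' k' → A n' k' ℤ.- B n' k') n k ≡ shift i j A n k ℤ.- shift i j B n k
shift-- i j A B n k with i ℕ.≤? n | j ℕ.≤? k
... | yes _ | yes _ = refl
... | yes _ | no _  = refl
... | no _  | _     = refl

shift-linear : ∀ i j (a : ℤ) A B n k →
               shift i j (λ n' k' → a ℤ.* A n' k' ℤ.+ B n' k') n k ≡ a ℤ.* shift i j A n k ℤ.+ shift i j B n k
shift-linear i j a A B n k with i ℕ.≤? n | j ℕ.≤? k
... | yes _ | yes _ = refl
... | yes _ | no _  = sym (cong (ℤ._+ + 0) (ZP.*-zeroʳ a))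
... | no _  | _     = sym (cong (ℤ._+ + 0) (ZP.*-zeroʳ a))

shift-0 : ∀ i j n k → shift i j (λ _ _ → + 0) n k ≡ + 0
shift-0 i j n k with i ℕ.≤? n | j ℕ.≤? k
... | yes _ | yes _ = refl
... | yes _ | no _  = refl
... | no _  | _     = refl

shift₁ : ℕ → ℕ → (ℕ → ℤ) → ℤ
shift₁ i n F with i ℕ.≤? n
... | yes _ = F (n ∸ i)
... | no _  = + 0

shift₁-cong : ∀ i n {F F' : ℕ → ℤ} → (∀ a → F a ≡ F' a) → shift₁ i n F ≡ shift₁ i n F'
shift₁-cong i n F≗F' with i ℕ.≤? n
... | yes _ = F≗F' _
... | no _  = refl

shift-shift₁ : ∀ i j A n k → shift i j A n k ≡ shift₁ i n (λ a → shift₁ j k (A a))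
shift-shift₁ i j A n k with i ℕ.≤? n | j ℕ.≤? k
... | yes _ | yes _ = refl
... | yes _ | no _  = refl
... | no _  | _     = refl

shift₁-shift₁ : ∀ i i' n (F : ℕ → ℤ) → shift₁ i n (λ a → shift₁ i' a F) ≡ shift₁ (i + i') n F
shift₁-shift₁ i i' n F with i ℕ.≤? n
shift₁-shift₁ i i' n F | yes i≤n with i' ℕ.≤? n ∸ i | (i + i') ℕ.≤? n
... | yes _   | yes _ = cong F (NP.∸-+-assoc n i i')
... | yes i'≤ | no ≰  = ⊥-elim (≰ (subst (i + i' ≤_) (NP.m+[n∸m]≡n i≤n) (NP.+-monoʳ-≤ i i'≤)))
... | no ≰    | yes ≤ = ⊥-elim (≰ (subst (_≤ n ∸ i) (NP.m+n∸m≡n i i') (NP.∸-monoˡ-≤ i ≤)))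
... | no _    | no _  = refl
shift₁-shift₁ i i' n F | no i≰n with (i + i') ℕ.≤? n
... | yes ≤ = ⊥-elim (i≰n (NP.≤-trans (NP.m≤m+n i i') ≤))
... | no _  = refl

shift₁-comm : ∀ j k i a (H : ℕ → ℕ → ℤ) →
              shift₁ j k (λ b → shift₁ i a (λ a' → H a' b)) ≡ shift₁ i a (λ a' → shift₁ j k (H a'))
shift₁-comm j k i a H with j ℕ.≤? k | i ℕ.≤? a
... | yes _ | yes _ = refl
... | yes _ | no _  = refl
... | no _  | yes _ = refl
... | no _  | no _  = refl

shift-shift : ∀ i j i' j' A n k → shift i j (shift i' j' A) n k ≡ shift (i + i') (j + j') A n k
shift-shift i j i' j' A n k = begin
  shift i j (shift i' j' A) n k
    ≡⟨ shift-shift₁ i j (shift i' j' A) n k ⟩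
  shift₁ i n (λ a → shift₁ j k (λ b → shift i' j' A a b))
    ≡⟨ shift₁-cong i n (λ a → shift₁-cong j k (λ b → shift-shift₁ i' j' A a b)) ⟩
  shift₁ i n (λ a → shift₁ j k (λ b → shift₁ i' a (λ a' → shift₁ j' b (A a'))))
    ≡⟨ shift₁-cong i n (λ a → shift₁-comm j k i' a (λ a' b → shift₁ j' b (A a'))) ⟩
  shift₁ i n (λ a → shift₁ i' a (λ a' → shift₁ j k (λ b → shift₁ j' b (A a'))))
    ≡⟨ shift₁-cong i n (λ a → shift₁-cong i' a (λ a' → shift₁-shift₁ j j' k (A a'))) ⟩
  shift₁ i n (λ a → shift₁ i' a (λ a' → shift₁ (j + j') k (A a')))
    ≡⟨ shift₁-shift₁ i i' n (λ a' → shift₁ (j + j') k (A a')) ⟩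
  shift₁ (i + i') n (λ a' → shift₁ (j + j') k (A a'))
    ≡⟨ shift-shift₁ (i + i') (j + j') A n k ⟨
  shift (i + i') (j + j') A n k ∎
  where open ≡-Reasoning

shift-comm : ∀ i j i' j' A n k → shift i j (shift i' j' A) n k ≡ shift i' j' (shift i j A) n k
shift-comm i j i' j' A n k =
  trans (shift-shift i j i' j' A n k)
        (trans (cong₂ (λ a b → shift a b A n k) (+-comm i i') (+-comm j j')) (sym (shift-shift i' j' i j A n k)))

shift-vanishes : ∀ i j A k → 1 ≤ i → shift i j A 0 k ≡ + 0
shift-vanishes (suc i) j A k _ = refl

coeffMul-∷ : ∀ c i j f A n k → coeffMul ((c , i , j) ∷ f) A n k ≡ c ℤ.* shift i j A n k ℤ.+ coeffMul f A n k
coeffMul-∷ c i j f A n k with i ℕ.≤? n | j ℕ.≤? k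
... | yes _ | yes _ = refl
... | yes _ | no _  = sym (trans (cong (ℤ._+ coeffMul f A n k) (ZP.*-zeroʳ c)) (ZP.+-identityˡ _))
... | no _  | _     = sym (trans (cong (ℤ._+ coeffMul f A n k) (ZP.*-zeroʳ c)) (ZP.+-identityˡ _))

coeffMul-++ : ∀ f g A n k → coeffMul (f ++ g) A n k ≡ coeffMul f A n k ℤ.+ coeffMul g A n k
coeffMul-++ []                g A n k = sym (ZP.+-identityˡ _)
coeffMul-++ ((c , i , j) ∷ f) g A n k = begin
  coeffMul ((c , i , j) ∷ f ++ g) A n k
    ≡⟨ coeffMul-∷ c i j (f ++ g) A n k ⟩
  c ℤ.* shift i j A n k ℤ.+ coeffMul (f ++ g) A n k
    ≡⟨ cong (λ z → c ℤ.* shift i j A n k ℤ.+ z) (coeffMul-++ f g A n k) ⟩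
  c ℤ.* shift i j A n k ℤ.+ (coeffMul f A n k ℤ.+ coeffMul g A n k)
    ≡⟨ ZP.+-assoc (c ℤ.* shift i j A n k) _ _ ⟨
  c ℤ.* shift i j A n k ℤ.+ coeffMul f A n k ℤ.+ coeffMul g A n k
    ≡⟨ cong (ℤ._+ coeffMul g A n k) (coeffMul-∷ c i j f A n k) ⟨
  coeffMul ((c , i , j) ∷ f) A n k ℤ.+ coeffMul g A n k        ∎
  where open ≡-Reasoning

coeffMul-⊖ : ∀ f A n k → coeffMul (⊖ f) A n k ≡ ℤ.- coeffMul f A n k
coeffMul-⊖ []                A n k = refl
coeffMul-⊖ ((c , i , j) ∷ f) A n k =
  trans (coeffMul-∷ (ℤ.- c) i j (⊖ f) A n k)
  (trans (cong (λ z → (ℤ.- c) ℤ.* shift i j A n k ℤ.+ z) (coeffMul-⊖ f A n k))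
  (trans (neg-distrib c (shift i j A n k) (coeffMul f A n k)) (cong ℤ.-_ (sym (coeffMul-∷ c i j f A n k)))))
  where
  neg-distrib : ∀ (c s r : ℤ) → (ℤ.- c) ℤ.* s ℤ.+ ℤ.- r ≡ ℤ.- (c ℤ.* s ℤ.+ r)
  neg-distrib = solve-∀

coeffMul-⊝ : ∀ f g A n k → coeffMul (f ⊝ g) A n k ≡ coeffMul f A n k ℤ.- coeffMul g A n k
coeffMul-⊝ f g A n k = trans (coeffMul-++ f (⊖ g) A n k) (cong (ℤ._+_ (coeffMul f A n k)) (coeffMul-⊖ g A n k))

coeffMul-cong : ∀ f {A B} → A ≈ B → coeffMul f A ≈ coeffMul f B
coeffMul-cong []                A≈B n k = refl
coeffMul-cong ((c , i , j) ∷ f) A≈B n k =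
  trans (coeffMul-∷ c i j f _ n k)
  (trans (cong₂ (λ x y → c ℤ.* x ℤ.+ y) (shift-cong i j A≈B n k) (coeffMul-cong f A≈B n k))
  (sym (coeffMul-∷ c i j f _ n k)))

coeffMul-linear : ∀ f (a : ℤ) A B n k →
                  coeffMul f (λ n' k' → a ℤ.* A n' k' ℤ.+ B n' k') n k ≡ a ℤ.* coeffMul f A n k ℤ.+ coeffMul f B n k
coeffMul-linear []                a A B n k = sym (cong (ℤ._+ + 0) (ZP.*-zeroʳ a))
coeffMul-linear ((c , i , j) ∷ f) a A B n k =
  trans (coeffMul-∷ c i j f _ n k)
  (trans (cong₂ (λ x y → c ℤ.* x ℤ.+ y) (shift-linear i j a A B n k) (coeffMul-linear f a A B n k))
  (trans (distrib c a (shift i j A n k) (shift i j B n k) (coeffMul f A n k) (coeffMul f B n k))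
  (sym (cong₂ (λ x y → a ℤ.* x ℤ.+ y) (coeffMul-∷ c i j f A n k) (coeffMul-∷ c i j f B n k)))))
  where
  distrib : ∀ (c a sA sB fA fB : ℤ) →
            c ℤ.* (a ℤ.* sA ℤ.+ sB) ℤ.+ (a ℤ.* fA ℤ.+ fB) ≡ a ℤ.* (c ℤ.* sA ℤ.+ fA) ℤ.+ (c ℤ.* sB ℤ.+ fB)
  distrib = solve-∀

coeffMul-+ : ∀ f A B n k → coeffMul f (λ n' k' → A n' k' ℤ.+ B n' k') n k ≡ coeffMul f A n k ℤ.+ coeffMul f B n k
coeffMul-+ f A B n k =
  trans (coeffMul-cong f (λ n' k' → cong (ℤ._+ B n' k') (sym (ZP.*-identityˡ (A n' k')))) n k)
  (trans (coeffMul-linear f (+ 1) A B n k) (cong (ℤ._+ coeffMul f B n k) (ZP.*-identityˡ (coeffMul f A n k))))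

coeffMul-0 : ∀ f n k → coeffMul f (λ _ _ → + 0) n k ≡ + 0
coeffMul-0 []                n k = refl
coeffMul-0 ((c , i , j) ∷ f) n k =
  trans (coeffMul-∷ c i j f _ n k)
  (trans (cong₂ (λ x y → c ℤ.* x ℤ.+ y) (shift-0 i j n k) (coeffMul-0 f n k)) (cong (ℤ._+ + 0) (ZP.*-zeroʳ c)))

shift-coeffMul : ∀ f i j A n k → shift i j (coeffMul f A) n k ≡ coeffMul f (shift i j A) n k
shift-coeffMul []                  i j A n k = shift-0 i j n k
shift-coeffMul ((c , i' , j') ∷ f) i j A n k =
  trans (shift-cong i j (λ n' k' → coeffMul-∷ c i' j' f A n' k') n k)
  (trans (shift-linear i j c (shift i' j' A) (coeffMul f A) n k)
  (trans (cong₂ (λ x y → c ℤ.* x ℤ.+ y) (shift-comm i j i' j' A n k) (shift-coeffMul f i j A n k))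
  (sym (coeffMul-∷ c i' j' f (shift i j A) n k))))

coeffMul-comm : ∀ f g A n k → coeffMul f (coeffMul g A) n k ≡ coeffMul g (coeffMul f A) n k
coeffMul-comm []                g A n k = sym (coeffMul-0 g n k)
coeffMul-comm ((c , i , j) ∷ f) g A n k =
  trans (coeffMul-∷ c i j f (coeffMul g A) n k)
  (trans (cong₂ (λ x y → c ℤ.* x ℤ.+ y) (shift-coeffMul g i j A n k) (coeffMul-comm f g A n k))
  (trans (sym (coeffMul-linear g c (shift i j A) (coeffMul f A) n k))
  (coeffMul-cong g (λ n' k' → sym (coeffMul-∷ c i j f A n' k')) n k)))

coeffMul-monomial-⊛ : ∀ c i j g A n k → coeffMul (((c , i , j) ∷ []) ⊛ g) A n k ≡ c ℤ.* shift i j (coeffMul g A) n k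
coeffMul-monomial-⊛ c i j [] A n k = sym (trans (cong (c ℤ.*_) (shift-0 i j n k)) (ZP.*-zeroʳ c))
coeffMul-monomial-⊛ c i j ((d , i' , j') ∷ g) A n k =
  trans (coeffMul-∷ (c ℤ.* d) (i + i') (j + j') _ A n k)
  (trans (cong₂ (λ x y → c ℤ.* d ℤ.* x ℤ.+ y) (sym (shift-shift i j i' j' A n k)) (coeffMul-monomial-⊛ c i j g A n k))
  (trans (factor c d (shift i j (shift i' j' A) n k) (shift i j (coeffMul g A) n k))
  (cong (c ℤ.*_) (trans (sym (shift-linear i j d (shift i' j' A) (coeffMul g A) n k))
                        (shift-cong i j (λ n' k' → sym (coeffMul-∷ d i' j' g A n' k')) n k)))))
  where
  factor : ∀ (c d x y : ℤ) → c ℤ.* d ℤ.* x ℤ.+ c ℤ.* y ≡ c ℤ.* (d ℤ.* x ℤ.+ y)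
  factor = solve-∀

coeffMul-⊛ : ∀ f g A n k → coeffMul (f ⊛ g) A n k ≡ coeffMul f (coeffMul g A) n k
coeffMul-⊛ []                g A n k = refl
coeffMul-⊛ ((c , i , j) ∷ f) g A n k =
  trans (cong (λ h → coeffMul h A n k) split)
  (trans (coeffMul-++ (((c , i , j) ∷ []) ⊛ g) (f ⊛ g) A n k)
  (trans (cong₂ ℤ._+_ (coeffMul-monomial-⊛ c i j g A n k) (coeffMul-⊛ f g A n k))
  (sym (coeffMul-∷ c i j f (coeffMul g A) n k))))
  where
  split : ((c , i , j) ∷ f) ⊛ g ≡ ((c , i , j) ∷ []) ⊛ g ++ f ⊛ g
  split = cong (_++ f ⊛ g) (sym (LP.++-identityʳ _))

coeffMul-cst : ∀ c A n k → coeffMul (cst c) A n k ≡ c ℤ.* A n k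
coeffMul-cst c A n k = ZP.+-identityʳ _

coeffMul-xⁱyʲ : ∀ i j A n k → coeffMul ((+ 1 , i , j) ∷ []) A n k ≡ shift i j A n k
coeffMul-xⁱyʲ i j A n k = trans (coeffMul-∷ (+ 1) i j [] A n k) (trans (ZP.+-identityʳ _) (ZP.*-identityˡ _))

coeffMul-X^ : ∀ m A n k → coeffMul (X ^^ m) A n k ≡ shift m 0 A n k
coeffMul-X^ zero    A n k = trans (coeffMul-cst (+ 1) A n k) (ZP.*-identityˡ _)
coeffMul-X^ (suc m) A n k =
  trans (coeffMul-⊛ X (X ^^ m) A n k)
  (trans (coeffMul-xⁱyʲ 1 0 (coeffMul (X ^^ m) A) n k)
  (trans (shift-cong 1 0 (coeffMul-X^ m A) n k) (shift-shift 1 0 m 0 A n k)))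

monomialCoeff : ℕ → ℕ → ℕ → ℕ → ℤ
monomialCoeff i j n k with i ℕ.≟ n | j ℕ.≟ k
... | yes _ | yes _ = + 1
... | _     | _     = + 0

shift-𝟙 : ∀ i j n k → shift i j 𝟙 n k ≡ monomialCoeff i j n k
shift-𝟙 i j n k with i ℕ.≤? n | j ℕ.≤? k
shift-𝟙 i j n k | yes i≤n | yes j≤k with 0 ℕ.≟ n ∸ i | 0 ℕ.≟ k ∸ j | i ℕ.≟ n | j ℕ.≟ k
... | yes _ | yes _  | yes _ | yes _ = refl
... | yes _ | yes e  | yes _ | no ≢  = ⊥-elim (≢ (NP.≤-antisym j≤k (NP.m∸n≡0⇒m≤n (sym e))))
... | yes e | yes _  | no ≢  | _     = ⊥-elim (≢ (NP.≤-antisym i≤n (NP.m∸n≡0⇒m≤n (sym e))))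
... | yes _ | no ≢   | yes _ | yes refl = ⊥-elim (≢ (sym (NP.n∸n≡0 j)))
... | yes _ | no _   | yes _ | no _  = refl
... | yes _ | no _   | no _  | _     = refl
... | no ≢  | _      | yes refl | _  = ⊥-elim (≢ (sym (NP.n∸n≡0 i)))
... | no _  | _      | no _  | _     = refl
shift-𝟙 i j n k | yes _ | no j≰k with i ℕ.≟ n | j ℕ.≟ k
... | _     | yes refl = ⊥-elim (j≰k NP.≤-refl)
... | yes _ | no _     = refl
... | no _  | no _     = refl
shift-𝟙 i j n k | no i≰n | _ with i ℕ.≟ n
... | yes refl = ⊥-elim (i≰n NP.≤-refl)
... | no _     = refl

coeffP≡coeffMul-𝟙 : ∀ f n k → coeffP f n k ≡ coeffMul f 𝟙 n k
coeffP≡coeffMul-𝟙 []                n k = refl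
coeffP≡coeffMul-𝟙 ((c , i , j) ∷ f) n k =
  trans (coeffP-∷ c i j f n k)
  (trans (cong₂ (λ x y → c ℤ.* x ℤ.+ y) (sym (shift-𝟙 i j n k)) (coeffP≡coeffMul-𝟙 f n k))
  (sym (coeffMul-∷ c i j f 𝟙 n k)))
  where
  coeffP-∷ : ∀ c i j f n k → coeffP ((c , i , j) ∷ f) n k ≡ c ℤ.* monomialCoeff i j n k ℤ.+ coeffP f n k
  coeffP-∷ c i j f n k with i ℕ.≟ n | j ℕ.≟ k
  ... | yes _ | yes _ = cong (ℤ._+ coeffP f n k) (sym (ZP.*-identityʳ c))
  ... | yes _ | no _  = sym (trans (cong (ℤ._+ coeffP f n k) (ZP.*-zeroʳ c)) (ZP.+-identityˡ _))
  ... | no _  | _     = sym (trans (cong (ℤ._+ coeffP f n k) (ZP.*-zeroʳ c)) (ZP.+-identityˡ _))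

XDivisible : Poly → Set
XDivisible = All (λ m → 1 ≤ proj₁ (proj₂ m))

XDivisible-⊖ : ∀ f → XDivisible f → XDivisible (⊖ f)
XDivisible-⊖ []      []       = []
XDivisible-⊖ (_ ∷ f) (d ∷ ds) = d ∷ XDivisible-⊖ f ds

coeffMul-XDivisible : ∀ f {A B} n k → XDivisible f → (∀ {n'} → n' < n → ∀ k' → A n' k' ≡ B n' k') →
                      coeffMul f A n k ≡ coeffMul f B n k
coeffMul-XDivisible []                n k []         _     = refl
coeffMul-XDivisible ((c , i , j) ∷ f) {A} {B} n k (1≤i ∷ ds) agree =
  trans (coeffMul-∷ c i j f A n k)
  (trans (cong₂ (λ x y → c ℤ.* x ℤ.+ y) shift-agrees (coeffMul-XDivisible f n k ds agree))
  (sym (coeffMul-∷ c i j f B n k)))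
  where
  shift-agrees : shift i j A n k ≡ shift i j B n k
  shift-agrees with i ℕ.≤? n | j ℕ.≤? k
  ... | yes i≤n | yes _ = agree (NP.∸-monoʳ-< 1≤i i≤n) (k ∸ j)
  ... | yes _   | no _  = refl
  ... | no _    | _     = refl

coeffMul-1+XDivisible-injective : ∀ f {A B} → XDivisible f →
  coeffMul ((+ 1 , 0 , 0) ∷ f) A ≈ coeffMul ((+ 1 , 0 , 0) ∷ f) B → A ≈ B
coeffMul-1+XDivisible-injective f {A} {B} xf same = <-rec (λ n → ∀ k → A n k ≡ B n k) step
  where
  cancel : ∀ (a b : ℤ) → + 1 ℤ.* a ℤ.+ b ℤ.- b ≡ a
  cancel = solve-∀
  step : ∀ n → (∀ {n'} → n' < n → ∀ k → A n' k ≡ B n' k) → ∀ k → A n k ≡ B n k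
  step n below k = begin
    A n k                                                         ≡⟨ cancel (A n k) (coeffMul f A n k) ⟨
    coeffMul ((+ 1 , 0 , 0) ∷ f) A n k ℤ.- coeffMul f A n k       ≡⟨ cong₂ ℤ._-_ (same n k) (coeffMul-XDivisible f n k xf below) ⟩
    coeffMul ((+ 1 , 0 , 0) ∷ f) B n k ℤ.- coeffMul f B n k       ≡⟨ cancel (B n k) (coeffMul f B n k) ⟩
    B n k                                                         ∎
    where open ≡-Reasoning

expand : Poly → Series → ℕ → ℕ → ℤ
expand [] A n k = + 0
expand ((c , i , j) ∷ f) A n k = c ℤ.* shift i j A n k ℤ.+ expand f A n k

coeffMul≡expand : ∀ f A n k → coeffMul f A n k ≡ expand f A n k
coeffMul≡expand [] A n k = refl
coeffMul≡expand ((c , i , j) ∷ f) A n k = trans (coeffMul-∷ c i j f A n k)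
    (cong (ℤ._+_ (c ℤ.* shift i j A n k)) (coeffMul≡expand f A n k))

shift-≡ : ∀ {i i' j j'} A n k → i ≡ i' → j ≡ j' → shift i j A n k ≡ shift i' j' A n k
shift-≡ A n k refl refl = refl

expand-⊖ : ∀ f A n k → expand (⊖ f) A n k ≡ ℤ.- coeffMul f A n k
expand-⊖ f A n k = trans (sym (coeffMul≡expand (⊖ f) A n k)) (coeffMul-⊖ f A n k)

shift-+₄ : ∀ i j (Dx A B C : Series) {E : Series} → E ≈ (λ n k → Dx n k ℤ.+ (A n k ℤ.+ (B n k ℤ.+ C n k))) →
      ∀ n k → shift i j E n k ≡ shift i j Dx n k ℤ.+ (shift i j A n k ℤ.+ (shift i j B n k ℤ.+ shift i j C n k))
shift-+₄ i j Dx A B C h n k =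
  trans (shift-cong i j h n k)
  (trans (shift-+ i j Dx (λ n' k' → A n' k' ℤ.+ (B n' k' ℤ.+ C n' k')) n k)
  (cong (ℤ._+_ (shift i j Dx n k)) (trans (shift-+ i j A (λ n' k' → B n' k' ℤ.+ C n' k') n k)
      (cong (ℤ._+_ (shift i j A n k)) (shift-+ i j B C n k)))))

-- Elements of 𝓕 n p as compositions of n with parts in [1, p]

module Encoding (p : ℕ) where

  Admissible : List ℕ → Set
  Admissible w = All (λ f → 1 ≤ f × f ≤ p) w

  runs' : List ℕ → List Step
  runs' [] = []
  runs' (g ∷ r) = U ∷ (Ds g ++ runs' r)

  runs : List ℕ → List Step
  runs [] = []
  runs (f ∷ r) = Ds f ++ runs' r

  excess : List ℕ → ℕ
  excess [] = 0
  excess (f ∷ r) = (f ∸ 1) + excess r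

  -- path (f₁ ∷ ⋯ ∷ fₘ) = U^(1 + excess) D^f₁ U D^f₂ ⋯ U D^fₘ with excess = Σ (fᵢ ∸ 1)
  path : List ℕ → List Step
  path [] = []
  path (f ∷ r) = Us (suc (excess (f ∷ r))) ++ runs (f ∷ r)

  excess-∷ : ∀ f r → 1 ≤ f → f + excess r ≡ suc (excess (f ∷ r))
  excess-∷ (suc f) r _ = refl

  mutual
    Walk-runs' : ∀ r → Admissible r → Walk (excess r) (runs' r)
    Walk-runs' [] [] = wnil
    Walk-runs' (g ∷ r) ((1≤g , g≤p) ∷ v) = wU (subst (λ x → Walk x (runs (g ∷ r))) (excess-∷ g r 1≤g)
        (Walk-runs g r ((1≤g , g≤p) ∷ v)))

    Walk-runs : ∀ f r → Admissible (f ∷ r) → Walk (f + excess r) (runs (f ∷ r))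
    Walk-runs f r (_ ∷ v) = Walk-Ds f (Walk-runs' r v)

  Walk-path : ∀ w → Admissible w → Walk 0 (path w)
  Walk-path [] [] = wnil
  Walk-path (f ∷ r) v@((1≤f , _) ∷ _) =
    Walk-Us (suc (excess (f ∷ r))) (subst (λ x → Walk x (runs (f ∷ r))) (trans (excess-∷ f r 1≤f) (sym (NP.+-identityʳ _)))
        (Walk-runs f r v))

  length-runs' : ∀ r → length (runs' r) ≡ sum r + length r
  length-runs' [] = refl
  length-runs' (g ∷ r) = trans (cong suc (trans (LP.length-++ (Ds g)) (trans (cong₂ _+_ (LP.length-replicate g) (length-runs' r))
    (sym (+-assoc g (sum r) (length r)))))) (sym (+-suc (g + sum r) (length r)))

  excess+length : ∀ r → Admissible r → excess r + length r ≡ sum r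
  excess+length [] [] = refl
  excess+length (suc g ∷ r) (_ ∷ v) = trans (+-suc (g + excess r) (length r))
      (cong suc (trans (+-assoc g (excess r) (length r)) (cong (_+_ g) (excess+length r v))))

  length-path : ∀ w → Admissible w → length (path w) ≡ 2 * sum w
  length-path [] [] = refl
  length-path (suc f ∷ r) (_ ∷ v) =
    begin
      length (Us (suc (f + excess r)) ++ Ds (suc f) ++ runs' r)
    ≡⟨ LP.length-++ (Us (suc (f + excess r))) ⟩
      length (Us (suc (f + excess r))) + length (Ds (suc f) ++ runs' r)
    ≡⟨ cong₂ _+_ (LP.length-replicate (suc (f + excess r))) (LP.length-++ (Ds (suc f))) ⟩
      suc (f + excess r) + (length (Ds (suc f)) + length (runs' r))
    ≡⟨ cong (λ z → suc (f + excess r) + z) (cong₂ _+_ (LP.length-replicate (suc f)) (length-runs' r)) ⟩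
      suc (f + excess r) + (suc f + (sum r + length r))
    ≡⟨ arith f (excess r) (sum r) (length r) ⟩
      suc (f + (excess r + length r)) + suc (f + sum r)
    ≡⟨ cong (λ z → suc (f + z) + suc (f + sum r)) (excess+length r v) ⟩
      suc (f + sum r) + suc (f + sum r)
    ≡⟨ cong (λ z → suc (f + sum r) + z) (sym (NP.+-identityʳ (suc (f + sum r)))) ⟩
      2 * sum (suc f ∷ r)
    ∎
    where
    open ≡-Reasoning
    arith : ∀ a b c d → suc (a + b) + (suc a + (c + d)) ≡ suc (a + (b + d)) + suc (a + c)
    arith a b c d = cong suc (solve 4 (λ a b c d → (a :+ b) :+ (con 1 :+ a :+ (c :+ d)) := (a :+ (b :+ d)) :+ (con 1 :+ a :+ c))
        refl a b c d)
      where
      open +-*-Solver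

  NoDp : List Step → Set
  NoDp X = ¬ Occurs (Ds (suc p)) X

  NoUU-Ds-runs' : ∀ k r → Admissible r → NoUU (Ds k ++ runs' r)
  NoUU-Ds-runs' (suc k) r v (here (() ∷ _))
  NoUU-Ds-runs' (suc k) r v (there o) = NoUU-Ds-runs' k r v o
  NoUU-Ds-runs' zero [] v (here ())
  NoUU-Ds-runs' zero (suc g ∷ r) v (here (_ ∷ (() ∷ _)))
  NoUU-Ds-runs' zero (g ∷ r) (_ ∷ v) (there o) = NoUU-Ds-runs' g r v o

  NoDp-Us : ∀ a X → NoDp X → NoDp (Us a ++ X)
  NoDp-Us zero X nd o = nd o
  NoDp-Us (suc a) X nd (here (() ∷ _))
  NoDp-Us (suc a) X nd (there o) = NoDp-Us a X nd o

  NotD-runs' : ∀ r → NotD (runs' r)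
  NotD-runs' [] = tt
  NotD-runs' (g ∷ r) = tt

  NoDp-Ds-runs' : ∀ k r → k ≤ p → Admissible r → NoDp (Ds k ++ runs' r)
  NoDp-Ds-runs' zero [] le v (here pr) = ¬Prefix-Ds (suc p) zero [] (s≤s le) tt pr
  NoDp-Ds-runs' zero (g ∷ r) le v (here pr) = ¬Prefix-Ds (suc p) zero (runs' (g ∷ r)) (s≤s le) tt pr
  NoDp-Ds-runs' zero (g ∷ r) le ((_ , g≤p) ∷ v) (there o) = NoDp-Ds-runs' g r g≤p v o
  NoDp-Ds-runs' (suc k) r le v (here pr) = ¬Prefix-Ds (suc p) (suc k) (runs' r) (s≤s le) (NotD-runs' r) pr
  NoDp-Ds-runs' (suc k) r le v (there o) = NoDp-Ds-runs' k r (NP.≤-trans (NP.n≤1+n k) le) v o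

  path-InF : ∀ n w → Admissible w → sum w ≡ n → InF n p (path w)
  path-InF n [] [] refl = Walk⇒IsDyck {n = 0} refl wnil , (λ { (here ()) }) , (λ { (here ()) })
  path-InF n (f ∷ r) v@((_ , f≤p) ∷ adm') refl =
    Walk⇒IsDyck {n = sum (f ∷ r)} (length-path (f ∷ r) v) (Walk-path (f ∷ r) v) ,
    NoDUU-Us (suc (excess (f ∷ r))) (runs (f ∷ r)) (NoUU-Ds-runs' f r adm') ,
    NoDp-Us (suc (excess (f ∷ r))) (runs (f ∷ r)) (NoDp-Ds-runs' f r f≤p adm')

  NoDp⇒≤p : ∀ k X → NoDp (Ds k ++ X) → k ≤ p
  NoDp⇒≤p k X nd with k ℕ.≤? p
  ... | yes le = le
  ... | no nle = ⊥-elim (nd (here (Prefix-Ds (suc p) k X (NP.≰⇒> nle))))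

  parseRuns : ∀ k R {h} → 1 ≤ k → NoUU R → NoDp (Ds k ++ R) → Walk h (Ds k ++ R) →
             Σ ℕ λ f → Σ (List ℕ) λ r → Admissible (f ∷ r) × runs (f ∷ r) ≡ Ds k ++ R
  parseRuns k [] 1≤k noUU nd walk = k , [] , ((1≤k , NoDp⇒≤p k [] nd) ∷ []) , refl
  parseRuns k (D ∷ R) {h} 1≤k noUU nd walk
    with parseRuns (suc k) R (s≤s z≤n) (NoUU-tail noUU) (subst NoDp (Ds-snoc k R) nd) (subst (Walk h) (Ds-snoc k R) walk)
  ... | f , r , v , e = f , r , v , trans e (sym (Ds-snoc k R))
  parseRuns k (U ∷ []) 1≤k noUU nd walk = ⊥-elim (¬Walk-++U (Ds k) walk)
  parseRuns k (U ∷ U ∷ R) 1≤k noUU nd walk = ⊥-elim (noUU (here (refl ∷ (refl ∷ []))))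
  parseRuns k (U ∷ D ∷ R) 1≤k noUU nd walk
    with Walk-suffix (Ds k ++ U ∷ []) (subst (λ z → Walk _ z) (sym (LP.++-assoc (Ds k) (U ∷ []) (D ∷ R))) walk)
  ... | h' , wk'
    with parseRuns 1 R (s≤s z≤n) (NoUU-tail (NoUU-tail noUU))
        (λ o → nd (subst (Occurs _) (LP.++-assoc (Ds k) (U ∷ []) (D ∷ R)) ((Ds k ++ U ∷ []) ++ⁱ o))) wk'
  ... | g , r , v , e = k , g ∷ r , ((1≤k , NoDp⇒≤p k _ nd) ∷ v) , cong (λ z → Ds k ++ U ∷ z) e

  parsePath : ∀ P → Walk 0 P → NoDUU P → NoDp P → Σ (List ℕ) λ w → Admissible w × P ≡ path w
  parsePath P walk noDUU noDp with splitUs P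
  ... | a , [] , refl , _ = [] , [] , cong (λ m → Us m ++ []) a≡0
    where
    a≡0 : a ≡ 0
    a≡0 = trans (sym (NP.+-identityʳ a)) (Walk-height-unique (Walk-Us⁻ a walk) wnil)
  ... | a , D ∷ R , refl , _
    with f , r , adm@((1≤f , _) ∷ _) , runs≡ ← parseRuns 1 R (s≤s z≤n) (NoDUU⇒NoUU-tail R (λ o → noDUU (Us a ++ⁱ o)))
                                                  (λ o → noDp (Us a ++ⁱ o)) (Walk-Us⁻ a walk)
    = f ∷ r , adm , cong₂ (λ m X → Us m ++ X) a≡ (sym runs≡)
    where
    a≡ : a ≡ suc (excess (f ∷ r))
    a≡ = trans (sym (NP.+-identityʳ a))
               (trans (Walk-height-unique (Walk-Us⁻ a walk) (subst (Walk _) runs≡ (Walk-runs f r adm))) (excess-∷ f r 1≤f))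

  InF⇒path : ∀ n P → InF n p P → Σ (List ℕ) λ w → Admissible w × sum w ≡ n × P ≡ path w
  InF⇒path n P (dyck , noDUU , noDp) with w , adm , refl ← parsePath P (IsDyck⇒Walk {n} dyck) noDUU noDp =
    w , adm , NP.*-cancelˡ-≡ (sum w) n 2 (trans (sym (length-path w adm)) (proj₁ dyck)) , refl

  partsUpTo : ℕ → List ℕ
  partsUpTo zero = []
  partsUpTo (suc m) = suc m ∷ partsUpTo m

  ∈-partsUpTo⁻ : ∀ {m f} → f ∈ partsUpTo m → 1 ≤ f × f ≤ m
  ∈-partsUpTo⁻ {suc m} (here refl) = s≤s z≤n , NP.≤-refl
  ∈-partsUpTo⁻ {suc m} (there mem) with ∈-partsUpTo⁻ mem
  ... | a , b = a , NP.m≤n⇒m≤1+n b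

  ∈-partsUpTo⁺ : ∀ {m f} → 1 ≤ f → f ≤ m → f ∈ partsUpTo m
  ∈-partsUpTo⁺ {zero} {zero} () _
  ∈-partsUpTo⁺ {zero} {suc f} _ ()
  ∈-partsUpTo⁺ {suc m} {f} 1≤f fm with f ℕ.≟ suc m
  ... | yes refl = here refl
  ... | no ne = there (∈-partsUpTo⁺ 1≤f (NP.≤-pred (NP.≤∧≢⇒< fm ne)))

  partsUpTo-unique : ∀ m → Unique (partsUpTo m)
  partsUpTo-unique zero = []
  partsUpTo-unique (suc m) = All.tabulate (λ mem e → NP.<-irrefl (sym e) (s≤s (proj₂ (∈-partsUpTo⁻ mem)))) ∷ partsUpTo-unique m

  mutual
    compsFuel : ℕ → ℕ → List (List ℕ)
    compsFuel zero n = []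
    compsFuel (suc t) zero = [] ∷ []
    compsFuel (suc t) (suc n) = compsWithFirstIn t (suc n) (partsUpTo p)

    compsWithFirstIn : ℕ → ℕ → List ℕ → List (List ℕ)
    compsWithFirstIn t m [] = []
    compsWithFirstIn t m (f ∷ fs) = compsWithFirst t m f ++ compsWithFirstIn t m fs

    compsWithFirst : ℕ → ℕ → ℕ → List (List ℕ)
    compsWithFirst t m f with f ℕ.≤? m
    ... | yes _ = map (f ∷_) (compsFuel t (m ∸ f))
    ... | no _ = []

  comps : ℕ → List (List ℕ)
  comps n = compsFuel (suc n) n

  ∈-compsWithFirst⁻ : ∀ t m f {w} → w ∈ compsWithFirst t m f → Σ (List ℕ) λ r → w ≡ f ∷ r × f ≤ m × r ∈ compsFuel t (m ∸ f)
  ∈-compsWithFirst⁻ t m f mem with f ℕ.≤? m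
  ... | yes le with MP.∈-map⁻ (f ∷_) mem
  ...   | r , mr , refl = r , refl , le , mr
  ∈-compsWithFirst⁻ t m f () | no _

  ∈-compsWithFirst⁺ : ∀ t m f {r} → f ≤ m → r ∈ compsFuel t (m ∸ f) → (f ∷ r) ∈ compsWithFirst t m f
  ∈-compsWithFirst⁺ t m f le mem with f ℕ.≤? m
  ... | yes _ = MP.∈-map⁺ (f ∷_) mem
  ... | no nle = ⊥-elim (nle le)

  ∈-compsWithFirstIn⁻ : ∀ t m fs {w} → w ∈ compsWithFirstIn t m fs → Σ ℕ λ f → f ∈ fs × w ∈ compsWithFirst t m f
  ∈-compsWithFirstIn⁻ t m (f ∷ fs) mem with MP.∈-++⁻ (compsWithFirst t m f) mem
  ... | inj₁ a = f , here refl , a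
  ... | inj₂ b with ∈-compsWithFirstIn⁻ t m fs b
  ...   | f' , mf , mw = f' , there mf , mw

  ∈-compsWithFirstIn⁺ : ∀ t m fs {f w} → f ∈ fs → w ∈ compsWithFirst t m f → w ∈ compsWithFirstIn t m fs
  ∈-compsWithFirstIn⁺ t m (f ∷ fs) (here refl) mw = MP.∈-++⁺ˡ mw
  ∈-compsWithFirstIn⁺ t m (f' ∷ fs) (there mf) mw = MP.∈-++⁺ʳ (compsWithFirst t m f') (∈-compsWithFirstIn⁺ t m fs mf mw)

  ∈-compsFuel⁻ : ∀ t n {w} → w ∈ compsFuel t n → Admissible w × sum w ≡ n
  ∈-compsFuel⁻ (suc t) zero (here refl) = [] , refl
  ∈-compsFuel⁻ (suc t) (suc n) mem with ∈-compsWithFirstIn⁻ t (suc n) (partsUpTo p) mem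
  ... | f , mf , mw with ∈-compsWithFirst⁻ t (suc n) f mw
  ...   | r , refl , le , mr with ∈-compsFuel⁻ t (suc n ∸ f) mr | ∈-partsUpTo⁻ mf
  ...     | v , s | 1≤f , f≤p = ((1≤f , f≤p) ∷ v) , trans (cong (_+_ f) s) (NP.m+[n∸m]≡n le)

  ∈-compsFuel⁺ : ∀ t n w → n < t → Admissible w → sum w ≡ n → w ∈ compsFuel t n
  ∈-compsFuel⁺ (suc t) zero [] lt [] refl = here refl
  ∈-compsFuel⁺ (suc t) zero (suc f ∷ r) lt v ()
  ∈-compsFuel⁺ (suc t) zero (zero ∷ r) lt ((() , _) ∷ v) s
  ∈-compsFuel⁺ (suc t) (suc n) [] lt v ()
  ∈-compsFuel⁺ (suc t) (suc n) (f ∷ r) (s≤s lt) ((1≤f , f≤p) ∷ v) s =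
    ∈-compsWithFirstIn⁺ t (suc n) (partsUpTo p) (∈-partsUpTo⁺ 1≤f f≤p)
        (∈-compsWithFirst⁺ t (suc n) f fle (∈-compsFuel⁺ t (suc n ∸ f) r lt' v s'))
    where
    fle : f ≤ suc n
    fle = subst (λ z → f ≤ z) s (NP.m≤m+n f (sum r))
    s' : sum r ≡ suc n ∸ f
    s' = sym (trans (cong (λ z → z ∸ f) (sym s)) (NP.m+n∸m≡n f (sum r)))
    lt' : suc n ∸ f < t
    lt' = NP.≤-trans (s≤s (NP.∸-monoʳ-≤ (suc n) 1≤f)) lt

  compsWithFirst-head : ∀ t m f {w} → w ∈ compsWithFirst t m f → Σ (List ℕ) λ r → w ≡ f ∷ r
  compsWithFirst-head t m f mem with ∈-compsWithFirst⁻ t m f mem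
  ... | r , e , _ = r , e

  mutual
    compsFuel-unique : ∀ t n → Unique (compsFuel t n)
    compsFuel-unique zero n = []
    compsFuel-unique (suc t) zero = [] ∷ []
    compsFuel-unique (suc t) (suc n) = compsWithFirstIn-unique t (suc n) (partsUpTo p) (partsUpTo-unique p)

    compsWithFirstIn-unique : ∀ t m fs → Unique fs → Unique (compsWithFirstIn t m fs)
    compsWithFirstIn-unique t m [] u = []
    compsWithFirstIn-unique t m (f ∷ fs) (nf ∷ u) = UP.++⁺ (compsWithFirst-unique t m f) (compsWithFirstIn-unique t m fs u) disj
      where
      disj : ∀ {v} → ¬ (v ∈ compsWithFirst t m f × v ∈ compsWithFirstIn t m fs)
      disj (a , b) with compsWithFirst-head t m f a | ∈-compsWithFirstIn⁻ t m fs b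
      ... | r , refl | f' , mf' , mw with compsWithFirst-head t m f' mw
      ...   | r' , e = All.lookup nf mf' (LP.∷-injectiveˡ e)

    compsWithFirst-unique : ∀ t m f → Unique (compsWithFirst t m f)
    compsWithFirst-unique t m f with f ℕ.≤? m
    ... | yes _ = UP.map⁺ LP.∷-injectiveʳ (compsFuel-unique t (m ∸ f))
    ... | no _ = []

  ∈-comps⁻ : ∀ n {w} → w ∈ comps n → Admissible w × sum w ≡ n
  ∈-comps⁻ n = ∈-compsFuel⁻ (suc n) n

  ∈-comps⁺ : ∀ n w → Admissible w → sum w ≡ n → w ∈ comps n
  ∈-comps⁺ n w = ∈-compsFuel⁺ (suc n) n w NP.≤-refl

  comps-unique : ∀ n → Unique (comps n)
  comps-unique n = compsFuel-unique (suc n) n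

  Us-D-injective : ∀ a a' (X Y : List Step) → Us a ++ D ∷ X ≡ Us a' ++ D ∷ Y → X ≡ Y
  Us-D-injective zero zero X Y e = LP.∷-injectiveʳ e
  Us-D-injective zero (suc a') X Y ()
  Us-D-injective (suc a) zero X Y ()
  Us-D-injective (suc a) (suc a') X Y e = Us-D-injective a a' X Y (LP.∷-injectiveʳ e)

  Ds-injective : ∀ f f' (X Y : List Step) → NotD X → NotD Y → Ds f ++ X ≡ Ds f' ++ Y → f ≡ f' × X ≡ Y
  Ds-injective zero zero X Y nx ny e = refl , e
  Ds-injective zero (suc f') (D ∷ X) Y () ny e
  Ds-injective zero (suc f') (U ∷ X) Y nx ny ()
  Ds-injective zero (suc f') [] Y nx ny ()
  Ds-injective (suc f) zero X (D ∷ Y) nx () e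
  Ds-injective (suc f) zero X (U ∷ Y) nx ny ()
  Ds-injective (suc f) zero X [] nx ny ()
  Ds-injective (suc f) (suc f') X Y nx ny e with Ds-injective f f' X Y nx ny (LP.∷-injectiveʳ e)
  ... | a , b = cong suc a , b

  runs'-injective : ∀ r r' → runs' r ≡ runs' r' → r ≡ r'
  runs'-injective [] [] e = refl
  runs'-injective [] (g ∷ r') ()
  runs'-injective (g ∷ r) [] ()
  runs'-injective (g ∷ r) (g' ∷ r') e with Ds-injective g g' (runs' r) (runs' r') (NotD-runs' r) (NotD-runs' r')
      (LP.∷-injectiveʳ e)
  ... | a , b = cong₂ _∷_ a (runs'-injective r r' b)

  path-injective : ∀ {w w'} → Admissible w → Admissible w' → path w ≡ path w' → w ≡ w'
  path-injective {[]} {[]} _ _ e = refl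
  path-injective {[]} {f ∷ r} _ _ ()
  path-injective {f ∷ r} {[]} _ _ ()
  path-injective {suc f ∷ r} {suc f' ∷ r'} _ _ e with Ds-injective f f' (runs' r) (runs' r') (NotD-runs' r) (NotD-runs' r')
    (Us-D-injective (suc (excess (suc f ∷ r))) (suc (excess (suc f' ∷ r'))) _ _ e)
  ... | a , b = cong₂ _∷_ (cong suc a) (runs'-injective r r' b)
  path-injective {zero ∷ r} ((() , _) ∷ _) _ e
  path-injective {suc f ∷ r} {zero ∷ r'} _ ((() , _) ∷ _) e

  comps-Admissible : ∀ n → All Admissible (comps n)
  comps-Admissible n = All.tabulate (λ mem → proj₁ (∈-comps⁻ n mem))

  paths : ℕ → List (List Step)
  paths n = map path (comps n)

  paths-unique : ∀ n → Unique (paths n)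
  paths-unique n = Unique-map Admissible path (comps-Admissible n) path-injective (comps-unique n)

  𝓕↭paths : ∀ n → 𝓕 n p ↭ paths n
  𝓕↭paths n = ∼bag⇒↭ (unique∧set⇒bag (𝓕-unique {n}) (paths-unique n) (mk⇔ to from))
    where
    to : ∀ {x} → x ∈ 𝓕 n p → x ∈ paths n
    to {x} mem with InF⇒path n x (∈𝓕⇒InF {n} mem)
    ... | w , v , s , refl = MP.∈-map⁺ path (∈-comps⁺ n w v s)
    from : ∀ {x} → x ∈ paths n → x ∈ 𝓕 n p
    from mem with MP.∈-map⁻ path mem
    ... | w , mw , refl with ∈-comps⁻ n mw
    ...   | v , s = InF⇒∈𝓕 {n} (path-InF n w v s)

  mutual
    compsFuel-suc : ∀ t n → n < t → compsFuel t n ≡ compsFuel (suc t) n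
    compsFuel-suc (suc t) zero _ = refl
    compsFuel-suc (suc t) (suc n) (s≤s lt) = compsWithFirstIn-suc t (suc n) (partsUpTo p) lt (partsUpTo-positive p)

    compsWithFirstIn-suc : ∀ t m fs → m ≤ t → All (1 ≤_) fs → compsWithFirstIn t m fs ≡ compsWithFirstIn (suc t) m fs
    compsWithFirstIn-suc t m [] le a = refl
    compsWithFirstIn-suc t m (f ∷ fs) le (1≤f ∷ a) = cong₂ _++_ (compsWithFirst-suc t m f le 1≤f)
        (compsWithFirstIn-suc t m fs le a)

    compsWithFirst-suc : ∀ t m f → m ≤ t → 1 ≤ f → compsWithFirst t m f ≡ compsWithFirst (suc t) m f
    compsWithFirst-suc t m f le 1≤f with f ℕ.≤? m
    ... | yes f≤m = cong (map (f ∷_)) (compsFuel-suc t (m ∸ f) (NP.≤-trans (NP.∸-monoʳ-< 1≤f f≤m) le))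
    ... | no _ = refl

    partsUpTo-positive : ∀ m → All (1 ≤_) (partsUpTo m)
    partsUpTo-positive zero = []
    partsUpTo-positive (suc m) = s≤s z≤n ∷ partsUpTo-positive m

  compsFuel≡comps : ∀ t n → n < t → compsFuel t n ≡ comps n
  compsFuel≡comps (suc t) n (s≤s le) with NP.m≤n⇒m<n∨m≡n le
  ... | inj₂ refl = refl
  ... | inj₁ lt = trans (sym (compsFuel-suc t n lt)) (compsFuel≡comps t n lt)

-- Covers as single swaps

module Covers (p : ℕ) (2≤p : 2 ≤ p) where

  open Encoding p

  isMax : ℕ → Bool
  isMax f = f ℕ.≡ᵇ p

  isMax⇒≡ : ∀ f → isMax f ≡ true → f ≡ p
  isMax⇒≡ f e = NP.≡ᵇ⇒≡ f p (Equivalence.from T-≡ e)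

  isMax-false⇒≢ : ∀ {f} → isMax f ≡ false → f ≢ p
  isMax-false⇒≢ e refl = subst T e (NP.≡⇒≡ᵇ p p refl)

  isMax-p : isMax p ≡ true
  isMax-p = Equivalence.to T-≡ (NP.≡⇒≡ᵇ p p refl)

  isMax-< : ∀ f → f < p → isMax f ≡ false
  isMax-< f f<p with isMax f in e
  ... | true  = ⊥-elim (NP.<-irrefl (isMax⇒≡ f e) f<p)
  ... | false = refl

  atLeast2 : ℕ → Bool
  atLeast2 (suc (suc _)) = true
  atLeast2 _             = false

  atLeast2⇒ : ∀ f → atLeast2 f ≡ true → Σ ℕ λ f' → f ≡ suc (suc f')
  atLeast2⇒ (suc (suc f)) _ = f , refl

  atLeast2-≥ : ∀ f → 2 ≤ f → atLeast2 f ≡ true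
  atLeast2-≥ (suc (suc f)) _         = refl
  atLeast2-≥ (suc zero)    (s≤s ())

  bit : Bool → ℕ
  bit true  = 1
  bit false = 0

  optional : ∀ {A : Set} → Bool → A → List A
  optional true  x = x ∷ []
  optional false x = []

  length-optional : ∀ {A : Set} b (x : A) → length (optional b x) ≡ bit b
  length-optional true  x = refl
  length-optional false x = refl

  ∈-optional : ∀ {A : Set} b {x y : A} → y ∈ optional b x → b ≡ true × y ≡ x
  ∈-optional true (here refl) = refl , refl

  optional-unique : ∀ {A : Set} b (x : A) → Unique (optional b x)
  optional-unique true  x = [] ∷ []
  optional-unique false x = []

  ∧-true₁ : ∀ {a b} → a ∧ b ≡ true → a ≡ true
  ∧-true₁ {true} _ = refl

  ∧-true₂ : ∀ {a b} → a ∧ b ≡ true → b ≡ true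
  ∧-true₂ {true} e = e

  not-true : ∀ {a} → not a ≡ true → a ≡ false
  not-true {false} _ = refl

  ¬isMax⇒≢ : ∀ f → not (isMax f) ≡ true → f ≢ p
  ¬isMax⇒≢ f e = isMax-false⇒≢ (not-true e)

  -- A lower cover lowers one peak UD to DU: the first peak if f₁ ≥ 2, giving (1, f₁ − 1, …), or
  -- the peak between fᵢ and fᵢ₊₁ if fᵢ < p and fᵢ₊₁ ≥ 2, giving (…, fᵢ + 1, fᵢ₊₁ − 1, …).
  lowerMoves : List ℕ → List (List ℕ)
  lowerMoves' : ℕ → List ℕ → List (List ℕ)

  lowerMoves [] = []
  lowerMoves (f ∷ r) = optional (atLeast2 f) (1 ∷ (f ∸ 1) ∷ r) ++ lowerMoves' f r

  lowerMoves' f [] = []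
  lowerMoves' f (g ∷ r) = optional (not (isMax f) ∧ atLeast2 g) (suc f ∷ (g ∸ 1) ∷ r) ++ map (f ∷_) (lowerMoves' g r)

  -- An upper cover raises one valley DU to UD, moving a unit from fᵢ to fᵢ₊₁ if fᵢ₊₁ < p and
  -- fᵢ ≥ 2; for i = 1 also fᵢ = 1 is allowed, and this part is absorbed into the first ascent.
  moveRight : ℕ → ℕ → List ℕ → List ℕ
  moveRight (suc zero) g r = suc g ∷ r
  moveRight f g r = (f ∸ 1) ∷ suc g ∷ r

  upperMoves' : ℕ → List ℕ → List (List ℕ)
  upperMoves' f [] = []
  upperMoves' f (g ∷ r) = optional (atLeast2 f ∧ not (isMax g)) ((f ∸ 1) ∷ suc g ∷ r) ++ map (f ∷_) (upperMoves' g r)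

  upperMoves : List ℕ → List (List ℕ)
  upperMoves [] = []
  upperMoves (f ∷ []) = []
  upperMoves (f ∷ g ∷ r) = optional (not (isMax g)) (moveRight f g r) ++ map (f ∷_) (upperMoves' g r)

  lowerCount' : (previousIsMax : Bool) → List ℕ → ℕ
  lowerCount' b [] = 0
  lowerCount' b (f ∷ r) = bit (not b ∧ atLeast2 f) + lowerCount' (isMax f) r

  upperCount' : (previousAtLeast2 : Bool) → List ℕ → ℕ
  upperCount' b [] = 0
  upperCount' b (g ∷ r) = bit (b ∧ not (isMax g)) + upperCount' (atLeast2 g) r

  lowerCount upperCount : List ℕ → ℕ
  lowerCount w = lowerCount' false w
  upperCount [] = 0
  upperCount (f ∷ r) = upperCount' true r

  length-lowerMoves' : ∀ f r → length (lowerMoves' f r) ≡ lowerCount' (isMax f) r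
  length-lowerMoves' f [] = refl
  length-lowerMoves' f (g ∷ r) = trans (LP.length-++ (optional (not (isMax f) ∧ atLeast2 g) _))
    (cong₂ _+_ (length-optional _ _) (trans (LP.length-map (f ∷_) (lowerMoves' g r)) (length-lowerMoves' g r)))

  length-lowerMoves : ∀ w → length (lowerMoves w) ≡ lowerCount w
  length-lowerMoves [] = refl
  length-lowerMoves (f ∷ r) = trans (LP.length-++ (optional (atLeast2 f) _))
      (cong₂ _+_ (length-optional _ _) (length-lowerMoves' f r))

  length-upperMoves' : ∀ f r → length (upperMoves' f r) ≡ upperCount' (atLeast2 f) r
  length-upperMoves' f [] = refl
  length-upperMoves' f (g ∷ r) = trans (LP.length-++ (optional (atLeast2 f ∧ not (isMax g)) _))
    (cong₂ _+_ (length-optional _ _) (trans (LP.length-map (f ∷_) (upperMoves' g r)) (length-upperMoves' g r)))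

  length-upperMoves : ∀ w → length (upperMoves w) ≡ upperCount w
  length-upperMoves [] = refl
  length-upperMoves (f ∷ []) = refl
  length-upperMoves (f ∷ g ∷ r) = trans (LP.length-++ (optional (not (isMax g)) _))
    (cong₂ _+_ (length-optional _ _) (trans (LP.length-map (f ∷_) (upperMoves' g r)) (length-upperMoves' g r)))

  
  n≢1+n : ∀ n → n ≢ suc n
  n≢1+n n e = NP.1+n≢n (sym e)

  head₀ : List ℕ → ℕ
  head₀ [] = 0
  head₀ (x ∷ _) = x

  lowerMoves'-head : ∀ f r {v} → v ∈ lowerMoves' f r → head₀ v ≡ f ⊎ head₀ v ≡ suc f
  lowerMoves'-head f (g ∷ r) mem with MP.∈-++⁻ (optional (not (isMax f) ∧ atLeast2 g) (suc f ∷ (g ∸ 1) ∷ r)) mem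
  ... | inj₁ a with ∈-optional (not (isMax f) ∧ atLeast2 g) a
  ...   | _ , refl = inj₂ refl
  lowerMoves'-head f (g ∷ r) mem | inj₂ b with MP.∈-map⁻ (f ∷_) b
  ...   | _ , _ , refl = inj₁ refl

  Unique-map-∷ : ∀ (f : ℕ) {xs} → Unique xs → Unique (map (f ∷_) xs)
  Unique-map-∷ f u = UP.map⁺ LP.∷-injectiveʳ u

  lowerMoves'-unique : ∀ f r → Unique (lowerMoves' f r)
  lowerMoves'-unique f [] = []
  lowerMoves'-unique f (g ∷ r) = UP.++⁺ (optional-unique _ _) (Unique-map-∷ f (lowerMoves'-unique g r)) disj
    where
    disj : ∀ {v} → ¬ (v ∈ optional (not (isMax f) ∧ atLeast2 g) (suc f ∷ (g ∸ 1) ∷ r) × v ∈ map (f ∷_) (lowerMoves' g r))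
    disj (a , b) with ∈-optional (not (isMax f) ∧ atLeast2 g) a | MP.∈-map⁻ (f ∷_) b
    ... | _ , refl | _ , _ , e = n≢1+n f (sym (LP.∷-injectiveˡ e))

  lowerMoves-unique : ∀ w → Unique (lowerMoves w)
  lowerMoves-unique [] = []
  lowerMoves-unique (f ∷ r) = UP.++⁺ (optional-unique _ _) (lowerMoves'-unique f r) disj
    where
    disj : ∀ {v} → ¬ (v ∈ optional (atLeast2 f) (1 ∷ (f ∸ 1) ∷ r) × v ∈ lowerMoves' f r)
    disj (a , b) with ∈-optional (atLeast2 f) a
    ... | bf , refl with atLeast2⇒ f bf | lowerMoves'-head f r b
    ...   | f' , refl | inj₁ e = NP.0≢1+n (suc-injective e)
    ...   | f' , refl | inj₂ e = NP.0≢1+n (suc-injective e)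

  upperMoves'-unique : ∀ f r → Unique (upperMoves' f r)
  upperMoves'-unique f [] = []
  upperMoves'-unique f (g ∷ r) = UP.++⁺ (optional-unique _ _) (Unique-map-∷ f (upperMoves'-unique g r)) disj
    where
    disj : ∀ {v} → ¬ (v ∈ optional (atLeast2 f ∧ not (isMax g)) ((f ∸ 1) ∷ suc g ∷ r) × v ∈ map (f ∷_) (upperMoves' g r))
    disj (a , b) with ∈-optional (atLeast2 f ∧ not (isMax g)) a
    ... | bfg , refl with atLeast2⇒ f (∧-true₁ bfg) | MP.∈-map⁻ (f ∷_) b
    ...   | f' , refl | _ , _ , e = n≢1+n (suc f') (LP.∷-injectiveˡ e)

  upperMoves-unique : ∀ w → Admissible w → Unique (upperMoves w)
  upperMoves-unique [] _ = []
  upperMoves-unique (f ∷ []) _ = []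
  upperMoves-unique (f ∷ g ∷ r) ((1≤f , _) ∷ (1≤g , _) ∷ _) = UP.++⁺ (optional-unique _ _)
      (Unique-map-∷ f (upperMoves'-unique g r)) disj
    where
    hd-up1 : ∀ f g → 1 ≤ f → 1 ≤ g → head₀ (moveRight f g r) ≢ f
    hd-up1 (suc zero) (suc g) _ _ e = NP.0≢1+n (sym (suc-injective e))
    hd-up1 (suc (suc f)) g _ _ e = n≢1+n (suc f) e
    disj : ∀ {v} → ¬ (v ∈ optional (not (isMax g)) (moveRight f g r) × v ∈ map (f ∷_) (upperMoves' g r))
    disj (a , b) with ∈-optional (not (isMax g)) a | MP.∈-map⁻ (f ∷_) b
    ... | _ , refl | _ , _ , e = hd-up1 f g 1≤f 1≤g (cong head₀ e)

  NonEmpty : List ℕ → Set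
  NonEmpty v = Σ ℕ λ f → Σ (List ℕ) λ r → v ≡ f ∷ r

  lowerMoves'-swap : ∀ f r {v} → Admissible (f ∷ r) → v ∈ lowerMoves' f r →
           Swap U D (runs (f ∷ r)) (runs v) × excess v ≡ excess (f ∷ r) × Admissible v × NonEmpty v
  lowerMoves'-swap zero r ((() , _) ∷ _) mem
  lowerMoves'-swap (suc f₀) (g ∷ r) {v} adm@((1≤f , f≤p) ∷ (1≤g , g≤p) ∷ adm') mem with MP.∈-++⁻
      (optional (not (isMax (suc f₀)) ∧ atLeast2 g) (suc (suc f₀) ∷ (g ∸ 1) ∷ r)) mem
  ... | inj₁ a with ∈-optional (not (isMax (suc f₀)) ∧ atLeast2 g) a
  ...   | c , refl with atLeast2⇒ g (∧-true₂ c)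
  ...     | g₀ , refl =
    (Ds (suc f₀) , D ∷ Ds g₀ ++ runs' r , refl , sym (Ds-snoc (suc f₀) (U ∷ D ∷ Ds g₀ ++ runs' r))) ,
    sym (+-suc f₀ (g₀ + excess r)) ,
    ((s≤s z≤n , NP.≤∧≢⇒< f≤p (¬isMax⇒≢ (suc f₀) (∧-true₁ c))) ∷ (s≤s z≤n , NP.≤-trans (NP.n≤1+n _) g≤p) ∷ adm') ,
    _ , _ , refl
  lowerMoves'-swap (suc f₀) (g ∷ r) {v} adm@((1≤f , f≤p) ∷ adm') mem | inj₂ b with MP.∈-map⁻ (suc f₀ ∷_) b
  ... | v' , m' , refl with lowerMoves'-swap g r adm' m'
  ...   | swap , excess≡ , adm-v , (g' , r' , refl) = Swap-++ (Ds (suc f₀)) (Swap-∷ U swap) , cong (_+_ f₀) excess≡ , ((1≤f , f≤p) ∷ adm-v) , _ , _ ,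
      refl

  lowerMoves-swap : ∀ w {v} → Admissible w → v ∈ lowerMoves w → Swap U D (path w) (path v) × Admissible v
  lowerMoves-swap (f ∷ r) {v} adm@((1≤f , f≤p) ∷ adm') mem with MP.∈-++⁻ (optional (atLeast2 f) (1 ∷ (f ∸ 1) ∷ r)) mem
  ... | inj₁ a with ∈-optional (atLeast2 f) a
  ...   | c , refl with atLeast2⇒ f c
  ...     | f₀ , refl =
    (Us (suc (f₀ + excess r)) , Ds (suc f₀) ++ runs' r , sym (Us-snoc (suc (f₀ + excess r)) (D ∷ Ds (suc f₀) ++ runs' r)) , refl)
        ,
    ((s≤s z≤n , NP.≤-trans (s≤s z≤n) 2≤p) ∷ (s≤s z≤n , NP.≤-trans (NP.n≤1+n _) f≤p) ∷ adm')
  lowerMoves-swap (f ∷ r) {v} adm mem | inj₂ b with lowerMoves'-swap f r adm b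
  ... | swap , excess≡ , adm-v , (g' , r' , refl) = subst (λ z → Swap U D (path (f ∷ r)) (Us (suc z) ++ runs (g' ∷ r'))) (sym excess≡)
      (Swap-++ (Us (suc (excess (f ∷ r)))) swap) , adm-v

  valley-swap : ∀ f₀ g r → Admissible (suc (suc f₀) ∷ g ∷ r) → g ≢ p →
            Swap D U (runs (suc (suc f₀) ∷ g ∷ r)) (runs (suc f₀ ∷ suc g ∷ r)) × excess (suc f₀ ∷ suc g ∷ r) ≡ excess
                (suc (suc f₀) ∷ g ∷ r) × Admissible (suc f₀ ∷ suc g ∷ r)
  valley-swap f₀ (suc g₀) r ((1≤f , f≤p) ∷ (1≤g , g≤p) ∷ adm') ne =
    (Ds (suc f₀) , Ds (suc g₀) ++ runs' r , sym (Ds-snoc (suc f₀) (U ∷ Ds (suc g₀) ++ runs' r)) , refl) ,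
    +-suc f₀ (g₀ + excess r) ,
    ((s≤s z≤n , NP.≤-trans (NP.n≤1+n _) f≤p) ∷ (s≤s z≤n , NP.≤∧≢⇒< g≤p ne) ∷ adm')

  upperMoves'-swap : ∀ f r {v} → Admissible (f ∷ r) → v ∈ upperMoves' f r →
            Swap D U (runs (f ∷ r)) (runs v) × excess v ≡ excess (f ∷ r) × Admissible v × NonEmpty v
  upperMoves'-swap f (g ∷ r) {v} adm mem with MP.∈-++⁻ (optional (atLeast2 f ∧ not (isMax g)) ((f ∸ 1) ∷ suc g ∷ r)) mem
  ... | inj₁ a with ∈-optional (atLeast2 f ∧ not (isMax g)) a
  ...   | c , refl with atLeast2⇒ f (∧-true₁ c)
  ...     | f₀ , refl with valley-swap f₀ g r adm (¬isMax⇒≢ g (∧-true₂ c))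
  ...       | swap , excess≡ , adm-v = swap , excess≡ , adm-v , _ , _ , refl
  upperMoves'-swap f (g ∷ r) {v} adm@((1≤f , f≤p) ∷ adm') mem | inj₂ b with MP.∈-map⁻ (f ∷_) b
  ... | v' , m' , refl with upperMoves'-swap g r adm' m'
  ...   | swap , excess≡ , adm-v , (g' , r' , refl) = Swap-++ (Ds f) (Swap-∷ U swap) , cong (_+_ (f ∸ 1)) excess≡ , ((1≤f , f≤p) ∷ adm-v) , _ , _ ,
      refl

  upperMoves-inner-swap : ∀ f g r {v} → Admissible (f ∷ g ∷ r) → v ∈ map (f ∷_) (upperMoves' g r) → Swap D U (path (f ∷ g ∷ r))
      (path v) × Admissible v
  upperMoves-inner-swap f g r {v} adm@((1≤f , f≤p) ∷ adm') b with MP.∈-map⁻ (f ∷_) b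
  ... | v' , m' , refl with upperMoves'-swap g r adm' m'
  ...   | swap , excess≡ , adm-v , (g' , r' , refl) =
    subst (λ z → Swap D U (path (f ∷ g ∷ r)) (Us (suc ((f ∸ 1) + z)) ++ runs (f ∷ g' ∷ r'))) (sym excess≡)
      (Swap-++ (Us (suc (excess (f ∷ g ∷ r)))) (Swap-++ (Ds f) (Swap-∷ U swap))) , ((1≤f , f≤p) ∷ adm-v)

  upperMoves-swap : ∀ w {v} → Admissible w → v ∈ upperMoves w → Swap D U (path w) (path v) × Admissible v
  upperMoves-swap (zero ∷ _) ((() , _) ∷ _) mem
  upperMoves-swap (suc zero ∷ zero ∷ r) (_ ∷ (() , _) ∷ _) mem
  upperMoves-swap (suc zero ∷ suc g₀ ∷ r) {v} adm@((1≤f , f≤p) ∷ (1≤g , g≤p) ∷ adm') mem with MP.∈-++⁻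
      (optional (not (isMax (suc g₀))) (moveRight 1 (suc g₀) r)) mem
  ... | inj₁ a with ∈-optional (not (isMax (suc g₀))) a
  ...   | c , refl =
    (Us (suc (g₀ + excess r)) , Ds (suc g₀) ++ runs' r , refl , sym (Us-snoc (suc (g₀ + excess r)) (D ∷ Ds (suc g₀) ++ runs' r)))
        ,
    ((s≤s z≤n , NP.≤∧≢⇒< g≤p (¬isMax⇒≢ (suc g₀) c)) ∷ adm')
  upperMoves-swap (suc zero ∷ suc g₀ ∷ r) {v} adm mem | inj₂ b = upperMoves-inner-swap 1 (suc g₀) r adm b
  upperMoves-swap (suc (suc f₀) ∷ g ∷ r) {v} adm mem with MP.∈-++⁻ (optional (not (isMax g)) (moveRight (suc (suc f₀)) g r)) mem
  ... | inj₁ a with ∈-optional (not (isMax g)) a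
  ...   | c , refl with valley-swap f₀ g r adm (¬isMax⇒≢ g c)
  ...     | swap , excess≡ , adm-v = subst (λ z → Swap D U (path (suc (suc f₀) ∷ g ∷ r)) (Us (suc z) ++ runs (suc f₀ ∷ suc g ∷ r))) (sym excess≡)
                             (Swap-++ (Us (suc (excess (suc (suc f₀) ∷ g ∷ r)))) swap) , adm-v
  upperMoves-swap (suc (suc f₀) ∷ g ∷ r) {v} adm mem | inj₂ b = upperMoves-inner-swap (suc (suc f₀)) g r adm b

  swap-∈𝓕 : ∀ {a b} n w v → Admissible w → sum w ≡ n → Admissible v → Swap a b (path w) (path v) → path v ∈ 𝓕 n p
  swap-∈𝓕 n w v adm-w refl adm-v swap = InF⇒∈𝓕 {n} (path-InF n v adm-v sum-v)
    where
    sum-v : sum v ≡ sum w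
    sum-v = NP.*-cancelˡ-≡ (sum v) (sum w) 2
              (trans (sym (length-path v adm-v)) (trans (sym (Swap-length swap)) (length-path w adm-w)))

  lowerMove-isLowerCover : ∀ n w {v} → Admissible w → sum w ≡ n → v ∈ lowerMoves w →
                           path v ∈ 𝓕 n p × IsLowerCoverOf n p (path v) (path w)
  lowerMove-isLowerCover n w {v} adm-w sum-w v∈ with lowerMoves-swap w adm-w v∈
  ... | swap@(X , Y , w≡ , v≡) , adm-v = v∈𝓕 , subst₂ (IsLowerCoverOf n p) (sym v≡) (sym w≡)
          (valley-isLowerCoverOf-peak {n} {p} X Y (subst (_∈ 𝓕 n p) v≡ v∈𝓕) (subst (_∈ 𝓕 n p) w≡ w∈𝓕))
    where
    v∈𝓕 : path v ∈ 𝓕 n p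
    v∈𝓕 = swap-∈𝓕 n w v adm-w sum-w adm-v swap
    w∈𝓕 : path w ∈ 𝓕 n p
    w∈𝓕 = InF⇒∈𝓕 {n} (path-InF n w adm-w sum-w)

  upperMove-isUpperCover : ∀ n w {v} → Admissible w → sum w ≡ n → v ∈ upperMoves w →
                           path v ∈ 𝓕 n p × IsUpperCoverOf n p (path v) (path w)
  upperMove-isUpperCover n w {v} adm-w sum-w v∈ with upperMoves-swap w adm-w v∈
  ... | swap@(X , Y , w≡ , v≡) , adm-v = v∈𝓕 , subst₂ (IsLowerCoverOf n p) (sym w≡) (sym v≡)
          (valley-isLowerCoverOf-peak {n} {p} X Y (subst (_∈ 𝓕 n p) w≡ w∈𝓕) (subst (_∈ 𝓕 n p) v≡ v∈𝓕))
    where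
    v∈𝓕 : path v ∈ 𝓕 n p
    v∈𝓕 = swap-∈𝓕 n w v adm-w sum-w adm-v swap
    w∈𝓕 : path w ∈ 𝓕 n p
    w∈𝓕 = InF⇒∈𝓕 {n} (path-InF n w adm-w sum-w)

  ¬isMax-1 : not (isMax 1) ≡ true
  ¬isMax-1 rewrite isMax-< 1 2≤p = refl

  runs-nonEmpty : ∀ s {X} → runs s ≡ D ∷ X → NonEmpty s
  runs-nonEmpty (x ∷ y) e = x , y , refl

  lowerMove-in-runs' : ∀ f g r {h g0 Q} → Admissible (f ∷ g ∷ r) → not (isMax f) ≡ true → Below h g0 Q (U ∷ Ds g ++ runs' r) →
      PeakLowerable g0 Q → NoUU Q →
        Σ (List Step) λ S → (Σ (List ℕ) λ s → s ∈ lowerMoves' f (g ∷ r) × runs s ≡ Ds f ++ S) × Below h g0 Q S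
  lowerMove-in-runs' f zero r (_ ∷ (() , _) ∷ _) nf b pk noUU
  lowerMove-in-runs' f (suc (suc g₀)) r adm nf b pk noUU =
    D ∷ U ∷ Ds (suc g₀) ++ runs' r ,
    (suc f ∷ suc g₀ ∷ r , MP.∈-++⁺ˡ (subst (λ z → suc f ∷ suc g₀ ∷ r ∈ optional (z ∧ true) (suc f ∷ suc g₀ ∷ r)) (sym nf)
        (here refl)) ,
      sym (Ds-snoc f (U ∷ Ds (suc g₀) ++ runs' r))) ,
    lower-peak b pk
  lowerMove-in-runs' f (suc zero) [] adm nf b pk noUU = ⊥-elim (¬lower-final-peak b pk)
  lowerMove-in-runs' f (suc zero) (g' ∷ r') adm@(_ ∷ adm') nf b pk noUU with skip-peak b pk noUU
  ... | h2 , g2 , Q'' , b2 , pk2 , nu2 , resume with lowerMove-in-runs' 1 g' r' adm' ¬isMax-1 b2 pk2 nu2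
  ...   | S'' , (s' , m' , e') , b3 with runs-nonEmpty s' e'
  ...     | x , y , refl =
    U ∷ D ∷ S'' ,
    (f ∷ s' , MP.∈-++⁺ʳ (optional (not (isMax f) ∧ atLeast2 1) _) (MP.∈-map⁺ (f ∷_) m') , cong (λ z → Ds f ++ U ∷ z) e') ,
    resume b3

  lowerMove-after-ascent : ∀ f r i j {h g0 Q} → Admissible (f ∷ r) → i + suc j ≡ suc (excess (f ∷ r)) → Below h g0 Q
      (U ∷ Us j ++ runs (f ∷ r)) → PeakLowerable g0 Q → NoUU Q →
        Σ (List Step) λ S → (Σ (List ℕ) λ v → v ∈ lowerMoves (f ∷ r) × Us i ++ S ≡ path v) × Below h g0 Q S
  lowerMove-after-ascent f r i (suc j) adm e (bUU b) (inj₁ 1≤g) noUU with lowerMove-after-ascent f r (suc i) j adm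
      (trans (sym (+-suc i (suc j))) e) b (inj₁ 1≤g) (NoUU-tail noUU)
  ... | S , (v , m , e') , b' = U ∷ S , (v , m , trans (Us-snoc i S) e') , bUU b'
  lowerMove-after-ascent f r i (suc j) adm e (bUU b) (inj₂ ()) noUU
  lowerMove-after-ascent f r i (suc j) adm e (bDU b) pk noUU with lowerMove-after-ascent f r (suc i) j adm
      (trans (sym (+-suc i (suc j))) e) b (inj₁ (s≤s z≤n)) (NoUU-tail noUU)
  ... | S , (v , m , e') , b' = U ∷ S , (v , m , trans (Us-snoc i S) e') , bDU b'
  lowerMove-after-ascent zero r i zero ((() , _) ∷ _) e b pk noUU
  lowerMove-after-ascent (suc (suc f₀)) r i zero adm e b pk noUU =
    D ∷ U ∷ Ds (suc f₀) ++ runs' r ,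
    (1 ∷ suc f₀ ∷ r , MP.∈-++⁺ˡ {ys = lowerMoves' (suc (suc f₀)) r} (here refl) , cong
        (λ z → Us z ++ D ∷ U ∷ Ds (suc f₀) ++ runs' r) ie) ,
    lower-peak b pk
    where
    ie : i ≡ suc (f₀ + excess r)
    ie = suc-injective (trans (trans (cong suc (sym (NP.+-identityʳ i))) (sym (+-suc i 0))) e)
  lowerMove-after-ascent (suc zero) [] i zero adm e b pk noUU = ⊥-elim (¬lower-final-peak b pk)
  lowerMove-after-ascent (suc zero) (g ∷ r') i zero adm@(_ ∷ adm') e b pk noUU with skip-peak b pk noUU
  ... | h2 , g2 , Q'' , b2 , pk2 , nu2 , resume with lowerMove-in-runs' 1 g r' adm ¬isMax-1 b2 pk2 nu2
  ...   | S'' , (s' , m' , e') , b3 with runs-nonEmpty s' e' | lowerMoves'-swap 1 (g ∷ r') adm m'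
  ...     | x , y , refl | _ , excess≡ , _ =
    U ∷ D ∷ S'' ,
    (s' , m' , trans (Us-snoc i (D ∷ S'')) (sym (trans (cong (λ z → Us (suc z) ++ runs s') (trans excess≡ (sym ie)))
        (cong (λ z → Us (suc i) ++ z) e')))) ,
    resume b3
    where
    ie : i ≡ excess (1 ∷ g ∷ r')
    ie = suc-injective (trans (trans (cong suc (sym (NP.+-identityʳ i))) (sym (+-suc i 0))) e)

  lowerMove-in-runs : ∀ f r t e {h Q} → Admissible (f ∷ r) → t + e ≡ f → Below h 0 Q (Ds e ++ runs' r) → NoDUU Q → NoDp
      (Ds t ++ Q) → Q ≢ Ds e ++ runs' r →
        Σ (List Step) λ S → (Σ (List ℕ) λ s → s ∈ lowerMoves' f r × runs s ≡ Ds t ++ S) × Below h 0 Q S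
  lowerMove-in-runs f r t (suc e) {Q = D ∷ Q'} adm te (bDD b) noDUU noDp ne
    with lowerMove-in-runs f r (suc t) e adm (trans (sym (+-suc t e)) te) b (NoDUU-tail noDUU) (subst NoDp (Ds-snoc t Q') noDp)
        (λ x → ne (cong (D ∷_) x))
  ... | S , (s , m , es) , b' = D ∷ S , (s , m , trans es (sym (Ds-snoc t S))) , bDD b'
  lowerMove-in-runs f [] t zero adm te bnil noDUU noDp ne = ⊥-elim (ne refl)
  lowerMove-in-runs f (g ∷ r') t zero {Q = U ∷ Q'} adm@(_ ∷ adm') te (bUU b) noDUU noDp ne
    with lowerMove-in-runs g r' 0 g adm' refl b (NoDUU-tail noDUU)
        (λ o → noDp (subst (Occurs _) (LP.++-assoc (Ds t) (U ∷ []) Q') ((Ds t ++ U ∷ []) ++ⁱ o))) (λ x → ne (cong (U ∷_) x))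
  ... | S' , (s' , m' , es) , b' with lowerMoves'-swap g r' adm' m'
  ...   | _ , _ , _ , (x , y , refl) =
    U ∷ S' ,
    (f ∷ s' , MP.∈-++⁺ʳ (optional (not (isMax f) ∧ atLeast2 g) _) (MP.∈-map⁺ (f ∷_) m') ,
      trans (cong (λ z → Ds z ++ U ∷ runs s') (sym (trans (sym (NP.+-identityʳ t)) te))) (cong (λ z → Ds t ++ U ∷ z) es)) ,
    bUU b'
  lowerMove-in-runs f (g ∷ r') t zero {Q = D ∷ Q'} adm te (bDU b) noDUU noDp ne
    with lowerMove-in-runs' f g r' adm nf (bDU b) (inj₂ tt) (NoUU-D∷ (NoDUU⇒NoUU-tail Q' noDUU))
    where
    tf : t ≡ f
    tf = trans (sym (NP.+-identityʳ t)) te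
    nf : not (isMax f) ≡ true
    nf with isMax f in ip
    ... | false = refl
    ... | true = ⊥-elim (noDp (here (subst (λ z → Prefix _≡_ (Ds (suc p)) (Ds z ++ D ∷ Q')) (sym (trans tf (isMax⇒≡ f ip)))
                                      (subst (Prefix _≡_ (Ds (suc p))) (sym (Ds-snoc p Q'))
                                          (Prefix-Ds (suc p) (suc p) Q' NP.≤-refl)))))
  ... | S , (s , m , es) , b' = S , (s , m , trans es (cong (λ z → Ds z ++ S) (sym (trans (sym (NP.+-identityʳ t)) te)))) , b'

  lowerMove-in-path : ∀ f r i j {h Q} → Admissible (f ∷ r) → i + j ≡ suc (excess (f ∷ r)) → Below h 0 Q (Us j ++ runs (f ∷ r)) →
      NoDUU Q → NoDp Q → Q ≢ Us j ++ runs (f ∷ r) →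
        Σ (List Step) λ S → (Σ (List ℕ) λ v → v ∈ lowerMoves (f ∷ r) × Us i ++ S ≡ path v) × Below h 0 Q S
  lowerMove-in-path f r i (suc j) {Q = U ∷ Q'} adm e (bUU b) noDUU noDp ne
    with lowerMove-in-path f r (suc i) j adm (trans (sym (+-suc i j)) e) b (NoDUU-tail noDUU) (λ o → noDp (there o))
        (λ x → ne (cong (U ∷_) x))
  ... | S , (v , m , e') , b' = U ∷ S , (v , m , trans (Us-snoc i S) e') , bUU b'
  lowerMove-in-path f r i (suc j) {Q = D ∷ Q'} adm e (bDU b) noDUU noDp ne = lowerMove-after-ascent f r i j adm e (bDU b)
      (inj₂ tt) (NoUU-D∷ (NoDUU⇒NoUU-tail Q' noDUU))
  lowerMove-in-path f r i zero adm e b noDUU noDp ne with lowerMove-in-runs f r 0 f adm refl b noDUU noDp ne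
  ... | S , (s , m , es) , b' with lowerMoves'-swap f r adm m
  ...   | _ , excess≡ , _ , (x , y , refl) =
    S , (s , MP.∈-++⁺ʳ (optional (atLeast2 f) _) m , sym (trans (cong (λ z → Us (suc z) ++ runs s) excess≡)
        (trans (cong (λ z → Us z ++ runs s) (sym ie)) (cong (λ z → Us i ++ z) es)))) , b'
    where
    ie : i ≡ suc (excess (f ∷ r))
    ie = trans (sym (NP.+-identityʳ i)) e

  -- Walk along Q and path w until Q first steps below; from there on Q stays strictly below or
  -- starts with D, so the next peak of path w that a lower move may lower still lies above Q.
  below-lowerMove : ∀ w {Q} → Admissible w → Below 0 0 Q (path w) → NoDUU Q → NoDp Q → Q ≢ path w →
          Σ (List ℕ) λ v → v ∈ lowerMoves w × Below 0 0 Q (path v)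
  below-lowerMove [] adm bnil noDUU noDp ne = ⊥-elim (ne refl)
  below-lowerMove (f ∷ r) adm b noDUU noDp ne with lowerMove-in-path f r 0 (suc (excess (f ∷ r))) adm refl b noDUU noDp ne
  ... | S , (v , m , e) , b' = v , m , subst (Below 0 0 _) e b'

  atLeast2-p : atLeast2 p ≡ true
  atLeast2-p = atLeast2-≥ p 2≤p

  descend-run : ∀ e r {h g Q} → Below h g (Ds (suc e) ++ runs' r) Q → ValleyRaisable g Q →
    Resumable h g (D ∷ runs' r) Q (Ds e ++_)
  descend-run zero r b vk = resumable [] _ refl b vk (λ b' → b')
  descend-run (suc e) r (bDU b) vk with descend-run e r b (inj₁ (s≤s z≤n))
  ... | resumable Q1 Q' refl b' vk' resume = resumable (U ∷ Q1) Q' refl b' vk' (λ x → bDU (resume x))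
  descend-run (suc e) r (bDD b) (inj₁ 1≤g) with descend-run e r b (inj₁ 1≤g)
  ... | resumable Q1 Q' refl b' vk' resume = resumable (D ∷ Q1) Q' refl b' vk' (λ x → bDD (resume x))
  descend-run (suc e) r (bDD b) (inj₂ ())

  p-1 : ℕ
  p-1 = p ∸ 1

  1+[p-1]≡p : suc p-1 ≡ p
  1+[p-1]≡p = NP.m+[n∸m]≡n {1} {p} (NP.≤-trans (s≤s z≤n) 2≤p)

  Ds-p : ∀ (Y : List Step) → Ds p ++ Y ≡ Ds p-1 ++ D ∷ Y
  Ds-p Y = trans (cong (λ z → Ds z ++ Y) (sym 1+[p-1]≡p)) (sym (Ds-snoc p-1 Y))

  -- Raising the valley before a run of length p would create D^(p+1). As Q avoids D^(p+1), it
  -- cannot follow that run down to its end, so the next valley is raisable.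
  skip-max-run : ∀ r {h g Q} → Below h g (D ∷ U ∷ Ds p ++ runs' r) Q → ValleyRaisable g Q → NoDp Q →
    Resumable h g (D ∷ runs' r) Q (λ X → D ∷ U ∷ Ds p-1 ++ X)
  skip-max-run r {h} {g} {Q} b vk nd = go (subst (λ z → Below h g (D ∷ U ∷ z) Q) (Ds-p (runs' r)) b) vk
    where
    vkFrom : ∀ {h' g' Q'} → Below h' g' (D ∷ runs' r) Q' → NoDp (D ∷ Ds p-1 ++ Q') → ValleyRaisable g' Q'
    vkFrom {Q' = U ∷ _} _ _ = inj₂ tt
    vkFrom {Q' = []} () _
    vkFrom {Q' = D ∷ Q''} _ nd2 = ⊥-elim (nd2 (here (subst (λ z → Prefix _≡_ (Ds (suc p)) (D ∷ z)) (sym (Ds-snoc p-1 Q''))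
       (Prefix-Ds (suc p) (suc (suc p-1)) Q'' (subst (λ z → suc p ≤ suc z) (sym 1+[p-1]≡p) NP.≤-refl)))))
    fin : ∀ {h2 g2 Q₂} → Below h2 g2 (Ds p-1 ++ D ∷ runs' r) Q₂ → (1 ≤ g2 ⊎ NoDp (D ∷ Q₂)) →
      Resumable h2 g2 (D ∷ runs' r) Q₂ (Ds p-1 ++_)
    fin b2 c with descend-Ds p-1 b2
    ... | _ , _ , Q1 , Q' , e , b' , inj₁ x , resume = resumable Q1 Q' e b' (inj₁ x) resume
    ... | _ , _ , Q1 , Q' , e , b' , inj₂ (refl , refl) , resume with c
    ...   | inj₁ x = resumable Q1 Q' e b' (inj₁ x) resume
    ...   | inj₂ nd2 = resumable Q1 Q' e b' (vkFrom b' (subst (λ z → NoDp (D ∷ z)) e nd2)) resume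
    go : Below h g (D ∷ U ∷ Ds p-1 ++ D ∷ runs' r) Q → ValleyRaisable g Q →
      Resumable h g (D ∷ runs' r) Q (λ X → D ∷ U ∷ Ds p-1 ++ X)
    go (bDU (bUU b2)) _ with fin b2 (inj₁ (s≤s z≤n))
    ... | resumable Q1 Q' refl b' vk' resume = resumable (U ∷ U ∷ Q1) Q' refl b' vk' (λ x → bDU (bUU (resume x)))
    go (bDU (bUD b2)) _ with fin b2 (inj₂ (λ o → nd (there o)))
    ... | resumable Q1 Q' refl b' vk' resume = resumable (U ∷ D ∷ Q1) Q' refl b' vk' (λ x → bDU (bUD (resume x)))
    go (bDD (bUU b2)) (inj₁ 1≤g) with fin b2 (inj₁ 1≤g)
    ... | resumable Q1 Q' refl b' vk' resume = resumable (D ∷ U ∷ Q1) Q' refl b' vk' (λ x → bDD (bUU (resume x)))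
    go (bDD (bUU b2)) (inj₂ ())
    go (bDD (bUD b2)) _ with fin b2 (inj₂ (λ o → nd (there o)))
    ... | resumable Q1 Q' refl b' vk' resume = resumable (D ∷ D ∷ Q1) Q' refl b' vk' (λ x → bDD (bUD (resume x)))

  NoDp-suffix : ∀ {Q} Q1 {Q'} → Q ≡ Q1 ++ Q' → NoDp Q → NoDp Q'
  NoDp-suffix Q1 refl nd o = nd (Q1 ++ⁱ o)

  upperMove-in-runs' : ∀ f g r {h g0 Q} → Admissible (f ∷ g ∷ r) → atLeast2 f ≡ true → Below h g0 (D ∷ U ∷ Ds g ++ runs' r) Q →
      ValleyRaisable g0 Q → NoDp Q →
        Σ (List Step) λ S → (Σ (List ℕ) λ s → s ∈ upperMoves' f (g ∷ r) × runs s ≡ Ds (f ∸ 1) ++ S) × Below h g0 S Q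
  upperMove-in-runs' zero g r adm () b vk nd
  upperMove-in-runs' (suc zero) g r adm () b vk nd
  upperMove-in-runs' (suc (suc f₀)) g r adm bf b vk nd with isMax g in ig
  ... | false = U ∷ D ∷ Ds g ++ runs' r , ((suc f₀ ∷ suc g ∷ r) , here refl , refl) , raise-valley b vk
  ... | true with isMax⇒≡ g ig
  ...   | refl with skip-max-run r b vk nd
  ...     | resumable Q1 Q' eq b' vk' resume with r | adm
  ...       | [] | _ = ⊥-elim (¬raise-final-valley b' vk')
  ...       | g₂ ∷ r₂ | _ ∷ adm' with upperMove-in-runs' p g₂ r₂ adm' atLeast2-p b' vk' (NoDp-suffix Q1 eq nd)
  ...         | S' , (s' , m' , es') , b'' with upperMoves'-swap p (g₂ ∷ r₂) adm' m'
  ...           | _ , _ , _ , (x , y , refl) =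
    D ∷ U ∷ Ds p-1 ++ S' ,
    (suc (suc f₀) ∷ s' , MP.∈-map⁺ (suc (suc f₀) ∷_) m' ,
      cong (D ∷_) (trans (cong (λ z → D ∷ Ds f₀ ++ U ∷ z) es') (sym (Ds-snoc f₀ (U ∷ Ds p-1 ++ S'))))) ,
    resume b''

  upperMove-first-valley : ∀ f g r {h g0 Q} → Admissible (f ∷ g ∷ r) → Below h g0 (D ∷ U ∷ Ds g ++ runs' r) Q → ValleyRaisable g0
      Q → NoDp Q →
         Σ (List Step) λ S → (Σ (List ℕ) λ s → s ∈ upperMoves (f ∷ g ∷ r) × path s ≡ Us (suc (excess (f ∷ g ∷ r))) ++ Ds (f ∸ 1)
             ++ S) × Below h g0 S Q
  upperMove-first-valley zero g r ((() , _) ∷ _) b vk nd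
  upperMove-first-valley (suc f₀) g r adm b vk nd with isMax g in ig
  upperMove-first-valley (suc zero) zero r (_ ∷ (() , _) ∷ _) b vk nd | false
  upperMove-first-valley (suc zero) (suc g₀) r adm b vk nd | false =
    U ∷ D ∷ Ds (suc g₀) ++ runs' r ,
    (suc (suc g₀) ∷ r , here refl , sym (Us-snoc (suc (g₀ + excess r)) (D ∷ Ds (suc g₀) ++ runs' r))) ,
    raise-valley b vk
  upperMove-first-valley (suc (suc f₁)) g r adm b vk nd | false with valley-swap f₁ g r adm (isMax-false⇒≢ ig)
  ... | _ , excess≡ , _ =
    U ∷ D ∷ Ds g ++ runs' r ,
    (suc f₁ ∷ suc g ∷ r , here refl , cong (λ z → Us (suc z) ++ Ds (suc f₁) ++ U ∷ D ∷ Ds g ++ runs' r) excess≡) ,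
    raise-valley b vk
  upperMove-first-valley (suc f₀) g r adm b vk nd | true with isMax⇒≡ g ig
  ... | refl with skip-max-run r b vk nd
  ...   | resumable Q1 Q' eq b' vk' resume with r | adm
  ...     | [] | _ = ⊥-elim (¬raise-final-valley b' vk')
  ...     | g₂ ∷ r₂ | _ ∷ adm' with upperMove-in-runs' p g₂ r₂ adm' atLeast2-p b' vk' (NoDp-suffix Q1 eq nd)
  ...       | S' , (s' , m' , es') , b'' with upperMoves'-swap p (g₂ ∷ r₂) adm' m'
  ...         | _ , excess≡ , _ , (x , y , refl) =
    D ∷ U ∷ Ds p-1 ++ S' ,
    (suc f₀ ∷ s' , MP.∈-map⁺ (suc f₀ ∷_) m' ,
      trans (cong (λ z → Us (suc (f₀ + z)) ++ Ds (suc f₀) ++ U ∷ runs s') excess≡)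
        (cong (λ z → Us (suc (excess (suc f₀ ∷ p ∷ g₂ ∷ r₂))) ++ z)
          (trans (cong (λ z → D ∷ Ds f₀ ++ U ∷ z) es') (sym (Ds-snoc f₀ (U ∷ Ds p-1 ++ S')))))) ,
    resume b''

  UpperMoveBelow : Bool → ℕ → List ℕ → ℕ → List Step → Set
  UpperMoveBelow true f r t S = Σ (List ℕ) λ s → s ∈ upperMoves (f ∷ r) × path s ≡ Us (suc (excess (f ∷ r))) ++ Ds t ++ S
  UpperMoveBelow false f r t S = Σ (List ℕ) λ s → s ∈ upperMoves' f r × runs s ≡ Ds t ++ S

  UpperMoveBelow-D : ∀ b f r t S → UpperMoveBelow b f r (suc t) S → UpperMoveBelow b f r t (D ∷ S)
  UpperMoveBelow-D true f r t S (s , m , e) = s , m , trans e (cong (Us (suc (excess (f ∷ r))) ++_) (sym (Ds-snoc t S)))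
  UpperMoveBelow-D false f r t S (s , m , e) = s , m , trans e (sym (Ds-snoc t S))

  UpperMoveBelow-∷ : ∀ b f g r' S' → Admissible (f ∷ g ∷ r') → UpperMoveBelow false g r' 0 S' → UpperMoveBelow b f (g ∷ r') f
      (U ∷ S')
  UpperMoveBelow-∷ b f g r' S' (_ ∷ adm') (s' , m' , e') with upperMoves'-swap g r' adm' m'
  UpperMoveBelow-∷ true f g r' S' (_ ∷ adm') (s' , m' , e') | _ , excess≡ , _ , (x , y , refl) =
    f ∷ s' , MP.∈-++⁺ʳ (optional (not (isMax g)) _) (MP.∈-map⁺ (f ∷_) m') ,
    trans (cong (λ z → Us (suc ((f ∸ 1) + z)) ++ Ds f ++ U ∷ runs s') excess≡)
        (cong (λ z → Us (suc (excess (f ∷ g ∷ r'))) ++ Ds f ++ U ∷ z) e')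
  UpperMoveBelow-∷ false f g r' S' (_ ∷ adm') (s' , m' , e') | _ , excess≡ , _ , (x , y , refl) =
    f ∷ s' , MP.∈-++⁺ʳ (optional (atLeast2 f ∧ not (isMax g)) _) (MP.∈-map⁺ (f ∷_) m') , cong (λ z → Ds f ++ U ∷ z) e'

  ¬NoDUU-DU-StartsU : ∀ {Q'} → NoDUU (D ∷ U ∷ Q') → StartsU Q' → ⊥
  ¬NoDUU-DU-StartsU {U ∷ Q''} nd _ = nd (here (refl ∷ (refl ∷ (refl ∷ []))))

  ∸1-+-suc : ∀ {t e f} → t + suc e ≡ f → f ∸ 1 ≡ t + e
  ∸1-+-suc {t} {e} refl = cong (_∸ 1) (+-suc t e)

  upperMove-in-runs : ∀ b f r t e {h Q} → Admissible (f ∷ r) → t + e ≡ f → Below h 0 (Ds e ++ runs' r) Q → NoDUU Q →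
      (1 ≤ t → NoDUU (D ∷ Q)) → NoDp Q →
       (StartsU Q → 1 ≤ e → atLeast2 f ≡ true ⊎ b ≡ true) → Ds e ++ runs' r ≢ Q → Σ (List Step) λ S → UpperMoveBelow b f r t S ×
           Below h 0 S Q
  upperMove-in-runs b f r t (suc e) {Q = D ∷ Q'} adm te (bDD bb) noDUU ctx nd lok ne
    with upperMove-in-runs b f r (suc t) e adm (trans (sym (+-suc t e)) te) bb (NoDUU-tail noDUU) (λ _ → noDUU)
        (λ o → nd (there o)) lok' (λ x → ne (cong (D ∷_) x))
    where
    lok' : StartsU Q' → 1 ≤ e → atLeast2 f ≡ true ⊎ b ≡ true
    lok' _ (s≤s z≤n) = inj₁ (atLeast2-≥ f (subst (λ z → 2 ≤ z) te (NP.≤-trans (s≤s (s≤s z≤n)) (NP.m≤n+m (suc (suc _)) t))))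
  ... | S , res , b' = D ∷ S , UpperMoveBelow-D b f r t S res , bDD b'
  upperMove-in-runs b f r t (suc e) {Q = U ∷ Q'} adm te (bDU bb) noDUU ctx nd lok ne with descend-run e r (bDU bb) (inj₂ tt)
  ... | resumable Q1 Q'' eq b' vk' resume with r | adm
  ...   | [] | _ = ⊥-elim (¬raise-final-valley b' vk')
  ...   | g ∷ r'' | adm₂ with b | lok tt (s≤s z≤n)
  ...     | false | inj₂ ()
  ...     | false | inj₁ bf with upperMove-in-runs' f g r'' adm₂ bf b' vk' (NoDp-suffix Q1 eq nd)
  ...       | S₁ , (s , m , es) , b₁ = Ds e ++ S₁ , (s , m , trans es
      (trans (cong (λ z → Ds z ++ S₁) (∸1-+-suc te)) (sym (Ds-++ t e S₁)))) , resume b₁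
  upperMove-in-runs b f r t (suc e) {Q = U ∷ Q'} adm te (bDU bb) noDUU ctx nd lok ne | resumable Q1 Q'' eq b' vk' resume | g ∷ r'' |
      adm₂ | true | _
    with upperMove-first-valley f g r'' adm₂ b' vk' (NoDp-suffix Q1 eq nd)
  ... | S₁ , (s , m , es) , b₁ = Ds e ++ S₁ , (s , m , trans es
      (cong (Us (suc (excess (f ∷ g ∷ r''))) ++_) (trans (cong (λ z → Ds z ++ S₁) (∸1-+-suc te)) (sym (Ds-++ t e S₁))))) , resume b₁
  upperMove-in-runs b f [] t zero adm te bnil noDUU ctx nd lok ne = ⊥-elim (ne refl)
  upperMove-in-runs b f (g ∷ r'') t zero {Q = U ∷ Q'} adm@(_ ∷ adm') te (bUU bb) noDUU ctx nd lok ne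
    with upperMove-in-runs false g r'' 0 g adm' refl bb (NoDUU-tail noDUU) (λ ()) (λ o → nd (there o)) lok''
        (λ x → ne (cong (U ∷_) x))
    where
    tf : t ≡ f
    tf = trans (sym (NP.+-identityʳ t)) te
    t1 : 1 ≤ t
    t1 = subst (1 ≤_) (sym tf) (proj₁ (All.head adm))
    lok'' : StartsU Q' → 1 ≤ g → atLeast2 g ≡ true ⊎ false ≡ true
    lok'' hu _ = ⊥-elim (¬NoDUU-DU-StartsU (ctx t1) hu)
  ... | S' , res , b' = U ∷ S' , subst (λ z → UpperMoveBelow b f (g ∷ r'') z (U ∷ S')) (sym (trans (sym (NP.+-identityʳ t)) te))
      (UpperMoveBelow-∷ b f g r'' S' adm res) , bUU b'

  upperMove-in-path : ∀ f r i j {h Q} → Admissible (f ∷ r) → i + j ≡ suc (excess (f ∷ r)) → Below h 0 (Us j ++ runs (f ∷ r)) Q →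
      NoDUU Q → NoDp Q → Us j ++ runs (f ∷ r) ≢ Q →
       Σ (List Step) λ S → (Σ (List ℕ) λ v → v ∈ upperMoves (f ∷ r) × Us i ++ S ≡ path v) × Below h 0 S Q
  upperMove-in-path f r i (suc j) {Q = U ∷ Q'} adm e (bUU b) noDUU nd ne
    with upperMove-in-path f r (suc i) j adm (trans (sym (+-suc i j)) e) b (NoDUU-tail noDUU) (λ o → nd (there o))
        (λ x → ne (cong (U ∷_) x))
  ... | S , (v , m , e') , b' = U ∷ S , (v , m , trans (Us-snoc i S) e') , bUU b'
  upperMove-in-path f r i zero adm e b noDUU nd ne with upperMove-in-runs true f r 0 f adm refl b noDUU (λ ()) nd
      (λ _ _ → inj₂ refl) ne
  ... | S , (s , m , es) , b' = S , (s , m , sym (trans es (cong (λ z → Us z ++ S) (sym (trans (sym (NP.+-identityʳ i)) e))))) ,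
      b'

  -- Symmetrically, the next raisable valley of path w after Q first goes above it stays below Q.
  below-upperMove : ∀ w {Q} → Admissible w → Below 0 0 (path w) Q → NoDUU Q → NoDp Q → path w ≢ Q →
         Σ (List ℕ) λ v → v ∈ upperMoves w × Below 0 0 (path v) Q
  below-upperMove [] adm bnil noDUU nd ne = ⊥-elim (ne refl)
  below-upperMove (f ∷ r) adm b noDUU nd ne with upperMove-in-path f r 0 (suc (excess (f ∷ r))) adm refl b noDUU nd ne
  ... | S , (v , m , e) , b' = v , m , subst (λ z → Below 0 0 z _) e b'

  lowerMoves-Admissible : ∀ w → Admissible w → All Admissible (lowerMoves w)
  lowerMoves-Admissible w adm = All.tabulate (λ m → proj₂ (lowerMoves-swap w adm m))

  upperMoves-Admissible : ∀ w → Admissible w → All Admissible (upperMoves w)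
  upperMoves-Admissible w adm = All.tabulate (λ m → proj₂ (upperMoves-swap w adm m))

  #lowerCovers≡lowerCount : ∀ {n} w → Admissible w → sum w ≡ n → #lowerCovers n p (path w) ≡ lowerCount w
  #lowerCovers≡lowerCount {n} w adm refl = begin
    #lowerCovers n p (path w)         ≡⟨ length-filter-unique (λ Q → lowerCover? n p Q (path w)) (𝓕-unique {n}) moves-unique
        move⇒cover cover⇒move ⟩
    length (map path (lowerMoves w))  ≡⟨ LP.length-map path (lowerMoves w) ⟩
    length (lowerMoves w)             ≡⟨ length-lowerMoves w ⟩
    lowerCount w                      ∎
    where
    open ≡-Reasoning
    moves-unique : Unique (map path (lowerMoves w))
    moves-unique = Unique-map Admissible path (lowerMoves-Admissible w adm) path-injective (lowerMoves-unique w)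
    move⇒cover : ∀ {Q} → Q ∈ map path (lowerMoves w) → Q ∈ 𝓕 n p × IsLowerCoverOf n p Q (path w)
    move⇒cover Q∈ with MP.∈-map⁻ path Q∈
    ... | v , v∈ , refl = lowerMove-isLowerCover n w adm refl v∈
    cover⇒move : ∀ {Q} → Q ∈ 𝓕 n p → IsLowerCoverOf n p Q (path w) → Q ∈ map path (lowerMoves w)
    cover⇒move {Q} Q∈ ((Q≼ , Q≢) , nothingBetween)
      with _ , noDUU , noDp ← ∈𝓕⇒InF {n} Q∈
      with v , v∈ , Q≤v ← below-lowerMove w adm (≼⇒Below {n} Q∈ (InF⇒∈𝓕 {n} (path-InF n w adm refl)) Q≼) noDUU noDp Q≢
      with LP.≡-dec _≟S_ Q (path v)
    ... | yes refl = MP.∈-map⁺ path v∈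
    ... | no Q≢v   = ⊥-elim (nothingBetween (lose v∈𝓕 ((Below⇒≤heights Q≤v , Q≢v) , v≺w)))
      where
      v∈𝓕 : path v ∈ 𝓕 n p
      v∈𝓕 = proj₁ (lowerMove-isLowerCover n w adm refl v∈)
      v≺w : path v ≺ path w
      v≺w = proj₁ (proj₂ (lowerMove-isLowerCover n w adm refl v∈))

  #upperCovers≡upperCount : ∀ {n} w → Admissible w → sum w ≡ n → #upperCovers n p (path w) ≡ upperCount w
  #upperCovers≡upperCount {n} w adm refl = begin
    #upperCovers n p (path w)         ≡⟨ length-filter-unique (λ Q → upperCover? n p Q (path w)) (𝓕-unique {n}) moves-unique
        move⇒cover cover⇒move ⟩
    length (map path (upperMoves w))  ≡⟨ LP.length-map path (upperMoves w) ⟩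
    length (upperMoves w)             ≡⟨ length-upperMoves w ⟩
    upperCount w                      ∎
    where
    open ≡-Reasoning
    moves-unique : Unique (map path (upperMoves w))
    moves-unique = Unique-map Admissible path (upperMoves-Admissible w adm) path-injective (upperMoves-unique w adm)
    move⇒cover : ∀ {Q} → Q ∈ map path (upperMoves w) → Q ∈ 𝓕 n p × IsUpperCoverOf n p Q (path w)
    move⇒cover Q∈ with MP.∈-map⁻ path Q∈
    ... | v , v∈ , refl = upperMove-isUpperCover n w adm refl v∈
    cover⇒move : ∀ {Q} → Q ∈ 𝓕 n p → IsUpperCoverOf n p Q (path w) → Q ∈ map path (upperMoves w)
    cover⇒move {Q} Q∈ ((≼Q , ≢Q) , nothingBetween)
      with _ , noDUU , noDp ← ∈𝓕⇒InF {n} Q∈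
      with v , v∈ , v≤Q ← below-upperMove w adm (≼⇒Below {n} (InF⇒∈𝓕 {n} (path-InF n w adm refl)) Q∈ ≼Q) noDUU noDp ≢Q
      with LP.≡-dec _≟S_ (path v) Q
    ... | yes refl = MP.∈-map⁺ path v∈
    ... | no v≢Q   = ⊥-elim (nothingBetween (lose v∈𝓕 (w≺v , (Below⇒≤heights v≤Q , v≢Q))))
      where
      v∈𝓕 : path v ∈ 𝓕 n p
      v∈𝓕 = proj₁ (upperMove-isUpperCover n w adm refl v∈)
      w≺v : path w ≺ path v
      w≺v = proj₁ (proj₂ (upperMove-isUpperCover n w adm refl v∈))

  count-𝓕 : ∀ n k (s : List Step → ℕ) → count s k (𝓕 n p) ≡ count (s ∘ path) k (comps n)
  count-𝓕 n k s = trans (PP.↭-length (PP.filter-↭ (λ P → s P ℕ.≟ k) (𝓕↭paths n)))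
                        (length-filter-map path (λ P → s P ℕ.≟ k) (comps n))

  count-cong-comps : ∀ n k {s t : List ℕ → ℕ} → (∀ w → Admissible w → sum w ≡ n → s w ≡ t w) →
                     count s k (comps n) ≡ count t k (comps n)
  count-cong-comps n k s≡t =
    count-cong k (comps n) (λ {w} w∈ → let adm , sum≡ = ∈-comps⁻ n w∈ in s≡t w adm sum≡)

  #withLower≡count : ∀ n k → #withLower p n k ≡ count lowerCount k (comps n)
  #withLower≡count n k = trans (count-𝓕 n k (#lowerCovers n p)) (count-cong-comps n k #lowerCovers≡lowerCount)

  #withUpper≡count : ∀ n k → #withUpper p n k ≡ count upperCount k (comps n)
  #withUpper≡count n k = trans (count-𝓕 n k (#upperCovers n p)) (count-cong-comps n k #upperCovers≡upperCount)

-- Generating functions of the cover statistics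

module GeneratingFunctions (p : ℕ) (2≤p : 2 ≤ p) where

  open Encoding p
  open Covers p 2≤p

  -- countSeries s is the generating function Σ_w x^(sum w) y^(s w) over admissible compositions w
  countSeries : (List ℕ → ℕ) → Series
  countSeries s n k = + count s k (comps n)

  sumOver : List ℕ → (ℕ → ℤ) → ℤ
  sumOver []       F = + 0
  sumOver (f ∷ fs) F = F f ℤ.+ sumOver fs F

  sumOver-++ : ∀ xs ys F → sumOver (xs ++ ys) F ≡ sumOver xs F ℤ.+ sumOver ys F
  sumOver-++ []       ys F = sym (ZP.+-identityˡ _)
  sumOver-++ (x ∷ xs) ys F = trans (cong (ℤ._+_ (F x)) (sumOver-++ xs ys F)) (sym (ZP.+-assoc (F x) _ _))

  sumOver-cong : ∀ {P : ℕ → Set} xs {F F' : ℕ → ℤ} → All P xs → (∀ f → P f → F f ≡ F' f) → sumOver xs F ≡ sumOver xs F'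
  sumOver-cong []       []         _    = refl
  sumOver-cong (x ∷ xs) (px ∷ pxs) F≡F' = cong₂ ℤ._+_ (F≡F' x px) (sumOver-cong xs pxs F≡F')

  module _ (s : List ℕ → ℕ) (c : ℕ → ℕ) (s' : ℕ → List ℕ → ℕ) (s-∷ : ∀ f r → s (f ∷ r) ≡ c f + s' f r) where

    countSeries-first : ∀ n k f → 1 ≤ f →
                        + count s k (compsWithFirst (suc n) (suc n) f) ≡ shift f (c f) (countSeries (s' f)) (suc n) k
    countSeries-first n k f 1≤f with f ℕ.≤? suc n | c f ℕ.≤? k
    ... | yes _ | yes c≤k = cong +_ (begin
      count s k (map (f ∷_) rest)             ≡⟨ length-filter-map (f ∷_) (λ w → s w ℕ.≟ k) rest ⟩
      count (s ∘ (f ∷_)) k rest               ≡⟨ count-cong k rest (λ {r} _ → s-∷ f r) ⟩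
      count (λ r → c f + s' f r) k rest       ≡⟨ count-+-≤ (s' f) (c f) k rest c≤k ⟩
      count (s' f) (k ∸ c f) rest             ≡⟨ cong (count (s' f) (k ∸ c f))
          (compsFuel≡comps (suc n) (suc n ∸ f) (s≤s (NP.∸-monoʳ-≤ (suc n) 1≤f))) ⟩
      count (s' f) (k ∸ c f) (comps (suc n ∸ f)) ∎)
      where
      open ≡-Reasoning
      rest : List (List ℕ)
      rest = compsFuel (suc n) (suc n ∸ f)
    ... | yes _ | no c≰k = cong +_ (trans (length-filter-map (f ∷_) (λ w → s w ℕ.≟ k) rest)
                                   (trans (count-cong k rest (λ {r} _ → s-∷ f r)) (count-+-≰ (s' f) (c f) k rest c≰k)))
      where
      rest : List (List ℕ)
      rest = compsFuel (suc n) (suc n ∸ f)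
    ... | no _  | _      = refl

    countSeries-firstIn : ∀ n k fs → All (1 ≤_) fs →
                          + count s k (compsWithFirstIn (suc n) (suc n) fs) ≡ sumOver fs
                              (λ f → shift f (c f) (countSeries (s' f)) (suc n) k)
    countSeries-firstIn n k []       _            = refl
    countSeries-firstIn n k (f ∷ fs) (1≤f ∷ 1≤fs) =
      trans (cong +_ (count-++ s k (compsWithFirst (suc n) (suc n) f) (compsWithFirstIn (suc n) (suc n) fs)))
            (cong₂ ℤ._+_ (countSeries-first n k f 1≤f) (countSeries-firstIn n k fs 1≤fs))

    countSeries-suc : ∀ n k → countSeries s (suc n) k ≡ sumOver (partsUpTo p) (λ f → shift f (c f) (countSeries (s' f)) (suc n) k)
    countSeries-suc n k = countSeries-firstIn n k (partsUpTo p) (partsUpTo-positive p)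

  countSeries-zero : ∀ s k → s [] ≡ 0 → countSeries s 0 k ≡ 𝟙 0 k
  countSeries-zero s zero    s[]≡0 rewrite s[]≡0 = refl
  countSeries-zero s (suc k) s[]≡0 rewrite s[]≡0 = refl

  partsDownTo2 : ℕ → List ℕ
  partsDownTo2 zero    = []
  partsDownTo2 (suc m) = suc (suc m) ∷ partsDownTo2 m

  partsUpTo-suc : ∀ m → partsUpTo (suc m) ≡ partsDownTo2 m ++ 1 ∷ []
  partsUpTo-suc zero    = refl
  partsUpTo-suc (suc m) = cong (suc (suc m) ∷_) (partsUpTo-suc m)

  partsDownTo2-range : ∀ m → All (λ f → 2 ≤ f × f ≤ suc m) (partsDownTo2 m)
  partsDownTo2-range zero    = []
  partsDownTo2-range (suc m) = (s≤s (s≤s z≤n) , NP.≤-refl) ∷ All.map (Data.Product.map₂ NP.m≤n⇒m≤1+n) (partsDownTo2-range m)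

  p≡2+[p∸2] : p ≡ 2 + (p ∸ 2)
  p≡2+[p∸2] = sym (NP.m+[n∸m]≡n 2≤p)

  -- the part sizes f with 1 < f < p
  middleParts : List ℕ
  middleParts = partsDownTo2 (p ∸ 2)

  partsUpTo-p : partsUpTo p ≡ p ∷ middleParts ++ 1 ∷ []
  partsUpTo-p = subst (λ m → partsUpTo m ≡ m ∷ partsDownTo2 (m ∸ 2) ++ 1 ∷ []) (sym p≡2+[p∸2])
                      (cong (2 + (p ∸ 2) ∷_) (partsUpTo-suc (p ∸ 2)))

  middleParts-range : All (λ f → 2 ≤ f × f < p) middleParts
  middleParts-range = All.map (Data.Product.map₂ (λ f≤ → subst (_ <_) (sym p≡2+[p∸2]) (s≤s f≤))) (partsDownTo2-range (p ∸ 2))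

  middlePoly : ℕ → Poly
  middlePoly c = map (λ f → (+ 1 , f , c)) middleParts

  coeffMul-middlePoly : ∀ c A n k → coeffMul (middlePoly c) A n k ≡ sumOver middleParts (λ f → shift f c A n k)
  coeffMul-middlePoly c A n k = go middleParts
    where
    go : ∀ fs → coeffMul (map (λ f → (+ 1 , f , c)) fs) A n k ≡ sumOver fs (λ f → shift f c A n k)
    go []       = refl
    go (f ∷ fs) = trans (coeffMul-∷ (+ 1) f c _ A n k) (cong₂ ℤ._+_ (ZP.*-identityˡ (shift f c A n k)) (go fs))

  coeffMul-middlePoly-vanishes : ∀ c A k → coeffMul (middlePoly c) A 0 k ≡ + 0
  coeffMul-middlePoly-vanishes c A k =
    trans (coeffMul-middlePoly c A 0 k)
    (trans (sumOver-cong middleParts middleParts-range (λ f (2≤f , _) → shift-vanishes f c A k (NP.≤-trans (s≤s z≤n) 2≤f)))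
           (sumOver-0 middleParts))
    where
    sumOver-0 : ∀ fs → sumOver fs (λ _ → + 0) ≡ + 0
    sumOver-0 []       = refl
    sumOver-0 (_ ∷ fs) = trans (ZP.+-identityˡ _) (sumOver-0 fs)

  threeTerm : ℕ → ℕ → ℕ → Series → Series → Series → Series
  threeTerm a b c A B C n k = 𝟙 n k ℤ.+ (shift p a A n k ℤ.+ (coeffMul (middlePoly b) B n k ℤ.+ shift 1 c C n k))

  countSeries-rec : ∀ (s : List ℕ → ℕ) (c : ℕ → ℕ) (s' : ℕ → List ℕ → ℕ) →
                    (∀ f r → s (f ∷ r) ≡ c f + s' f r) → s [] ≡ 0 →
                    ∀ {a b c₁ : ℕ} {sA sB sC : List ℕ → ℕ} →
                    c p ≡ a → s' p ≡ sA → (∀ f → 2 ≤ f × f < p → c f ≡ b × s' f ≡ sB) → c 1 ≡ c₁ → s' 1 ≡ sC →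
                    countSeries s ≈ threeTerm a b c₁ (countSeries sA) (countSeries sB) (countSeries sC)
  countSeries-rec s c s' s-∷ s[]≡0 {a} {b} {c₁} {sA} {sB} {sC} refl refl middle refl refl zero k =
    trans (countSeries-zero s k s[]≡0)
          (sym (trans (cong (ℤ._+_ (𝟙 0 k)) vanish) (ZP.+-identityʳ _)))
    where
    vanish : shift p a (countSeries sA) 0 k ℤ.+ (coeffMul (middlePoly b) (countSeries sB) 0 k ℤ.+ shift 1 c₁ (countSeries sC) 0 k)
        ≡ + 0
    vanish = cong₂ ℤ._+_ (shift-vanishes p a _ k (NP.≤-trans (s≤s z≤n) 2≤p))
                         (trans (ZP.+-identityʳ _) (coeffMul-middlePoly-vanishes b _ k))
  countSeries-rec s c s' s-∷ s[]≡0 {a} {b} {c₁} {sA} {sB} {sC} refl refl middle refl refl (suc n) k = begin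
    countSeries s (suc n) k                         ≡⟨ countSeries-suc s c s' s-∷ n k ⟩
    sumOver (partsUpTo p) F                         ≡⟨ cong (λ fs → sumOver fs F) partsUpTo-p ⟩
    F p ℤ.+ sumOver (middleParts ++ 1 ∷ []) F       ≡⟨ cong (ℤ._+_ (F p)) (sumOver-++ middleParts (1 ∷ []) F) ⟩
    F p ℤ.+ (sumOver middleParts F ℤ.+ (F 1 ℤ.+ + 0))
      ≡⟨ cong (λ z → F p ℤ.+ (z ℤ.+ (F 1 ℤ.+ + 0))) (trans (sumOver-cong middleParts middleParts-range F-middle)
                                                        (sym (coeffMul-middlePoly b (countSeries sB) (suc n) k))) ⟩
    F p ℤ.+ (coeffMul (middlePoly b) (countSeries sB) (suc n) k ℤ.+ (F 1 ℤ.+ + 0))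
      ≡⟨ cong (λ z → F p ℤ.+ (coeffMul (middlePoly b) (countSeries sB) (suc n) k ℤ.+ z)) (ZP.+-identityʳ (F 1)) ⟩
    F p ℤ.+ (coeffMul (middlePoly b) (countSeries sB) (suc n) k ℤ.+ F 1)  ≡⟨ ZP.+-identityˡ _ ⟨
    threeTerm a b c₁ (countSeries sA) (countSeries sB) (countSeries sC) (suc n) k ∎
    where
    open ≡-Reasoning
    F : ℕ → ℤ
    F f = shift f (c f) (countSeries (s' f)) (suc n) k
    F-middle : ∀ f → 2 ≤ f × f < p → F f ≡ shift f b (countSeries sB) (suc n) k
    F-middle f range with c f | s' f | middle f range
    ... | _ | _ | refl , refl = refl

  lowerSeries upperSeries' : Bool → Series
  lowerSeries b  = countSeries (lowerCount' b)
  upperSeries' b = countSeries (upperCount' b)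

  upperSeries : Series
  upperSeries = countSeries upperCount

  lowerSeries-rec : ∀ b → lowerSeries b ≈ threeTerm (bit (not b)) (bit (not b)) 0 (lowerSeries true) (lowerSeries false)
      (lowerSeries false)
  lowerSeries-rec b =
    countSeries-rec (lowerCount' b) (λ f → bit (not b ∧ atLeast2 f)) (λ f → lowerCount' (isMax f)) (λ _ _ → refl) refl
      (long p 2≤p) (cong lowerCount' isMax-p)
      (λ f (2≤f , f<p) → long f 2≤f , cong lowerCount' (isMax-< f f<p))
      (cong bit (BP.∧-zeroʳ (not b))) (cong lowerCount' (isMax-< 1 2≤p))
    where
    long : ∀ f → 2 ≤ f → bit (not b ∧ atLeast2 f) ≡ bit (not b)
    long f 2≤f = cong bit (trans (cong (not b ∧_) (atLeast2-≥ f 2≤f)) (BP.∧-identityʳ (not b)))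

  upperSeries'-rec : ∀ b → upperSeries' b ≈ threeTerm 0 (bit b) (bit b) (upperSeries' true) (upperSeries' true)
      (upperSeries' false)
  upperSeries'-rec b =
    countSeries-rec (upperCount' b) (λ f → bit (b ∧ not (isMax f))) (λ f → upperCount' (atLeast2 f)) (λ _ _ → refl) refl
      (trans (cong (λ z → bit (b ∧ not z)) isMax-p) (cong bit (BP.∧-zeroʳ b))) (cong upperCount' (atLeast2-≥ p 2≤p))
      (λ f (2≤f , f<p) → notMax f f<p , cong upperCount' (atLeast2-≥ f 2≤f))
      (notMax 1 2≤p) refl
    where
    notMax : ∀ f → f < p → bit (b ∧ not (isMax f)) ≡ bit b
    notMax f f<p = cong bit (trans (cong (λ z → b ∧ not z) (isMax-< f f<p)) (BP.∧-identityʳ b))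

  upperSeries-rec : upperSeries ≈ threeTerm 0 0 0 (upperSeries' true) (upperSeries' true) (upperSeries' true)
  upperSeries-rec = countSeries-rec upperCount (λ _ → 0) (λ _ → upperCount' true) (λ _ _ → refl) refl
                      refl refl (λ _ _ → refl , refl) refl refl
  -- Δ = reducedDenom is the denominator of the theorem divided by 1 − x
  reducedDenom₊ reducedDenom reducedNumer upperNumer firstPartPoly : Poly
  reducedDenom₊ = (ℤ.-1ℤ , 1 , 0) ∷ (ℤ.-1ℤ , p , 0) ∷ (ℤ.-1ℤ , p + 1 , 1) ∷ (+ 1 , p + 1 , 0) ∷ ⊖ (middlePoly 1)
  reducedDenom  = (+ 1 , 0 , 0) ∷ reducedDenom₊
  reducedNumer = (+ 1 , 0 , 0) ∷ (+ 1 , p , 1) ∷ (ℤ.-1ℤ , p , 0) ∷ []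
  upperNumer = (+ 1 , 0 , 0) ∷ (ℤ.-1ℤ , 1 , 0) ∷ (+ 1 , 1 , 1) ∷ []
  firstPartPoly = (+ 1 , p , 0) ∷ (+ 1 , 1 , 0) ∷ middlePoly 0

  coeffMul-reducedDenom : ∀ A n k → coeffMul reducedDenom A n k ≡ A n k ℤ.- shift 1 0 A n k ℤ.- shift p 0 A n k ℤ.- shift (p + 1)
      1 A n k ℤ.+ shift (p + 1) 0 A n k ℤ.- coeffMul (middlePoly 1) A n k
  coeffMul-reducedDenom A n k = trans (coeffMul≡expand reducedDenom A n k)
      (trans (cong (λ z → + 1 ℤ.* A n k ℤ.+ (ℤ.-1ℤ ℤ.* shift 1 0 A n k ℤ.+
      (ℤ.-1ℤ ℤ.* shift p 0 A n k ℤ.+ (ℤ.-1ℤ ℤ.* shift (p + 1) 1 A n k ℤ.+ (+ 1 ℤ.* shift (p + 1) 0 A n k ℤ.+ z)))))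
      (expand-⊖ (middlePoly 1) A n k))
    (rearrange (A n k) (shift 1 0 A n k) (shift p 0 A n k) (shift (p + 1) 1 A n k) (shift (p + 1) 0 A n k)
        (coeffMul (middlePoly 1) A n k)))
    where
    rearrange : ∀ (a b c d e m : ℤ) →
                + 1 ℤ.* a ℤ.+ (ℤ.-1ℤ ℤ.* b ℤ.+ (ℤ.-1ℤ ℤ.* c ℤ.+ (ℤ.-1ℤ ℤ.* d ℤ.+ (+ 1 ℤ.* e ℤ.+ ℤ.- m))))
                ≡ a ℤ.- b ℤ.- c ℤ.- d ℤ.+ e ℤ.- m
    rearrange = solve-∀

  coeffMul-reducedNumer : ∀ A n k → coeffMul reducedNumer A n k ≡ A n k ℤ.+ shift p 1 A n k ℤ.- shift p 0 A n k
  coeffMul-reducedNumer A n k = trans (coeffMul≡expand reducedNumer A n k) (rearrange (A n k) (shift p 1 A n k) (shift p 0 A n k))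
    where
    rearrange : ∀ (a b c : ℤ) → + 1 ℤ.* a ℤ.+ (+ 1 ℤ.* b ℤ.+ (ℤ.-1ℤ ℤ.* c ℤ.+ + 0)) ≡ a ℤ.+ b ℤ.- c
    rearrange = solve-∀

  coeffMul-upperNumer : ∀ A n k → coeffMul upperNumer A n k ≡ A n k ℤ.- shift 1 0 A n k ℤ.+ shift 1 1 A n k
  coeffMul-upperNumer A n k = trans (coeffMul≡expand upperNumer A n k) (rearrange (A n k) (shift 1 0 A n k) (shift 1 1 A n k))
    where
    rearrange : ∀ (a b c : ℤ) → + 1 ℤ.* a ℤ.+ (ℤ.-1ℤ ℤ.* b ℤ.+ (+ 1 ℤ.* c ℤ.+ + 0)) ≡ a ℤ.- b ℤ.+ c
    rearrange = solve-∀

  coeffMul-firstPartPoly : ∀ A n k → coeffMul firstPartPoly A n k ≡ shift p 0 A n k ℤ.+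
      (shift 1 0 A n k ℤ.+ coeffMul (middlePoly 0) A n k)
  coeffMul-firstPartPoly A n k = trans (coeffMul≡expand firstPartPoly A n k)
      (trans (cong (λ z → + 1 ℤ.* shift p 0 A n k ℤ.+ (+ 1 ℤ.* shift 1 0 A n k ℤ.+ z))
      (sym (coeffMul≡expand (middlePoly 0) A n k))) (rearrange (shift p 0 A n k) (shift 1 0 A n k) (coeffMul (middlePoly 0) A n k)))
    where
    rearrange : ∀ (a b c : ℤ) → + 1 ℤ.* a ℤ.+ (+ 1 ℤ.* b ℤ.+ c) ≡ a ℤ.+ (b ℤ.+ c)
    rearrange = solve-∀

  shift-middlePoly : ∀ c i j A n k → shift i j (coeffMul (middlePoly c) A) n k ≡ sumOver middleParts
      (λ f → shift (f + i) (c + j) A n k)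
  shift-middlePoly c i j A n k = trans (shift-coeffMul (middlePoly c) i j A n k)
      (trans (coeffMul-middlePoly c (shift i j A) n k) (sumOver-cong middleParts middleParts-range
      (λ f _ → shift-shift f c i j A n k)))

  telescope : ∀ m (F : ℕ → ℤ) → sumOver (partsDownTo2 m) (λ f → F (f + 1)) ≡ sumOver (partsDownTo2 m) F ℤ.+ F (suc (suc m)) ℤ.- F
      2
  telescope zero F = sym (trans (cong (ℤ._- F 2) (ZP.+-identityˡ (F 2))) (ZP.+-inverseʳ (F 2)))
  telescope (suc m) F = trans (cong₂ ℤ._+_ (cong F (NP.+-comm (suc (suc m)) 1)) (telescope m F))
      (rearrange (F (suc (suc (suc m)))) (sumOver (partsDownTo2 m) F) (F (suc (suc m))) (F 2))
    where
    rearrange : ∀ (a b c d : ℤ) → a ℤ.+ (b ℤ.+ c ℤ.- d) ≡ c ℤ.+ b ℤ.+ a ℤ.- d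
    rearrange = solve-∀

  telescope-middle : ∀ c A n k → sumOver middleParts (λ f → shift (f + 1) c A n k) ≡ coeffMul (middlePoly c) A n k ℤ.+ shift p c A
      n k ℤ.- shift 2 c A n k
  telescope-middle c A n k = trans (telescope (p ∸ 2) (λ f → shift f c A n k))
      (cong₂ (λ x y → x ℤ.+ y ℤ.- shift 2 c A n k) (sym (coeffMul-middlePoly c A n k)) (shift-≡ A n k (sym p≡2+[p∸2]) refl))

  lower-identity : ∀ (a b c d e m Dx E F H Z X : ℤ) →
                   a ≡ Dx ℤ.+ (H ℤ.+ (m ℤ.+ b)) → H ≡ E ℤ.+ (Z ℤ.+ (X ℤ.+ d)) → c ≡ F ℤ.+ (Z ℤ.+ (X ℤ.+ e)) →
                   a ℤ.- b ℤ.- c ℤ.- d ℤ.+ e ℤ.- m ≡ Dx ℤ.+ E ℤ.- F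
  lower-identity a b c d e m Dx E F H Z X e1 e2 e3 rewrite e1 | e2 | e3 = rearrange Dx E F Z X b d e m
    where
    rearrange : ∀ (Dx E F Z X b d e m : ℤ) →
                Dx ℤ.+ (E ℤ.+ (Z ℤ.+ (X ℤ.+ d)) ℤ.+ (m ℤ.+ b)) ℤ.- b ℤ.- (F ℤ.+ (Z ℤ.+ (X ℤ.+ e))) ℤ.- d ℤ.+ e ℤ.- m
                ≡ Dx ℤ.+ E ℤ.- F
    rearrange = solve-∀

  -- With M = Σ_{1<f<p} xᶠ and G_b = lowerSeries b,
  -- Δ G₀ = (G₀ − x G₀ − y M G₀) − xᵖ G₀ − xᵖ⁺¹ y G₀ + xᵖ⁺¹ G₀. The recurrence of G₀ turns the bracket
  -- into 1 + xᵖ y G₁, and the recurrences of G₁ times xᵖ y and of G₀ times xᵖ cancel every remaining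
  -- series term.
  reducedDenom·lowerSeries : ∀ n k → coeffMul reducedDenom (lowerSeries false) n k ≡ coeffMul reducedNumer 𝟙 n k
  reducedDenom·lowerSeries n k = trans (coeffMul-reducedDenom G₀ n k)
      (trans (lower-identity (G₀ n k) (shift 1 0 G₀ n k) (shift p 0 G₀ n k) (shift (p + 1) 1 G₀ n k) (shift (p + 1) 0 G₀ n k)
      (coeffMul (middlePoly 1) G₀ n k) (𝟙 n k) (shift p 1 𝟙 n k) (shift p 0 𝟙 n k) (shift p 1 G₁ n k)
      (shift p 0 (shift p 1 G₁) n k) (shift p 0 (coeffMul (middlePoly 1) G₀) n k) (lowerSeries-rec false n k) xᵖy·G₁-rec xᵖ·G₀-rec)
      (sym (coeffMul-reducedNumer 𝟙 n k)))
    where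
    G₀ G₁ : Series
    G₀ = lowerSeries false
    G₁ = lowerSeries true
    xᵖy·G₁-rec : shift p 1 G₁ n k ≡ shift p 1 𝟙 n k ℤ.+ (shift p 0 (shift p 1 G₁) n k ℤ.+
        (shift p 0 (coeffMul (middlePoly 1) G₀) n k ℤ.+ shift (p + 1) 1 G₀ n k))
    xᵖy·G₁-rec = trans (shift-+₄ p 1 𝟙 (shift p 0 G₁) (coeffMul (middlePoly 0) G₀) (shift 1 0 G₀) (lowerSeries-rec true) n k)
          (cong (ℤ._+_ (shift p 1 𝟙 n k)) (cong₂ ℤ._+_ (trans (shift-shift p 1 p 0 G₁ n k) (sym (shift-shift p 0 p 1 G₁ n k)))
             (cong₂ ℤ._+_ (trans (shift-middlePoly 0 p 1 G₀ n k) (sym (shift-middlePoly 1 p 0 G₀ n k)))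
                 (shift-shift p 1 1 0 G₀ n k))))
    xᵖ·G₀-rec : shift p 0 G₀ n k ≡ shift p 0 𝟙 n k ℤ.+ (shift p 0 (shift p 1 G₁) n k ℤ.+
        (shift p 0 (coeffMul (middlePoly 1) G₀) n k ℤ.+ shift (p + 1) 0 G₀ n k))
    xᵖ·G₀-rec = trans (shift-+₄ p 0 𝟙 (shift p 1 G₁) (coeffMul (middlePoly 1) G₀) (shift 1 0 G₀) (lowerSeries-rec false) n k)
          (cong (ℤ._+_ (shift p 0 𝟙 n k)) (cong (ℤ._+_ (shift p 0 (shift p 1 G₁) n k))
              (cong (ℤ._+_ (shift p 0 (coeffMul (middlePoly 1) G₀) n k)) (shift-shift p 0 1 0 G₀ n k))))

  upper'-identity : ∀ (a b c d e m Dx B0 S0 s X Q : ℤ) →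
                    a ≡ Dx ℤ.+ (c ℤ.+ (m ℤ.+ s)) → b ≡ B0 ℤ.+ (e ℤ.+ (X ℤ.+ Q)) → s ≡ S0 ℤ.+ (d ℤ.+ (X ℤ.+ Q)) →
                    a ℤ.- b ℤ.- c ℤ.- d ℤ.+ e ℤ.- m ≡ Dx ℤ.- B0 ℤ.+ S0
  upper'-identity a b c d e m Dx B0 S0 s X Q e1 e2 e3 rewrite e1 | e2 | e3 = rearrange Dx B0 S0 c d e m X Q
    where
    rearrange : ∀ (Dx B0 S0 c d e m X Q : ℤ) →
                Dx ℤ.+ (c ℤ.+ (m ℤ.+ (S0 ℤ.+ (d ℤ.+ (X ℤ.+ Q))))) ℤ.- (B0 ℤ.+ (e ℤ.+ (X ℤ.+ Q))) ℤ.- c ℤ.- d ℤ.+ e ℤ.- m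
                ≡ Dx ℤ.- B0 ℤ.+ S0
    rearrange = solve-∀

  -- Likewise, with V_b = upperSeries' b, Δ V₁ = 1 − x + x y by the recurrence of V₁ and those of V₁
  -- times x and of V₀ times x y.
  reducedDenom·upperSeries' : ∀ n k → coeffMul reducedDenom (upperSeries' true) n k ≡ coeffMul upperNumer 𝟙 n k
  reducedDenom·upperSeries' n k = trans (coeffMul-reducedDenom V₁ n k)
      (trans (upper'-identity (V₁ n k) (shift 1 0 V₁ n k) (shift p 0 V₁ n k) (shift (p + 1) 1 V₁ n k) (shift (p + 1) 0 V₁ n k)
      (coeffMul (middlePoly 1) V₁ n k) (𝟙 n k) (shift 1 0 𝟙 n k) (shift 1 1 𝟙 n k) (shift 1 1 V₀ n k)
      (shift 1 0 (coeffMul (middlePoly 1) V₁) n k) (shift 1 0 (shift 1 1 V₀) n k) (upperSeries'-rec true n k) x·V₁-rec xy·V₀-rec)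
      (sym (coeffMul-upperNumer 𝟙 n k)))
    where
    V₀ V₁ : Series
    V₀ = upperSeries' false
    V₁ = upperSeries' true
    x·V₁-rec : shift 1 0 V₁ n k ≡ shift 1 0 𝟙 n k ℤ.+ (shift (p + 1) 0 V₁ n k ℤ.+
        (shift 1 0 (coeffMul (middlePoly 1) V₁) n k ℤ.+ shift 1 0 (shift 1 1 V₀) n k))
    x·V₁-rec = trans (shift-+₄ 1 0 𝟙 (shift p 0 V₁) (coeffMul (middlePoly 1) V₁) (shift 1 1 V₀) (upperSeries'-rec true) n k)
          (cong (ℤ._+_ (shift 1 0 𝟙 n k)) (cong (λ z → z ℤ.+
              (shift 1 0 (coeffMul (middlePoly 1) V₁) n k ℤ.+ shift 1 0 (shift 1 1 V₀) n k))
            (trans (shift-shift 1 0 p 0 V₁ n k) (shift-≡ V₁ n k (NP.+-comm 1 p) refl))))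
    xy·V₀-rec : shift 1 1 V₀ n k ≡ shift 1 1 𝟙 n k ℤ.+ (shift (p + 1) 1 V₁ n k ℤ.+
        (shift 1 0 (coeffMul (middlePoly 1) V₁) n k ℤ.+ shift 1 0 (shift 1 1 V₀) n k))
    xy·V₀-rec = trans (shift-+₄ 1 1 𝟙 (shift p 0 V₁) (coeffMul (middlePoly 0) V₁) (shift 1 0 V₀) (upperSeries'-rec false) n k)
          (cong (ℤ._+_ (shift 1 1 𝟙 n k)) (cong₂ ℤ._+_ (trans (shift-shift 1 1 p 0 V₁ n k) (shift-≡ V₁ n k (NP.+-comm 1 p) refl))
            (cong₂ ℤ._+_ (trans (shift-middlePoly 0 1 1 V₁ n k) (sym (shift-middlePoly 1 1 0 V₁ n k)))
                (trans (shift-shift 1 1 1 0 V₀ n k) (sym (shift-shift 1 0 1 1 V₀ n k))))))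

  upper-identity : ∀ (Dx B C Dd Ee M1d M0d S20 S21 P1 C' Dd' : ℤ) → C' ≡ Ee → Dd' ≡ Dd →
         (Dx ℤ.- B ℤ.- C ℤ.- Dd ℤ.+ Ee ℤ.- M1d) ℤ.+ ((C ℤ.- C' ℤ.+ Dd') ℤ.+
             ((B ℤ.- S20 ℤ.+ S21) ℤ.+ (M0d ℤ.- (M0d ℤ.+ C ℤ.- S20) ℤ.+ (M1d ℤ.+ P1 ℤ.- S21))))
         ≡ Dx ℤ.+ P1 ℤ.- C
  upper-identity Dx B C Dd Ee M1d M0d S20 S21 P1 C' Dd' refl refl = rearrange Dx B C Dd Ee M1d M0d S20 S21 P1
    where
    rearrange : ∀ (Dx B C Dd Ee M1d M0d S20 S21 P1 : ℤ) →
          (Dx ℤ.- B ℤ.- C ℤ.- Dd ℤ.+ Ee ℤ.- M1d) ℤ.+ ((C ℤ.- Ee ℤ.+ Dd) ℤ.+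
              ((B ℤ.- S20 ℤ.+ S21) ℤ.+ (M0d ℤ.- (M0d ℤ.+ C ℤ.- S20) ℤ.+ (M1d ℤ.+ P1 ℤ.- S21))))
          ≡ Dx ℤ.+ P1 ℤ.- C
    rearrange = solve-∀

  -- upperSeries = 1 + (xᵖ + x + M) V₁, so Δ · upperSeries = Δ + (xᵖ + x + M)(1 − x + x y), in which
  -- (1 − x) M telescopes.
  reducedDenom·upperSeries : ∀ n k → coeffMul reducedDenom upperSeries n k ≡ coeffMul reducedNumer 𝟙 n k
  reducedDenom·upperSeries n k =
    trans (coeffMul-cong reducedDenom {B = λ n' k' → 𝟙 n' k' ℤ.+ coeffMul firstPartPoly (upperSeries' true) n' k'} upperSeries≈ n k)
    (trans (coeffMul-+ reducedDenom 𝟙 (coeffMul firstPartPoly (upperSeries' true)) n k)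
    (trans (cong (ℤ._+_ (coeffMul reducedDenom 𝟙 n k)) (trans (coeffMul-comm reducedDenom firstPartPoly (upperSeries' true) n k)
        (coeffMul-cong firstPartPoly reducedDenom·upperSeries' n k)))
    (trans (cong₂ ℤ._+_ (coeffMul-reducedDenom 𝟙 n k) (trans (coeffMul-firstPartPoly (coeffMul upperNumer 𝟙) n k)
        (cong₂ ℤ._+_ xᵖ·upperNumer (cong₂ ℤ._+_ x·upperNumer M·upperNumer))))
    (trans (upper-identity (𝟙 n k) (shift 1 0 𝟙 n k) (shift p 0 𝟙 n k) (shift (p + 1) 1 𝟙 n k) (shift (p + 1) 0 𝟙 n k)
        (coeffMul (middlePoly 1) 𝟙 n k) (coeffMul (middlePoly 0) 𝟙 n k) (shift 2 0 𝟙 n k) (shift 2 1 𝟙 n k) (shift p 1 𝟙 n k)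
        (shift (1 + p) 0 𝟙 n k) (shift (1 + p) 1 𝟙 n k) (shift-≡ 𝟙 n k (NP.+-comm 1 p) refl) (shift-≡ 𝟙 n k (NP.+-comm 1 p) refl))
    (sym (coeffMul-reducedNumer 𝟙 n k))))))
    where
    V₁ : Series
    V₁ = upperSeries' true
    upperSeries≈ : upperSeries ≈ (λ n' k' → 𝟙 n' k' ℤ.+ coeffMul firstPartPoly V₁ n' k')
    upperSeries≈ n' k' = trans (upperSeries-rec n' k') (cong (ℤ._+_ (𝟙 n' k'))
        (trans (cong (ℤ._+_ (shift p 0 V₁ n' k')) (ZP.+-comm (coeffMul (middlePoly 0) V₁ n' k') (shift 1 0 V₁ n' k')))
        (sym (coeffMul-firstPartPoly V₁ n' k'))))
    xᵖ·upperNumer : shift p 0 (coeffMul upperNumer 𝟙) n k ≡ shift p 0 𝟙 n k ℤ.- shift (1 + p) 0 𝟙 n k ℤ.+ shift (1 + p) 1 𝟙 n k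
    xᵖ·upperNumer = trans (shift-coeffMul upperNumer p 0 𝟙 n k) (trans (coeffMul-upperNumer (shift p 0 𝟙) n k)
           (cong₂ (λ x y → shift p 0 𝟙 n k ℤ.- x ℤ.+ y) (shift-shift 1 0 p 0 𝟙 n k) (shift-shift 1 1 p 0 𝟙 n k)))
    x·upperNumer : shift 1 0 (coeffMul upperNumer 𝟙) n k ≡ shift 1 0 𝟙 n k ℤ.- shift 2 0 𝟙 n k ℤ.+ shift 2 1 𝟙 n k
    x·upperNumer = trans (shift-coeffMul upperNumer 1 0 𝟙 n k) (trans (coeffMul-upperNumer (shift 1 0 𝟙) n k)
           (cong₂ (λ x y → shift 1 0 𝟙 n k ℤ.- x ℤ.+ y) (shift-shift 1 0 1 0 𝟙 n k) (shift-shift 1 1 1 0 𝟙 n k)))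
    M·upperNumer : coeffMul (middlePoly 0) (coeffMul upperNumer 𝟙) n k ≡ coeffMul (middlePoly 0) 𝟙 n k ℤ.-
        (coeffMul (middlePoly 0) 𝟙 n k ℤ.+ shift p 0 𝟙 n k ℤ.- shift 2 0 𝟙 n k) ℤ.+
        (coeffMul (middlePoly 1) 𝟙 n k ℤ.+ shift p 1 𝟙 n k ℤ.- shift 2 1 𝟙 n k)
    M·upperNumer = trans (coeffMul-comm (middlePoly 0) upperNumer 𝟙 n k) (trans (coeffMul-upperNumer (coeffMul (middlePoly 0) 𝟙) n k)
           (cong₂ (λ x y → coeffMul (middlePoly 0) 𝟙 n k ℤ.- x ℤ.+ y)
               (trans (shift-middlePoly 0 1 0 𝟙 n k) (telescope-middle 0 𝟙 n k))
               (trans (shift-middlePoly 0 1 1 𝟙 n k) (telescope-middle 1 𝟙 n k))))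

  p+1+1≡2+p : p + 1 + 1 ≡ 2 + p
  p+1+1≡2+p = trans (NP.+-comm (p + 1) 1) (cong suc (NP.+-comm p 1))

  coeffMul-denom : ∀ A n k → coeffMul (denom p) A n k ≡
    ((+ 1 ℤ.* A n k ℤ.- + 2 ℤ.* shift 1 0 A n k) ℤ.+ shift (p + 1) 0 A n k) ℤ.-
    (((shift 2 1 A n k ℤ.- shift p 1 A n k ℤ.+ shift (p + 1) 1 A n k) ℤ.- shift (p + 1 + 1) 1 A n k) ℤ.-
     + 1 ℤ.* ((shift 2 0 A n k ℤ.- shift p 0 A n k ℤ.+ shift (p + 1) 0 A n k) ℤ.- shift (p + 1 + 1) 0 A n k))
  coeffMul-denom A n k =
    trans (coeffMul-⊝ L1 YQ A n k)
    (cong₂ ℤ._-_ l1 yq)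
    where
    L1 YQ QQ : Poly
    L1 = cst (+ 1) ⊝ cst (+ 2) ⊛ X ⊕ X ^^ suc p
    QQ = X ^^ 2 ⊝ X ^^ p ⊕ X ^^ suc p ⊝ X ^^ (2 + p)
    YQ = (Y ⊝ cst (+ 1)) ⊛ QQ
    s1 : ∀ j B → shift (suc p) j B n k ≡ shift (p + 1) j B n k
    s1 j B = shift-≡ B n k (NP.+-comm 1 p) refl
    s2 : ∀ j B n' k' → shift (2 + p) j B n' k' ≡ shift (p + 1 + 1) j B n' k'
    s2 j B n' k' = shift-≡ B n' k' (sym p+1+1≡2+p) refl
    l1 : coeffMul L1 A n k ≡ (+ 1 ℤ.* A n k ℤ.- + 2 ℤ.* shift 1 0 A n k) ℤ.+ shift (p + 1) 0 A n k
    l1 = trans (coeffMul-++ (cst (+ 1) ⊝ cst (+ 2) ⊛ X) (X ^^ suc p) A n k)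
          (cong₂ ℤ._+_ (trans (coeffMul-⊝ (cst (+ 1)) (cst (+ 2) ⊛ X) A n k)
                         (cong₂ ℤ._-_ (coeffMul-cst (+ 1) A n k)
                             (trans (coeffMul-⊛ (cst (+ 2)) X A n k)
                             (trans (coeffMul-cst (+ 2) (coeffMul X A) n k) (cong (ℤ._*_ (+ 2)) (coeffMul-xⁱyʲ 1 0 A n k))))))
                       (trans (coeffMul-X^ (suc p) A n k) (s1 0 A)))
    qq : ∀ n' k' → coeffMul QQ A n' k' ≡ (shift 2 0 A n' k' ℤ.- shift p 0 A n' k' ℤ.+ shift (suc p) 0 A n' k') ℤ.- shift (2 + p) 0
        A n' k'
    qq n' k' = trans (coeffMul-⊝ (X ^^ 2 ⊝ X ^^ p ⊕ X ^^ suc p) (X ^^ (2 + p)) A n' k')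
      (cong₂ ℤ._-_ (trans (coeffMul-++ (X ^^ 2 ⊝ X ^^ p) (X ^^ suc p) A n' k')
         (cong₂ ℤ._+_ (trans (coeffMul-⊝ (X ^^ 2) (X ^^ p) A n' k') (cong₂ ℤ._-_ (coeffMul-X^ 2 A n' k') (coeffMul-X^ p A n' k')))
             (coeffMul-X^ (suc p) A n' k')))
       (coeffMul-X^ (2 + p) A n' k'))
    yq : coeffMul YQ A n k ≡ ((shift 2 1 A n k ℤ.- shift p 1 A n k ℤ.+ shift (p + 1) 1 A n k) ℤ.- shift (p + 1 + 1) 1 A n k) ℤ.-
                       + 1 ℤ.* ((shift 2 0 A n k ℤ.- shift p 0 A n k ℤ.+ shift (p + 1) 0 A n k) ℤ.- shift (p + 1 + 1) 0 A n k)
    yq = trans (coeffMul-⊛ (Y ⊝ cst (+ 1)) QQ A n k)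
         (trans (coeffMul-⊝ Y (cst (+ 1)) (coeffMul QQ A) n k)
         (cong₂ ℤ._-_
           (trans (coeffMul-xⁱyʲ 0 1 (coeffMul QQ A) n k)
           (trans (shift-cong 0 1 qq n k)
           (trans (shift-- 0 1 (λ n' k' → shift 2 0 A n' k' ℤ.- shift p 0 A n' k' ℤ.+ shift (suc p) 0 A n' k') (shift (2 + p) 0 A)
               n k)
           (cong₂ ℤ._-_
             (trans (shift-+ 0 1 (λ n' k' → shift 2 0 A n' k' ℤ.- shift p 0 A n' k') (shift (suc p) 0 A) n k)
               (cong₂ ℤ._+_ (trans (shift-- 0 1 (shift 2 0 A) (shift p 0 A) n k)
                   (cong₂ ℤ._-_ (shift-shift 0 1 2 0 A n k) (shift-shift 0 1 p 0 A n k)))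
                   (trans (shift-shift 0 1 (suc p) 0 A n k) (s1 1 A))))
             (trans (shift-shift 0 1 (2 + p) 0 A n k) (s2 1 A n k))))))
           (trans (coeffMul-cst (+ 1) (coeffMul QQ A) n k) (cong (ℤ._*_ (+ 1))
               (trans (qq n k) (cong₂ (λ x y → (shift 2 0 A n k ℤ.- shift p 0 A n k ℤ.+ x) ℤ.- y) (s1 0 A) (s2 0 A n k)))))))

  coeffMul-[1-x]·reducedDenom : ∀ A n k → coeffMul (cst (+ 1) ⊝ X) (coeffMul reducedDenom A) n k ≡
    + 1 ℤ.* (A n k ℤ.- shift 1 0 A n k ℤ.- shift p 0 A n k ℤ.- shift (p + 1) 1 A n k ℤ.+ shift (p + 1) 0 A n k
             ℤ.- coeffMul (middlePoly 1) A n k)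
    ℤ.- (shift 1 0 A n k ℤ.- shift 2 0 A n k ℤ.- shift (p + 1) 0 A n k ℤ.- shift (p + 1 + 1) 1 A n k
         ℤ.+ shift (p + 1 + 1) 0 A n k ℤ.- (coeffMul (middlePoly 1) A n k ℤ.+ shift p 1 A n k ℤ.- shift 2 1 A n k))
  coeffMul-[1-x]·reducedDenom A n k =
    trans (coeffMul-⊝ (cst (+ 1)) X (coeffMul reducedDenom A) n k)
    (cong₂ ℤ._-_ (trans (coeffMul-cst (+ 1) (coeffMul reducedDenom A) n k) (cong (ℤ._*_ (+ 1)) (coeffMul-reducedDenom A n k)))
      (trans (coeffMul-xⁱyʲ 1 0 (coeffMul reducedDenom A) n k)
          (trans (shift-coeffMul reducedDenom 1 0 A n k) (trans (coeffMul-reducedDenom (shift 1 0 A) n k)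
        (cong₂ (λ x y → x ℤ.- y)
          (cong₂ (λ x y → x ℤ.+ y)
            (cong₂ (λ x y → x ℤ.- y)
              (cong₂ (λ x y → shift 1 0 A n k ℤ.- x ℤ.- y) (shift-shift 1 0 1 0 A n k) (shift-shift p 0 1 0 A n k))
              (shift-shift (p + 1) 1 1 0 A n k))
            (shift-shift (p + 1) 0 1 0 A n k))
          (trans (coeffMul-middlePoly 1 (shift 1 0 A) n k) (trans
              (sumOver-cong middleParts middleParts-range (λ f _ → shift-shift f 1 1 0 A n k)) (telescope-middle 1 A n k))))))))

  denom≡[1-x]·reducedDenom : ∀ A n k → coeffMul (denom p) A n k ≡ coeffMul (cst (+ 1) ⊝ X) (coeffMul reducedDenom A) n k
  denom≡[1-x]·reducedDenom A n k = trans (coeffMul-denom A n k)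
      (trans (rearrange (A n k) (shift 1 0 A n k) (shift 2 0 A n k) (shift p 0 A n k) (shift (p + 1) 0 A n k)
                        (shift (p + 1 + 1) 0 A n k) (shift 2 1 A n k) (shift p 1 A n k) (shift (p + 1) 1 A n k)
                        (shift (p + 1 + 1) 1 A n k) (coeffMul (middlePoly 1) A n k))
             (sym (coeffMul-[1-x]·reducedDenom A n k)))
    where
    rearrange : ∀ (a b s20 c₀ c1p c2p s21 p1 d1 d2 m : ℤ) →
      ((+ 1 ℤ.* a ℤ.- + 2 ℤ.* b) ℤ.+ c1p) ℤ.- (((s21 ℤ.- p1 ℤ.+ d1) ℤ.- d2) ℤ.- + 1 ℤ.* ((s20 ℤ.- c₀ ℤ.+ c1p) ℤ.- c2p))
      ≡ + 1 ℤ.* (a ℤ.- b ℤ.- c₀ ℤ.- d1 ℤ.+ c1p ℤ.- m) ℤ.- (b ℤ.- s20 ℤ.- c1p ℤ.- d2 ℤ.+ c2p ℤ.- (m ℤ.+ p1 ℤ.- s21))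
    rearrange = solve-∀

  numer≡[1-x]·reducedNumer : ∀ n k → coeffP (numer p) n k ≡ coeffMul (cst (+ 1) ⊝ X) (coeffMul reducedNumer 𝟙) n k
  numer≡[1-x]·reducedNumer n k = trans (coeffP≡coeffMul-𝟙 (numer p) n k)
      (trans (coeffMul-⊛ (cst (+ 1) ⊝ X) numerFactor 𝟙 n k) (coeffMul-cong (cst (+ 1) ⊝ X) numerFactor≈reducedNumer n k))
    where
    numerFactor : Poly
    numerFactor = cst (+ 1) ⊕ (Y ⊝ cst (+ 1)) ⊛ X ^^ p
    numerFactor≈reducedNumer : ∀ n k → coeffMul numerFactor 𝟙 n k ≡ coeffMul reducedNumer 𝟙 n k
    numerFactor≈reducedNumer n k = trans (coeffMul-++ (cst (+ 1)) ((Y ⊝ cst (+ 1)) ⊛ X ^^ p) 𝟙 n k)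
      (trans (cong₂ ℤ._+_ (coeffMul-cst (+ 1) 𝟙 n k)
        (trans (coeffMul-⊛ (Y ⊝ cst (+ 1)) (X ^^ p) 𝟙 n k)
        (trans (coeffMul-⊝ Y (cst (+ 1)) (coeffMul (X ^^ p) 𝟙) n k)
        (cong₂ ℤ._-_ (trans (coeffMul-xⁱyʲ 0 1 (coeffMul (X ^^ p) 𝟙) n k)
            (trans (shift-cong 0 1 (coeffMul-X^ p 𝟙) n k) (shift-shift 0 1 p 0 𝟙 n k)))
                     (trans (coeffMul-cst (+ 1) (coeffMul (X ^^ p) 𝟙) n k) (cong (ℤ._*_ (+ 1)) (coeffMul-X^ p 𝟙 n k)))))))
      (trans (rearrange (𝟙 n k) (shift p 1 𝟙 n k) (shift p 0 𝟙 n k)) (sym (coeffMul-reducedNumer 𝟙 n k))))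
      where
      rearrange : ∀ (a b c : ℤ) → + 1 ℤ.* a ℤ.+ (b ℤ.- + 1 ℤ.* c) ≡ a ℤ.+ b ℤ.- c
      rearrange = solve-∀

  reducedDenom-XDivisible : XDivisible reducedDenom₊
  reducedDenom-XDivisible =
    s≤s z≤n ∷ 1≤p ∷ NP.m≤n+m 1 p ∷ NP.m≤n+m 1 p ∷
    XDivisible-⊖ (middlePoly 1) (AllP.map⁺ (All.map (λ (2≤f , _) → NP.≤-trans (s≤s z≤n) 2≤f) middleParts-range))
    where
    1≤p : 1 ≤ p
    1≤p = NP.≤-trans (s≤s z≤n) 2≤p

  lowerSeries≈upperSeries : lowerSeries false ≈ upperSeries
  lowerSeries≈upperSeries = coeffMul-1+XDivisible-injective reducedDenom₊ reducedDenom-XDivisible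
    (λ n k → trans (reducedDenom·lowerSeries n k) (sym (reducedDenom·upperSeries n k)))

  lowerSeries-expansion : IsExpansionOf (lowerSeries false) (numer p) (denom p)
  lowerSeries-expansion n k = begin
    coeffMul (denom p) (lowerSeries false) n k
      ≡⟨ denom≡[1-x]·reducedDenom (lowerSeries false) n k ⟩
    coeffMul (cst (+ 1) ⊝ X) (coeffMul reducedDenom (lowerSeries false)) n k
      ≡⟨ coeffMul-cong (cst (+ 1) ⊝ X) reducedDenom·lowerSeries n k ⟩
    coeffMul (cst (+ 1) ⊝ X) (coeffMul reducedNumer 𝟙) n k
      ≡⟨ numer≡[1-x]·reducedNumer n k ⟨
    coeffP (numer p) n k ∎
    where open ≡-Reasoning

corollary2p5 : (p : ℕ) → 2 ≤ p →
    (∀ n k → #withLower p n k ≡ #withUpper p n k)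
    × IsExpansionOf (λ n k → + (#withLower p n k)) (numer p) (denom p)
corollary2p5 p 2≤p = lower≡upper , expansion
  where
  open Covers p 2≤p
  open GeneratingFunctions p 2≤p

  #withLower≈lowerSeries : (λ n k → + #withLower p n k) ≈ lowerSeries false
  #withLower≈lowerSeries n k = cong +_ (#withLower≡count n k)

  lower≡upper : ∀ n k → #withLower p n k ≡ #withUpper p n k
  lower≡upper n k = ZP.+-injective (begin
    + #withLower p n k   ≡⟨ #withLower≈lowerSeries n k ⟩
    lowerSeries false n k ≡⟨ lowerSeries≈upperSeries n k ⟩
    upperSeries n k       ≡⟨ cong +_ (#withUpper≡count n k) ⟨
    + #withUpper p n k   ∎)
    where open ≡-Reasoning

  expansion : IsExpansionOf (λ n k → + #withLower p n k) (numer p) (denom p)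
  expansion n k = trans (coeffMul-cong (denom p) #withLower≈lowerSeries n k) (lowerSeries-expansion n k)
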